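{- $m_2^{(2)}(5,3)=8$.
   Context: For a prime power $q$, integers $0\le r< N$ and $w\ge 0$, $m_q^{(r)}(N,w)$ denotes the maximum total multiplicity of a multiset of points in the projective space $\mathrm{PG}(N,q)$ (a map $\mathcal{M}$ from points to nonnegative integers) such that every $r$-dimensional projective subspace $S$ has multiplicity $\sum_{P\in S}\mathcal{M}(P)\le w$. -}

module Defs where

open import Data.Bool using (Bool; true; false; _∨_; _∧_; _xor_; T)
open import Data.Nat using (ℕ; zero; suc; _+_; _≤_)
open import Data.List using (List; []; _∷_; map; concatMap; filterᵇ)
open import Data.Nat.ListAction using (sum)
open import Relation.Binary.PropositionalEquality using (_≡_)
open import Data.Vec using (Vec; []; _∷_; replicate; zipWith)
open import Data.Product using (Σ; _×_; _,_)

F2Vec : ℕ → Set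
F2Vec n = Vec Bool n

_⊕_ : ∀ {n} → F2Vec n → F2Vec n → F2Vec n
_⊕_ = zipWith _xor_

scale : ∀ {n} → Bool → F2Vec n → F2Vec n
scale a v = Data.Vec.map (a ∧_) v

zeroVec : ∀ {n} → F2Vec n
zeroVec = replicate _ false

isNonzero : ∀ {n} → F2Vec n → Bool
isNonzero []       = false
isNonzero (x ∷ v)  = x ∨ isNonzero v

allVecs : (n : ℕ) → List (F2Vec n)
allVecs zero    = [] ∷ []
allVecs (suc n) = concatMap (λ v → (false ∷ v) ∷ (true ∷ v) ∷ []) (allVecs n)

-- Points of PG(N,2): over F_2 every 1-dim subspace of F_2^(N+1) contains
-- exactly one nonzero vector, so points = nonzero vectors of F_2^(N+1).
points : (N : ℕ) → List (F2Vec (suc N))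
points N = filterᵇ isNonzero (allVecs (suc N))

combo : ∀ {k n} → Vec Bool k → Vec (F2Vec n) k → F2Vec n
combo []       []       = zeroVec
combo (c ∷ cs) (b ∷ bs) = scale c b ⊕ combo cs bs

LinIndep : ∀ {k n} → Vec (F2Vec n) k → Set
LinIndep {k} B = (c : Vec Bool k) → T (isNonzero c) → T (isNonzero (combo c B))

-- A multiset of points of PG(N,2): multiplicity function on F_2^(N+1)
-- (only its values on nonzero vectors, i.e. points, are ever used).
Multiset : ℕ → Set
Multiset N = F2Vec (suc N) → ℕ

totalMult : ∀ {N} → Multiset N → ℕ
totalMult {N} M = sum (map M (points N))

-- multiplicity of the r-dim projective subspace spanned by the
-- independent family B of r+1 vectors: sum of M over its points, i.e.
-- over the nonzero combinations (distinct by independence).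
subspaceMult : ∀ {N r} → Multiset N → Vec (F2Vec (suc N)) (suc r) → ℕ
subspaceMult {N} {r} M B =
  sum (map (λ c → M (combo c B)) (filterᵇ isNonzero (allVecs (suc r))))

Admissible : (N r w : ℕ) → Multiset N → Set
Admissible N r w M =
  (B : Vec (F2Vec (suc N)) (suc r)) → LinIndep B → subspaceMult M B ≤ w

IsM2 : (r N w m : ℕ) → Set
IsM2 r N w m =
  Σ (Multiset N) (λ M → Admissible N r w M × totalMult M ≡ m)
  × ((M : Multiset N) → Admissible N r w M → totalMult M ≤ m)

-- Lower bound: the eight points e₁, …, e₆, e₁+e₂+e₃+e₄, e₁+e₂+e₅+e₆ of PG(5,2) contain no three
-- collinear and no four coplanar points, and in a Fano plane any four points contain a line or
-- a quadrangle (x, y, z, x+y+z), so every plane meets them in at most three points.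
--
-- Upper bound: an exhaustive search modulo GL(6,2). A node is a set A of points assumed to have
-- positive multiplicity. Every point p either lies on a plane that bounds M(p) by 3 minus the
-- number of other points of A on it, or an automorphism carries the set of a later node into
-- A ∪ {p}, so that M(p) > 0 is already handled there. At every node the bounds add up to at
-- most 8, and the root A = ∅ covers every admissible multiset.
module Submission where

open import Defs
open import Data.Bool using (Bool; true; false; _∧_; _xor_; T; if_then_else_)
import Data.Bool
open import Data.Bool.Properties
  using (xor-assoc; xor-comm; xor-identityˡ; xor-identityʳ; xor-same; ∧-identityʳ; ∧-assoc;
         ∧-distribˡ-xor; ∧-distribʳ-xor)
open import Data.Empty using (⊥-elim)
open import Data.List using (List; []; _∷_; map; concatMap; filter; filterᵇ; length; zipWith)
import Data.List.Properties as List
open import Data.List.Membership.Propositional using (_∈_)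
open import Data.List.Membership.Propositional.Properties
  using (∈-concatMap⁺; ∈-concatMap⁻; ∈-filter⁺; ∈-filter⁻; ∈-map⁺; ∈-map⁻)
open import Data.List.Membership.Propositional.Properties.WithK using (unique∧set⇒bag)
open import Data.List.Relation.Binary.BagAndSetEquality using (∼bag⇒↭)
open import Data.List.Relation.Binary.Permutation.Propositional using (_↭_)
import Data.List.Relation.Binary.Permutation.Propositional.Properties as Perm
open import Data.List.Relation.Binary.Pointwise using (Pointwise; []; _∷_)
import Data.List.Relation.Binary.Pointwise as Pointwise
open import Data.List.Relation.Unary.All as All using (All; []; _∷_)
import Data.List.Relation.Unary.All.Properties as All
open import Data.List.Relation.Unary.AllPairs using ([]; _∷_)
open import Data.List.Relation.Unary.Any as Any using (Any; here; there)
import Data.List.Relation.Unary.Any.Properties as Anyₚ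
open import Data.List.Relation.Unary.Unique.Propositional using (Unique)
import Data.List.Relation.Unary.Unique.Propositional.Properties as Unique
open import Data.Nat using (ℕ; zero; suc; _+_; _∸_; _≤_; _≤?_; _≡ᵇ_; _%_; _/_; z≤n; s≤s)
import Data.Nat as ℕ
open import Data.Nat.ListAction using (sum)
open import Data.Nat.ListAction.Properties using (sum-↭)
open import Data.Nat.Properties
  using (≤-trans; ≤-reflexive; +-mono-≤; +-monoʳ-≤; +-suc; m≤n+m; m+n≤o⇒m≤o∸n; module ≤-Reasoning)
open import Data.Product using (_×_; _,_; proj₂)
open import Data.Sum using (_⊎_; inj₁; inj₂)
import Data.Sum as Sum
open import Data.Unit using (⊤; tt)
open import Data.Vec using (Vec; []; _∷_)
import Data.Vec as Vec
import Data.Vec.Properties as Vec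
open import Function using (_∘_; const)
open import Function.Bundles using (mk⇔)
open import Relation.Binary.Definitions using (DecidableEquality)
open import Relation.Binary.PropositionalEquality
open import Relation.Nullary using (Dec; yes; no; ¬_; ¬?)
open import Relation.Nullary.Decidable using (⌊_⌋; T?; toWitness; _×-dec_; _⊎-dec_; _→-dec_)
import Relation.Nullary.Decidable as Dec

private
  variable
    k m n : ℕ

-- Linear algebra over 𝔽₂

⊕-assoc : (u v w : F2Vec n) → (u ⊕ v) ⊕ w ≡ u ⊕ (v ⊕ w)
⊕-assoc = Vec.zipWith-assoc xor-assoc

⊕-comm : (u v : F2Vec n) → u ⊕ v ≡ v ⊕ u
⊕-comm = Vec.zipWith-comm xor-comm

⊕-identityˡ : (v : F2Vec n) → zeroVec ⊕ v ≡ v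
⊕-identityˡ = Vec.zipWith-identityˡ xor-identityˡ

⊕-same : (v : F2Vec n) → v ⊕ v ≡ zeroVec
⊕-same []      = refl
⊕-same (x ∷ v) = cong₂ _∷_ (xor-same x) (⊕-same v)

⊕≡zeroVec⇒≡ : (u v : F2Vec n) → u ⊕ v ≡ zeroVec → u ≡ v
⊕≡zeroVec⇒≡ []          []          _  = refl
⊕≡zeroVec⇒≡ (false ∷ u) (false ∷ v) eq = cong (false ∷_) (⊕≡zeroVec⇒≡ u v (cong Vec.tail eq))
⊕≡zeroVec⇒≡ (true  ∷ u) (true  ∷ v) eq = cong (true ∷_)  (⊕≡zeroVec⇒≡ u v (cong Vec.tail eq))

⊕-interchange : (u v w x : F2Vec n) → (u ⊕ v) ⊕ (w ⊕ x) ≡ (u ⊕ w) ⊕ (v ⊕ x)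
⊕-interchange u v w x = begin
  (u ⊕ v) ⊕ (w ⊕ x)  ≡⟨ ⊕-assoc u v (w ⊕ x) ⟩
  u ⊕ (v ⊕ (w ⊕ x))  ≡⟨ cong (u ⊕_) (⊕-assoc v w x) ⟨
  u ⊕ ((v ⊕ w) ⊕ x)  ≡⟨ cong (λ y → u ⊕ (y ⊕ x)) (⊕-comm v w) ⟩
  u ⊕ ((w ⊕ v) ⊕ x)  ≡⟨ cong (u ⊕_) (⊕-assoc w v x) ⟩
  u ⊕ (w ⊕ (v ⊕ x))  ≡⟨ ⊕-assoc u w (v ⊕ x) ⟨
  (u ⊕ w) ⊕ (v ⊕ x)  ∎
  where open ≡-Reasoning

_≟ᵥ_ : DecidableEquality (F2Vec n)
_≟ᵥ_ = Vec.≡-dec Data.Bool._≟_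

nonzero⇒≢zeroVec : (v : F2Vec n) → T (isNonzero v) → v ≢ zeroVec
nonzero⇒≢zeroVec (true  ∷ v) _  ()
nonzero⇒≢zeroVec (false ∷ v) nz refl = nonzero⇒≢zeroVec v nz refl

≢zeroVec⇒nonzero : (v : F2Vec n) → v ≢ zeroVec → T (isNonzero v)
≢zeroVec⇒nonzero []          v≢0 = v≢0 refl
≢zeroVec⇒nonzero (true  ∷ v) v≢0 = tt
≢zeroVec⇒nonzero (false ∷ v) v≢0 = ≢zeroVec⇒nonzero v (v≢0 ∘ cong (false ∷_))

scale-false : (v : F2Vec n) → scale false v ≡ zeroVec
scale-false []      = refl
scale-false (x ∷ v) = cong (false ∷_) (scale-false v)

scale-zeroVec : ∀ a → scale a (zeroVec {n}) ≡ zeroVec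
scale-zeroVec {zero}  a     = refl
scale-zeroVec {suc n} false = cong (false ∷_) (scale-zeroVec false)
scale-zeroVec {suc n} true  = cong (false ∷_) (scale-zeroVec true)

scale-distrib-⊕ : ∀ a (u v : F2Vec n) → scale a (u ⊕ v) ≡ scale a u ⊕ scale a v
scale-distrib-⊕ a []      []      = refl
scale-distrib-⊕ a (x ∷ u) (y ∷ v) = cong₂ _∷_ (∧-distribˡ-xor a x y) (scale-distrib-⊕ a u v)

scale-distrib-xor : ∀ a b (v : F2Vec n) → scale (a xor b) v ≡ scale a v ⊕ scale b v
scale-distrib-xor a b []      = refl
scale-distrib-xor a b (x ∷ v) = cong₂ _∷_ (∧-distribʳ-xor x a b) (scale-distrib-xor a b v)

scale-scale : ∀ a b (v : F2Vec n) → scale a (scale b v) ≡ scale (a ∧ b) v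
scale-scale a b []      = refl
scale-scale a b (x ∷ v) = cong₂ _∷_ (sym (∧-assoc a b x)) (scale-scale a b v)

combo-zeroVec : (B : Vec (F2Vec n) k) → combo zeroVec B ≡ zeroVec
combo-zeroVec []      = refl
combo-zeroVec (b ∷ B) = begin
  scale false b ⊕ combo zeroVec B  ≡⟨ cong₂ _⊕_ (scale-false b) (combo-zeroVec B) ⟩
  zeroVec ⊕ zeroVec                ≡⟨ ⊕-identityˡ zeroVec ⟩
  zeroVec                          ∎
  where open ≡-Reasoning

combo-⊕ : (c d : F2Vec k) (B : Vec (F2Vec n) k) → combo (c ⊕ d) B ≡ combo c B ⊕ combo d B
combo-⊕ []      []      []      = sym (⊕-identityˡ zeroVec)
combo-⊕ (a ∷ c) (b ∷ d) (x ∷ B) = begin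
  scale (a xor b) x ⊕ combo (c ⊕ d) B
    ≡⟨ cong₂ _⊕_ (scale-distrib-xor a b x) (combo-⊕ c d B) ⟩
  (scale a x ⊕ scale b x) ⊕ (combo c B ⊕ combo d B)
    ≡⟨ ⊕-interchange (scale a x) (scale b x) (combo c B) (combo d B) ⟩
  (scale a x ⊕ combo c B) ⊕ (scale b x ⊕ combo d B)
    ∎
  where open ≡-Reasoning

combo-scale : ∀ a (c : F2Vec k) (B : Vec (F2Vec n) k) → combo (scale a c) B ≡ scale a (combo c B)
combo-scale a []      []      = sym (scale-zeroVec a)
combo-scale a (b ∷ c) (x ∷ B) = begin
  scale (a ∧ b) x ⊕ combo (scale a c) B      ≡⟨ cong₂ _⊕_ (sym (scale-scale a b x)) (combo-scale a c B) ⟩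
  scale a (scale b x) ⊕ scale a (combo c B)  ≡⟨ scale-distrib-⊕ a (scale b x) (combo c B) ⟨
  scale a (scale b x ⊕ combo c B)            ∎
  where open ≡-Reasoning

combo-map-false∷ : (c : F2Vec k) (B : Vec (F2Vec n) k) → combo c (Vec.map (false ∷_) B) ≡ false ∷ combo c B
combo-map-false∷ []          []      = refl
combo-map-false∷ (false ∷ c) (x ∷ B) = cong (scale false (false ∷ x) ⊕_) (combo-map-false∷ c B)
combo-map-false∷ (true  ∷ c) (x ∷ B) = cong (scale true  (false ∷ x) ⊕_) (combo-map-false∷ c B)

combo-injective : (B : Vec (F2Vec n) k) → LinIndep B → ∀ c d → combo c B ≡ combo d B → c ≡ d
combo-injective B independent c d eq with c ≟ᵥ d
... | yes c≡d = c≡d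
... | no  c≢d = ⊥-elim (nonzero⇒≢zeroVec (combo (c ⊕ d) B) (independent (c ⊕ d) c⊕d-nonzero) (begin
  combo (c ⊕ d) B        ≡⟨ combo-⊕ c d B ⟩
  combo c B ⊕ combo d B  ≡⟨ cong (combo c B ⊕_) eq ⟨
  combo c B ⊕ combo c B  ≡⟨ ⊕-same (combo c B) ⟩
  zeroVec                ∎))
  where
  open ≡-Reasoning
  c⊕d-nonzero : T (isNonzero (c ⊕ d))
  c⊕d-nonzero = ≢zeroVec⇒nonzero (c ⊕ d) (c≢d ∘ ⊕≡zeroVec⇒≡ c d)

infixr 25 _·_
_·_ : Vec (F2Vec m) n → F2Vec n → F2Vec m
G · v = combo v G

_⊙_ : Vec (F2Vec m) n → Vec (F2Vec n) k → Vec (F2Vec m) k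
H ⊙ G = Vec.map (H ·_) G

identity : Vec (F2Vec n) n
identity {zero}  = []
identity {suc n} = (true ∷ zeroVec) ∷ Vec.map (false ∷_) identity

·-combo : (G : Vec (F2Vec m) n) (c : F2Vec k) (B : Vec (F2Vec n) k) → G · combo c B ≡ combo c (G ⊙ B)
·-combo G []      []      = combo-zeroVec G
·-combo G (a ∷ c) (x ∷ B) = begin
  G · (scale a x ⊕ combo c B)        ≡⟨ combo-⊕ (scale a x) (combo c B) G ⟩
  G · scale a x ⊕ G · combo c B      ≡⟨ cong₂ _⊕_ (combo-scale a x G) (·-combo G c B) ⟩
  scale a (G · x) ⊕ combo c (G ⊙ B)  ∎
  where open ≡-Reasoning

identity-· : (v : F2Vec n) → identity · v ≡ v
identity-· []      = refl
identity-· (a ∷ v) = begin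
  scale a (true ∷ zeroVec) ⊕ combo v (Vec.map (false ∷_) identity)
    ≡⟨ cong (scale a (true ∷ zeroVec) ⊕_) (combo-map-false∷ v identity) ⟩
  (a ∧ true ∷ scale a zeroVec) ⊕ (false ∷ identity · v)
    ≡⟨ cong₂ (λ b u → (b xor false) ∷ (u ⊕ identity · v)) (∧-identityʳ a) (scale-zeroVec a) ⟩
  (a xor false) ∷ (zeroVec ⊕ identity · v)
    ≡⟨ cong₂ _∷_ (xor-identityʳ a) (trans (⊕-identityˡ _) (identity-· v)) ⟩
  a ∷ v
    ∎
  where open ≡-Reasoning

⊙≡identity⇒inverse : (H : Vec (F2Vec n) m) (G : Vec (F2Vec m) n) → H ⊙ G ≡ identity →
                     ∀ v → H · G · v ≡ v
⊙≡identity⇒inverse H G HG≡I v = begin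
  H · G · v     ≡⟨ ·-combo H v G ⟩
  (H ⊙ G) · v   ≡⟨ cong (_· v) HG≡I ⟩
  identity · v  ≡⟨ identity-· v ⟩
  v             ∎
  where open ≡-Reasoning

·-nonzero : (G : Vec (F2Vec m) n) (H : Vec (F2Vec n) m) → (∀ v → H · G · v ≡ v) →
            ∀ v → T (isNonzero v) → T (isNonzero (G · v))
·-nonzero G H HG v nz = ≢zeroVec⇒nonzero (G · v) λ Gv≡0 → nonzero⇒≢zeroVec v nz (begin
  v            ≡⟨ HG v ⟨
  H · G · v    ≡⟨ cong (H ·_) Gv≡0 ⟩
  H · zeroVec  ≡⟨ combo-zeroVec H ⟩
  zeroVec      ∎)
  where open ≡-Reasoning

-- Enumerating 𝔽₂ⁿ and the points of PG(N,2)

∈-allVecs : (v : F2Vec n) → v ∈ allVecs n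
∈-allVecs []      = here refl
∈-allVecs (b ∷ v) =
  ∈-concatMap⁺ (λ u → (false ∷ u) ∷ (true ∷ u) ∷ []) (Any.map (λ { refl → ∈-pair b }) (∈-allVecs v))
  where
  ∈-pair : ∀ b → b ∷ v ∈ (false ∷ v) ∷ (true ∷ v) ∷ []
  ∈-pair false = here refl
  ∈-pair true  = there (here refl)

allVecs-unique : (n : ℕ) → Unique (allVecs n)
allVecs-unique zero    = [] ∷ []
allVecs-unique (suc n) = pairs-unique (allVecs-unique n)
  where
  pair : F2Vec n → List (F2Vec (suc n))
  pair v = (false ∷ v) ∷ (true ∷ v) ∷ []

  tail-∈ : ∀ {u xs} → u ∈ concatMap pair xs → Vec.tail u ∈ xs
  tail-∈ u∈ = Any.map (λ { (here refl) → refl ; (there (here refl)) → refl }) (∈-concatMap⁻ pair u∈)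

  pairs-unique : ∀ {xs} → Unique xs → Unique (concatMap pair xs)
  pairs-unique                []              = []
  pairs-unique {xs = v ∷ xs} (v∉xs ∷ unique) = ((λ ()) ∷ fresh) ∷ fresh ∷ pairs-unique unique
    where
    fresh : ∀ {b} → All (b ∷ v ≢_) (concatMap pair xs)
    fresh = All.tabulate λ u∈ b∷v≡u → All.lookup v∉xs (tail-∈ u∈) (cong Vec.tail b∷v≡u)

∈-points : ∀ {N} (v : F2Vec (suc N)) → T (isNonzero v) → v ∈ points N
∈-points v = ∈-filter⁺ (T? ∘ isNonzero) (∈-allVecs v)

points-nonzero : ∀ {N v} → v ∈ points N → T (isNonzero v)
points-nonzero {N} = proj₂ ∘ ∈-filter⁻ (T? ∘ isNonzero) {xs = allVecs (suc N)}

points-unique : (N : ℕ) → Unique (points N)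
points-unique N = Unique.filter⁺ (T? ∘ isNonzero) (allVecs-unique (suc N))

∀? : {P : F2Vec n → Set} → (∀ v → Dec (P v)) → Dec (∀ v → P v)
∀? {n} P? = Dec.map′ (λ all v → All.lookup all (∈-allVecs v)) (λ ∀P → All.tabulate λ {v} _ → ∀P v)
                     (All.all? P? (allVecs n))

linIndep? : (B : Vec (F2Vec n) k) → Dec (LinIndep B)
linIndep? B = ∀? λ c → T? (isNonzero c) →-dec T? (isNonzero (combo c B))

infix 4 _∈?_
_∈?_ : (v : F2Vec n) (vs : List (F2Vec n)) → Dec (v ∈ vs)
v ∈? vs = Any.any? (v ≟ᵥ_) vs

-- The action of GL(N+1,2)

module _ {N : ℕ} (G H : Vec (F2Vec (suc N)) (suc N)) (HG : ∀ v → H · G · v ≡ v) where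

  Admissible-∘ : ∀ {r w} (M : Multiset N) → Admissible N r w M → Admissible N r w (M ∘ (G ·_))
  Admissible-∘ {r} {w} M admissible B independent =
    subst (_≤ w) (sym mult≡) (admissible (G ⊙ B) independent′)
    where
    mult≡ : subspaceMult (M ∘ (G ·_)) B ≡ subspaceMult M (G ⊙ B)
    mult≡ = cong sum (List.map-cong (λ c → cong M (·-combo G c B)) (filterᵇ isNonzero (allVecs (suc r))))

    independent′ : LinIndep (G ⊙ B)
    independent′ c nz = subst (T ∘ isNonzero) (·-combo G c B) (·-nonzero G H HG (combo c B) (independent c nz))

  totalMult-∘ : (∀ v → G · H · v ≡ v) → (M : Multiset N) → totalMult (M ∘ (G ·_)) ≡ totalMult M
  totalMult-∘ GH M = begin
    sum (map (M ∘ (G ·_)) (points N))    ≡⟨ cong sum (List.map-∘ (points N)) ⟩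
    sum (map M (map (G ·_) (points N)))  ≡⟨ sum-↭ (Perm.map⁺ M permutes) ⟩
    sum (map M (points N))               ∎
    where
    open ≡-Reasoning
    injective : ∀ {u v} → G · u ≡ G · v → u ≡ v
    injective {u} {v} eq = trans (sym (HG u)) (trans (cong (H ·_) eq) (HG v))

    image⊆ : ∀ {v} → v ∈ map (G ·_) (points N) → v ∈ points N
    image⊆ v∈ with ∈-map⁻ (G ·_) v∈
    ... | u , u∈ , refl = ∈-points (G · u) (·-nonzero G H HG u (points-nonzero u∈))

    ⊆image : ∀ {v} → v ∈ points N → v ∈ map (G ·_) (points N)
    ⊆image {v} v∈ = subst (_∈ map (G ·_) (points N)) (GH v)
      (∈-map⁺ (G ·_) (∈-points (H · v) (·-nonzero H G GH v (points-nonzero v∈))))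

    permutes : map (G ·_) (points N) ↭ points N
    permutes = ∼bag⇒↭ (unique∧set⇒bag (Unique.map⁺ injective (points-unique N)) (points-unique N)
                                      (mk⇔ image⊆ ⊆image))

-- Certified exhaustive search

count≤sum : ∀ {A : Set} {P : A → Set} (P? : ∀ q → Dec (P q)) (M : A → ℕ) →
            (∀ {q} → P q → 1 ≤ M q) → ∀ L → length (filter P? L) ≤ sum (map M L)
count≤sum P? M positive []      = z≤n
count≤sum P? M positive (q ∷ L) with P? q
... | yes Pq = +-mono-≤ (positive Pq) (count≤sum P? M positive L)
... | no  _  = ≤-trans (count≤sum P? M positive L) (m≤n+m _ (M q))

mult+count≤sum : ∀ {A : Set} {P : A → Set} (P? : ∀ q → Dec (P q)) (M : A → ℕ) →
                 (∀ {q} → P q → 1 ≤ M q) → ∀ {p L} → ¬ P p → p ∈ L →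
                 M p + length (filter P? L) ≤ sum (map M L)
mult+count≤sum P? M positive {p} {p ∷ L} ¬Pp (here refl) with P? p
... | yes Pp = ⊥-elim (¬Pp Pp)
... | no  _  = +-monoʳ-≤ (M p) (count≤sum P? M positive L)
mult+count≤sum P? M positive {p} {q ∷ L} ¬Pp (there p∈L) with P? q
... | yes Pq = ≤-trans (≤-reflexive (+-suc (M p) _))
                       (+-mono-≤ (positive Pq) (mult+count≤sum P? M positive ¬Pp p∈L))
... | no  _  = ≤-trans (mult+count≤sum P? M positive ¬Pp p∈L) (m≤n+m _ (M q))

-- Points are written as numbers whose binary digits, least significant first, are the coordinates.
bits : (n : ℕ) → ℕ → F2Vec n
bits zero    x = []
bits (suc n) x = (x % 2 ≡ᵇ 1) ∷ bits n (x / 2)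

module Search (N r w m : ℕ) where

  Point : Set
  Point = F2Vec (suc N)

  -- For the point p at a node with set A: r+1 vectors spanning a subspace through p, or an
  -- automorphism G, its inverse, and the set of a later node that G maps into p ∷ A.
  data Certificate : Set where
    subspace  : Vec ℕ (suc r) → Certificate
    transform : Vec ℕ (suc N) → Vec ℕ (suc N) → List ℕ → Certificate

  -- The i-th certificate is for the i-th entry of `points N`, the point with code i + 1.
  record Node : Set where
    constructor node
    field
      support      : List ℕ
      certificates : List Certificate

  open Node public

  decode : List ℕ → List Point
  decode = map (bits (suc N))

  decodeᵥ : Vec ℕ k → Vec Point k
  decodeᵥ = Vec.map (bits (suc N))

  Positive : Multiset N → List Point → Set
  Positive M A = All (λ a → 1 ≤ M a) A

  Bounded : List Point → Set
  Bounded A = ∀ M → Admissible N r w M → Positive M A → totalMult M ≤ m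

  BoundedNode : Node → Set
  BoundedNode = Bounded ∘ decode ∘ support

  subspacePoints : Vec Point (suc r) → List Point
  subspacePoints B = map (λ c → combo c B) (filterᵇ isNonzero (allVecs (suc r)))

  subspaceMult≡ : ∀ M B → subspaceMult M B ≡ sum (map M (subspacePoints B))
  subspaceMult≡ M B = cong sum (List.map-∘ (filterᵇ isNonzero (allVecs (suc r))))

  otherIn? : (A : List Point) (p q : Point) → Dec (q ≢ p × q ∈ A)
  otherIn? A p q = ¬? (q ≟ᵥ p) ×-dec q ∈? A

  bound : List Point → Point → Certificate → ℕ
  bound A p (subspace bs)     = w ∸ length (filter (otherIn? A p) (subspacePoints (decodeᵥ bs)))
  bound A p (transform _ _ _) = 0

  Valid : List Node → List Point → Point → Certificate → Set
  Valid later A p (subspace bs)        = LinIndep (decodeᵥ bs) × p ∈ subspacePoints (decodeᵥ bs)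
  Valid later A p (transform gs hs A′) =
    A′ ∈ map support later × H ⊙ G ≡ identity × G ⊙ H ≡ identity ×
    All (λ a → G · a ∈ p ∷ A) (decode A′)
    where
    G = decodeᵥ gs
    H = decodeᵥ hs

  valid? : ∀ later A p c → Dec (Valid later A p c)
  valid? later A p (subspace bs)        = linIndep? (decodeᵥ bs) ×-dec p ∈? subspacePoints (decodeᵥ bs)
  valid? later A p (transform gs hs A′) =
    Any.any? (List.≡-dec ℕ._≟_ A′) (map support later) ×-dec
    Vec.≡-dec _≟ᵥ_ (H ⊙ G) identity ×-dec
    Vec.≡-dec _≟ᵥ_ (G ⊙ H) identity ×-dec
    All.all? (λ a → G · a ∈? p ∷ A) (decode A′)
    where
    G = decodeᵥ gs
    H = decodeᵥ hs

  certificate-sound : ∀ {later A p} c → All BoundedNode later → Valid later A p c →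
                      ∀ M → Admissible N r w M → Positive M A → M p ≤ bound A p c ⊎ totalMult M ≤ m
  certificate-sound {A = A} {p} (subspace bs) _ (independent , p∈B) M admissible positive =
    inj₁ (m+n≤o⇒m≤o∸n (M p) (begin
      M p + length (filter (otherIn? A p) (subspacePoints B))
        ≤⟨ mult+count≤sum (otherIn? A p) M (λ (_ , q∈A) → All.lookup positive q∈A)
                          (λ (p≢p , _) → p≢p refl) p∈B ⟩
      sum (map M (subspacePoints B))
        ≡⟨ subspaceMult≡ M B ⟨
      subspaceMult M B
        ≤⟨ admissible B independent ⟩
      w ∎))
    where
    open ≤-Reasoning
    B = decodeᵥ bs
  certificate-sound {A = A} {p} (transform gs hs A′) bounded (A′∈ , HG≡I , GH≡I , G[A′]⊆)
                    M admissible positive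
    with M p in Mp≡
  ... | zero  = inj₁ z≤n
  ... | suc _ = inj₂ (begin
      totalMult M             ≡⟨ totalMult-∘ G H HG GH M ⟨
      totalMult (M ∘ (G ·_))  ≤⟨ bounded′ (M ∘ (G ·_)) (Admissible-∘ G H HG M admissible) positive′ ⟩
      m                       ∎)
    where
    open ≤-Reasoning
    G = decodeᵥ gs
    H = decodeᵥ hs
    HG = ⊙≡identity⇒inverse H G HG≡I
    GH = ⊙≡identity⇒inverse G H GH≡I

    bounded′ : Bounded (decode A′)
    bounded′ = All.lookup (All.map⁺ bounded) A′∈

    positive′ : Positive (M ∘ (G ·_)) (decode A′)
    positive′ = All.map (λ { (here refl)  → subst (1 ≤_) (sym Mp≡) (s≤s z≤n)
                           ; (there Ga∈A) → All.lookup positive Ga∈A }) G[A′]⊆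

  certificates-sound : ∀ {later A ps cs} → All BoundedNode later → Pointwise (Valid later A) ps cs →
                       ∀ M → Admissible N r w M → Positive M A →
                       sum (map M ps) ≤ sum (zipWith (bound A) ps cs) ⊎ totalMult M ≤ m
  certificates-sound bounded [] M admissible positive = inj₁ z≤n
  certificates-sound bounded (_∷_ {y = c} valid valids) M admissible positive
    with certificate-sound c bounded valid M admissible positive
       | certificates-sound bounded valids M admissible positive
  ... | inj₁ Mp≤ | inj₁ rest≤ = inj₁ (+-mono-≤ Mp≤ rest≤)
  ... | inj₂ done | _         = inj₂ done
  ... | inj₁ _    | inj₂ done = inj₂ done

  NodeValid : List Node → Node → Set
  NodeValid later n = Pointwise (Valid later A) (points N) (certificates n) ×
                      sum (zipWith (bound A) (points N) (certificates n)) ≤ m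
    where A = decode (support n)

  nodeValid? : ∀ later n → Dec (NodeValid later n)
  nodeValid? later n = Pointwise.decidable (valid? later A) (points N) (certificates n) ×-dec
                       sum (zipWith (bound A) (points N) (certificates n)) ≤? m
    where A = decode (support n)

  node-sound : ∀ {later} n → All BoundedNode later → NodeValid later n → BoundedNode n
  node-sound n bounded (valids , sum≤m) M admissible positive
    with certificates-sound bounded valids M admissible positive
  ... | inj₁ total≤ = ≤-trans total≤ sum≤m
  ... | inj₂ done   = done

  Certified : List Node → Set
  Certified []          = ⊤
  Certified (n ∷ later) = NodeValid later n × Certified later

  certified? : ∀ nodes → Dec (Certified nodes)
  certified? []          = yes tt
  certified? (n ∷ later) = nodeValid? later n ×-dec certified? later

  certified-sound : ∀ nodes → Certified nodes → All BoundedNode nodes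
  certified-sound []          tt                  = []
  certified-sound (n ∷ later) (valid , certified) =
    node-sound n (certified-sound later certified) valid ∷ certified-sound later certified

  certified⇒bounded : ∀ {cs later} → Certified (node [] cs ∷ later) →
                      ∀ M → Admissible N r w M → totalMult M ≤ m
  certified⇒bounded {cs} {later} certified M admissible =
    All.head (certified-sound (node [] cs ∷ later) certified) M admissible []

-- Sets meeting every plane in at most three points

LineFree : (F2Vec n → Bool) → Set
LineFree S = ∀ x y → T (S x) → T (S y) → T (S (x ⊕ y)) → x ≡ y

-- For distinct non-collinear x, y, z, the points x, y, z, x ⊕ y ⊕ z form a quadrangle of a plane.
QuadrangleFree : (F2Vec n → Bool) → Set
QuadrangleFree S =
  ∀ x y z → T (S x) → T (S y) → T (S z) → T (S ((x ⊕ y) ⊕ z)) → x ≡ y ⊎ x ≡ z ⊎ y ≡ z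

lineFree? : (S : F2Vec n → Bool) → Dec (LineFree S)
lineFree? S = ∀? λ x → ∀? λ y → T? (S x) →-dec T? (S y) →-dec T? (S (x ⊕ y)) →-dec x ≟ᵥ y

quadrangleFree? : (S : F2Vec n → Bool) → Dec (QuadrangleFree S)
quadrangleFree? S = ∀? λ x → ∀? λ y → ∀? λ z →
  T? (S x) →-dec T? (S y) →-dec T? (S z) →-dec T? (S ((x ⊕ y) ⊕ z)) →-dec
  (x ≟ᵥ y ⊎-dec x ≟ᵥ z ⊎-dec y ≟ᵥ z)

LineFree-≗ : {S S′ : F2Vec n → Bool} → S ≗ S′ → LineFree S′ → LineFree S
LineFree-≗ eq free x y Sx Sy Sxy = free x y (subst T (eq x) Sx) (subst T (eq y) Sy) (subst T (eq (x ⊕ y)) Sxy)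

QuadrangleFree-≗ : {S S′ : F2Vec n → Bool} → S ≗ S′ → QuadrangleFree S′ → QuadrangleFree S
QuadrangleFree-≗ eq free x y z Sx Sy Sz Sxyz =
  free x y z (subst T (eq x) Sx) (subst T (eq y) Sy) (subst T (eq z) Sz) (subst T (eq ((x ⊕ y) ⊕ z)) Sxyz)

module _ (B : Vec (F2Vec n) k) (independent : LinIndep B) {S : F2Vec n → Bool} where

  private
    injective : ∀ c d → combo c B ≡ combo d B → c ≡ d
    injective = combo-injective B independent

  LineFree-∘combo : LineFree S → LineFree (λ c → S (combo c B))
  LineFree-∘combo free c d Sc Sd Sc⊕d =
    injective c d (free (combo c B) (combo d B) Sc Sd (subst (T ∘ S) (combo-⊕ c d B) Sc⊕d))

  QuadrangleFree-∘combo : QuadrangleFree S → QuadrangleFree (λ c → S (combo c B))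
  QuadrangleFree-∘combo free c d e Sc Sd Se Sc⊕d⊕e =
    Sum.map (injective c d) (Sum.map (injective c e) (injective d e))
      (free (combo c B) (combo d B) (combo e B) Sc Sd Se (subst (T ∘ S) combo-⊕₃ Sc⊕d⊕e))
    where
    combo-⊕₃ : combo ((c ⊕ d) ⊕ e) B ≡ (combo c B ⊕ combo d B) ⊕ combo e B
    combo-⊕₃ = trans (combo-⊕ (c ⊕ d) e B) (cong (_⊕ combo e B) (combo-⊕ c d B))

glue : (F2Vec n → Bool) → (F2Vec n → Bool) → F2Vec (suc n) → Bool
glue f g (false ∷ v) = f v
glue f g (true  ∷ v) = g v

boolFunctions : (n : ℕ) → List (F2Vec n → Bool)
boolFunctions zero    = const false ∷ const true ∷ []
boolFunctions (suc n) = concatMap (λ f → map (glue f) (boolFunctions n)) (boolFunctions n)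

boolFunctions-complete : (S : F2Vec n → Bool) → Any (_≗ S) (boolFunctions n)
boolFunctions-complete {zero} S with S [] in eq
... | false = here  λ { [] → sym eq }
... | true  = there (here λ { [] → sym eq })
boolFunctions-complete {suc n} S =
  Anyₚ.concatMap⁺ (λ f → map (glue f) (boolFunctions n))
    (Any.map (λ f≗ → Anyₚ.map⁺ (Any.map (glue-≗ f≗) (boolFunctions-complete (S ∘ (true ∷_)))))
             (boolFunctions-complete (S ∘ (false ∷_))))
  where
  glue-≗ : ∀ {f g} → f ≗ S ∘ (false ∷_) → g ≗ S ∘ (true ∷_) → glue f g ≗ S
  glue-≗ f≗ g≗ (false ∷ v) = f≗ v
  glue-≗ f≗ g≗ (true  ∷ v) = g≗ v

nonzeroCount : (F2Vec n → Bool) → ℕ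
nonzeroCount {n} S = sum (map (λ c → if S c then 1 else 0) (filterᵇ isNonzero (allVecs n)))

fano-bound : (S : F2Vec 3 → Bool) → LineFree S → QuadrangleFree S → nonzeroCount S ≤ 3
fano-bound S lineFree quadrangleFree =
  let bounded , f≗S = All.lookupAny checked (boolFunctions-complete S)
  in subst (_≤ 3) (count≡ f≗S) (bounded (LineFree-≗ f≗S lineFree) (QuadrangleFree-≗ f≗S quadrangleFree))
  where
  checked : All (λ f → LineFree f → QuadrangleFree f → nonzeroCount f ≤ 3) (boolFunctions 3)
  checked = toWitness {a? = All.all? (λ f → lineFree? f →-dec quadrangleFree? f →-dec nonzeroCount f ≤? 3)
                                     (boolFunctions 3)} tt

  count≡ : ∀ {f} → f ≗ S → nonzeroCount f ≡ nonzeroCount S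
  count≡ f≗S = cong sum (List.map-cong (λ c → cong (if_then 1 else 0) (f≗S c)) (filterᵇ isNonzero (allVecs 3)))

member : List (F2Vec n) → F2Vec n → Bool
member S v = ⌊ v ∈? S ⌋

member⇒∈ : (S : List (F2Vec n)) (v : F2Vec n) → T (member S v) → v ∈ S
member⇒∈ S v = toWitness {a? = v ∈? S}

module _ (S : List (F2Vec n)) where

  private
    ∈S : ∀ {v} → T (member S v) → v ∈ S
    ∈S = member⇒∈ S _

  LineFree-member : All (λ x → All (λ y → x ⊕ y ∈ S → x ≡ y) S) S → LineFree (member S)
  LineFree-member free x y x∈ y∈ x⊕y∈ = All.lookup (All.lookup free (∈S x∈)) (∈S y∈) (∈S x⊕y∈)

  QuadrangleFree-member : All (λ x → All (λ y → All (λ z → (x ⊕ y) ⊕ z ∈ S → x ≡ y ⊎ x ≡ z ⊎ y ≡ z) S) S) S →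
                          QuadrangleFree (member S)
  QuadrangleFree-member free x y z x∈ y∈ z∈ x⊕y⊕z∈ =
    All.lookup (All.lookup (All.lookup free (∈S x∈)) (∈S y∈)) (∈S z∈) (∈S x⊕y⊕z∈)

indicator : ∀ {N} → List (F2Vec (suc N)) → Multiset N
indicator S v = if member S v then 1 else 0

indicator-admissible : ∀ {N} (S : List (F2Vec (suc N))) → LineFree (member S) → QuadrangleFree (member S) →
                       Admissible N 2 3 (indicator S)
indicator-admissible S lineFree quadrangleFree B independent =
  fano-bound (λ c → member S (combo c B)) (LineFree-∘combo B independent lineFree)
                                          (QuadrangleFree-∘combo B independent quadrangleFree)

-- PG(5,2)

S₈ : List (F2Vec 6)
S₈ = map (bits 6) (1 ∷ 2 ∷ 4 ∷ 8 ∷ 15 ∷ 16 ∷ 32 ∷ 51 ∷ [])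

S₈-lineFree : LineFree (member S₈)
S₈-lineFree = LineFree-member S₈
  (toWitness {a? = All.all? (λ x → All.all? (λ y → x ⊕ y ∈? S₈ →-dec x ≟ᵥ y) S₈) S₈} tt)

S₈-quadrangleFree : QuadrangleFree (member S₈)
S₈-quadrangleFree = QuadrangleFree-member S₈
  (toWitness {a? = All.all? (λ x → All.all? (λ y → All.all? (λ z →
     (x ⊕ y) ⊕ z ∈? S₈ →-dec (x ≟ᵥ y ⊎-dec x ≟ᵥ z ⊎-dec y ≟ᵥ z)) S₈) S₈) S₈} tt)

open Search 5 2 3 8

plane : ℕ → ℕ → ℕ → Certificate
plane a b c = subspace (a ∷ b ∷ c ∷ [])

searchTree : List Node
searchTree =
  node []
    ( transform (1 ∷ 2 ∷ 4 ∷ 8 ∷ 16 ∷ 32 ∷ []) (1 ∷ 2 ∷ 4 ∷ 8 ∷ 16 ∷ 32 ∷ []) (1 ∷ [])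
    ∷ transform (2 ∷ 1 ∷ 4 ∷ 8 ∷ 16 ∷ 32 ∷ []) (2 ∷ 1 ∷ 4 ∷ 8 ∷ 16 ∷ 32 ∷ []) (1 ∷ [])
    ∷ transform (3 ∷ 1 ∷ 4 ∷ 8 ∷ 16 ∷ 32 ∷ []) (2 ∷ 3 ∷ 4 ∷ 8 ∷ 16 ∷ 32 ∷ []) (1 ∷ [])
    ∷ transform (4 ∷ 1 ∷ 2 ∷ 8 ∷ 16 ∷ 32 ∷ []) (2 ∷ 4 ∷ 1 ∷ 8 ∷ 16 ∷ 32 ∷ []) (1 ∷ [])
    ∷ transform (5 ∷ 1 ∷ 2 ∷ 8 ∷ 16 ∷ 32 ∷ []) (2 ∷ 4 ∷ 3 ∷ 8 ∷ 16 ∷ 32 ∷ []) (1 ∷ [])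
    ∷ transform (6 ∷ 1 ∷ 2 ∷ 8 ∷ 16 ∷ 32 ∷ []) (2 ∷ 4 ∷ 5 ∷ 8 ∷ 16 ∷ 32 ∷ []) (1 ∷ [])
    ∷ transform (7 ∷ 1 ∷ 2 ∷ 8 ∷ 16 ∷ 32 ∷ []) (2 ∷ 4 ∷ 7 ∷ 8 ∷ 16 ∷ 32 ∷ []) (1 ∷ [])
    ∷ transform (8 ∷ 1 ∷ 2 ∷ 4 ∷ 16 ∷ 32 ∷ []) (2 ∷ 4 ∷ 8 ∷ 1 ∷ 16 ∷ 32 ∷ []) (1 ∷ [])
    ∷ transform (9 ∷ 1 ∷ 2 ∷ 4 ∷ 16 ∷ 32 ∷ []) (2 ∷ 4 ∷ 8 ∷ 3 ∷ 16 ∷ 32 ∷ []) (1 ∷ [])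
    ∷ transform (10 ∷ 1 ∷ 2 ∷ 4 ∷ 16 ∷ 32 ∷ []) (2 ∷ 4 ∷ 8 ∷ 5 ∷ 16 ∷ 32 ∷ []) (1 ∷ [])
    ∷ transform (11 ∷ 1 ∷ 2 ∷ 4 ∷ 16 ∷ 32 ∷ []) (2 ∷ 4 ∷ 8 ∷ 7 ∷ 16 ∷ 32 ∷ []) (1 ∷ [])
    ∷ transform (12 ∷ 1 ∷ 2 ∷ 4 ∷ 16 ∷ 32 ∷ []) (2 ∷ 4 ∷ 8 ∷ 9 ∷ 16 ∷ 32 ∷ []) (1 ∷ [])
    ∷ transform (13 ∷ 1 ∷ 2 ∷ 4 ∷ 16 ∷ 32 ∷ []) (2 ∷ 4 ∷ 8 ∷ 11 ∷ 16 ∷ 32 ∷ []) (1 ∷ [])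
    ∷ transform (14 ∷ 1 ∷ 2 ∷ 4 ∷ 16 ∷ 32 ∷ []) (2 ∷ 4 ∷ 8 ∷ 13 ∷ 16 ∷ 32 ∷ []) (1 ∷ [])
    ∷ transform (15 ∷ 1 ∷ 2 ∷ 4 ∷ 16 ∷ 32 ∷ []) (2 ∷ 4 ∷ 8 ∷ 15 ∷ 16 ∷ 32 ∷ []) (1 ∷ [])
    ∷ transform (16 ∷ 1 ∷ 2 ∷ 4 ∷ 8 ∷ 32 ∷ []) (2 ∷ 4 ∷ 8 ∷ 16 ∷ 1 ∷ 32 ∷ []) (1 ∷ [])
    ∷ transform (17 ∷ 1 ∷ 2 ∷ 4 ∷ 8 ∷ 32 ∷ []) (2 ∷ 4 ∷ 8 ∷ 16 ∷ 3 ∷ 32 ∷ []) (1 ∷ [])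
    ∷ transform (18 ∷ 1 ∷ 2 ∷ 4 ∷ 8 ∷ 32 ∷ []) (2 ∷ 4 ∷ 8 ∷ 16 ∷ 5 ∷ 32 ∷ []) (1 ∷ [])
    ∷ transform (19 ∷ 1 ∷ 2 ∷ 4 ∷ 8 ∷ 32 ∷ []) (2 ∷ 4 ∷ 8 ∷ 16 ∷ 7 ∷ 32 ∷ []) (1 ∷ [])
    ∷ transform (20 ∷ 1 ∷ 2 ∷ 4 ∷ 8 ∷ 32 ∷ []) (2 ∷ 4 ∷ 8 ∷ 16 ∷ 9 ∷ 32 ∷ []) (1 ∷ [])
    ∷ transform (21 ∷ 1 ∷ 2 ∷ 4 ∷ 8 ∷ 32 ∷ []) (2 ∷ 4 ∷ 8 ∷ 16 ∷ 11 ∷ 32 ∷ []) (1 ∷ [])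
    ∷ transform (22 ∷ 1 ∷ 2 ∷ 4 ∷ 8 ∷ 32 ∷ []) (2 ∷ 4 ∷ 8 ∷ 16 ∷ 13 ∷ 32 ∷ []) (1 ∷ [])
    ∷ transform (23 ∷ 1 ∷ 2 ∷ 4 ∷ 8 ∷ 32 ∷ []) (2 ∷ 4 ∷ 8 ∷ 16 ∷ 15 ∷ 32 ∷ []) (1 ∷ [])
    ∷ transform (24 ∷ 1 ∷ 2 ∷ 4 ∷ 8 ∷ 32 ∷ []) (2 ∷ 4 ∷ 8 ∷ 16 ∷ 17 ∷ 32 ∷ []) (1 ∷ [])
    ∷ transform (25 ∷ 1 ∷ 2 ∷ 4 ∷ 8 ∷ 32 ∷ []) (2 ∷ 4 ∷ 8 ∷ 16 ∷ 19 ∷ 32 ∷ []) (1 ∷ [])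
    ∷ transform (26 ∷ 1 ∷ 2 ∷ 4 ∷ 8 ∷ 32 ∷ []) (2 ∷ 4 ∷ 8 ∷ 16 ∷ 21 ∷ 32 ∷ []) (1 ∷ [])
    ∷ transform (27 ∷ 1 ∷ 2 ∷ 4 ∷ 8 ∷ 32 ∷ []) (2 ∷ 4 ∷ 8 ∷ 16 ∷ 23 ∷ 32 ∷ []) (1 ∷ [])
    ∷ transform (28 ∷ 1 ∷ 2 ∷ 4 ∷ 8 ∷ 32 ∷ []) (2 ∷ 4 ∷ 8 ∷ 16 ∷ 25 ∷ 32 ∷ []) (1 ∷ [])
    ∷ transform (29 ∷ 1 ∷ 2 ∷ 4 ∷ 8 ∷ 32 ∷ []) (2 ∷ 4 ∷ 8 ∷ 16 ∷ 27 ∷ 32 ∷ []) (1 ∷ [])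
    ∷ transform (30 ∷ 1 ∷ 2 ∷ 4 ∷ 8 ∷ 32 ∷ []) (2 ∷ 4 ∷ 8 ∷ 16 ∷ 29 ∷ 32 ∷ []) (1 ∷ [])
    ∷ transform (31 ∷ 1 ∷ 2 ∷ 4 ∷ 8 ∷ 32 ∷ []) (2 ∷ 4 ∷ 8 ∷ 16 ∷ 31 ∷ 32 ∷ []) (1 ∷ [])
    ∷ transform (32 ∷ 1 ∷ 2 ∷ 4 ∷ 8 ∷ 16 ∷ []) (2 ∷ 4 ∷ 8 ∷ 16 ∷ 32 ∷ 1 ∷ []) (1 ∷ [])
    ∷ transform (33 ∷ 1 ∷ 2 ∷ 4 ∷ 8 ∷ 16 ∷ []) (2 ∷ 4 ∷ 8 ∷ 16 ∷ 32 ∷ 3 ∷ []) (1 ∷ [])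
    ∷ transform (34 ∷ 1 ∷ 2 ∷ 4 ∷ 8 ∷ 16 ∷ []) (2 ∷ 4 ∷ 8 ∷ 16 ∷ 32 ∷ 5 ∷ []) (1 ∷ [])
    ∷ transform (35 ∷ 1 ∷ 2 ∷ 4 ∷ 8 ∷ 16 ∷ []) (2 ∷ 4 ∷ 8 ∷ 16 ∷ 32 ∷ 7 ∷ []) (1 ∷ [])
    ∷ transform (36 ∷ 1 ∷ 2 ∷ 4 ∷ 8 ∷ 16 ∷ []) (2 ∷ 4 ∷ 8 ∷ 16 ∷ 32 ∷ 9 ∷ []) (1 ∷ [])
    ∷ transform (37 ∷ 1 ∷ 2 ∷ 4 ∷ 8 ∷ 16 ∷ []) (2 ∷ 4 ∷ 8 ∷ 16 ∷ 32 ∷ 11 ∷ []) (1 ∷ [])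
    ∷ transform (38 ∷ 1 ∷ 2 ∷ 4 ∷ 8 ∷ 16 ∷ []) (2 ∷ 4 ∷ 8 ∷ 16 ∷ 32 ∷ 13 ∷ []) (1 ∷ [])
    ∷ transform (39 ∷ 1 ∷ 2 ∷ 4 ∷ 8 ∷ 16 ∷ []) (2 ∷ 4 ∷ 8 ∷ 16 ∷ 32 ∷ 15 ∷ []) (1 ∷ [])
    ∷ transform (40 ∷ 1 ∷ 2 ∷ 4 ∷ 8 ∷ 16 ∷ []) (2 ∷ 4 ∷ 8 ∷ 16 ∷ 32 ∷ 17 ∷ []) (1 ∷ [])
    ∷ transform (41 ∷ 1 ∷ 2 ∷ 4 ∷ 8 ∷ 16 ∷ []) (2 ∷ 4 ∷ 8 ∷ 16 ∷ 32 ∷ 19 ∷ []) (1 ∷ [])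
    ∷ transform (42 ∷ 1 ∷ 2 ∷ 4 ∷ 8 ∷ 16 ∷ []) (2 ∷ 4 ∷ 8 ∷ 16 ∷ 32 ∷ 21 ∷ []) (1 ∷ [])
    ∷ transform (43 ∷ 1 ∷ 2 ∷ 4 ∷ 8 ∷ 16 ∷ []) (2 ∷ 4 ∷ 8 ∷ 16 ∷ 32 ∷ 23 ∷ []) (1 ∷ [])
    ∷ transform (44 ∷ 1 ∷ 2 ∷ 4 ∷ 8 ∷ 16 ∷ []) (2 ∷ 4 ∷ 8 ∷ 16 ∷ 32 ∷ 25 ∷ []) (1 ∷ [])
    ∷ transform (45 ∷ 1 ∷ 2 ∷ 4 ∷ 8 ∷ 16 ∷ []) (2 ∷ 4 ∷ 8 ∷ 16 ∷ 32 ∷ 27 ∷ []) (1 ∷ [])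
    ∷ transform (46 ∷ 1 ∷ 2 ∷ 4 ∷ 8 ∷ 16 ∷ []) (2 ∷ 4 ∷ 8 ∷ 16 ∷ 32 ∷ 29 ∷ []) (1 ∷ [])
    ∷ transform (47 ∷ 1 ∷ 2 ∷ 4 ∷ 8 ∷ 16 ∷ []) (2 ∷ 4 ∷ 8 ∷ 16 ∷ 32 ∷ 31 ∷ []) (1 ∷ [])
    ∷ transform (48 ∷ 1 ∷ 2 ∷ 4 ∷ 8 ∷ 16 ∷ []) (2 ∷ 4 ∷ 8 ∷ 16 ∷ 32 ∷ 33 ∷ []) (1 ∷ [])
    ∷ transform (49 ∷ 1 ∷ 2 ∷ 4 ∷ 8 ∷ 16 ∷ []) (2 ∷ 4 ∷ 8 ∷ 16 ∷ 32 ∷ 35 ∷ []) (1 ∷ [])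
    ∷ transform (50 ∷ 1 ∷ 2 ∷ 4 ∷ 8 ∷ 16 ∷ []) (2 ∷ 4 ∷ 8 ∷ 16 ∷ 32 ∷ 37 ∷ []) (1 ∷ [])
    ∷ transform (51 ∷ 1 ∷ 2 ∷ 4 ∷ 8 ∷ 16 ∷ []) (2 ∷ 4 ∷ 8 ∷ 16 ∷ 32 ∷ 39 ∷ []) (1 ∷ [])
    ∷ transform (52 ∷ 1 ∷ 2 ∷ 4 ∷ 8 ∷ 16 ∷ []) (2 ∷ 4 ∷ 8 ∷ 16 ∷ 32 ∷ 41 ∷ []) (1 ∷ [])
    ∷ transform (53 ∷ 1 ∷ 2 ∷ 4 ∷ 8 ∷ 16 ∷ []) (2 ∷ 4 ∷ 8 ∷ 16 ∷ 32 ∷ 43 ∷ []) (1 ∷ [])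
    ∷ transform (54 ∷ 1 ∷ 2 ∷ 4 ∷ 8 ∷ 16 ∷ []) (2 ∷ 4 ∷ 8 ∷ 16 ∷ 32 ∷ 45 ∷ []) (1 ∷ [])
    ∷ transform (55 ∷ 1 ∷ 2 ∷ 4 ∷ 8 ∷ 16 ∷ []) (2 ∷ 4 ∷ 8 ∷ 16 ∷ 32 ∷ 47 ∷ []) (1 ∷ [])
    ∷ transform (56 ∷ 1 ∷ 2 ∷ 4 ∷ 8 ∷ 16 ∷ []) (2 ∷ 4 ∷ 8 ∷ 16 ∷ 32 ∷ 49 ∷ []) (1 ∷ [])
    ∷ transform (57 ∷ 1 ∷ 2 ∷ 4 ∷ 8 ∷ 16 ∷ []) (2 ∷ 4 ∷ 8 ∷ 16 ∷ 32 ∷ 51 ∷ []) (1 ∷ [])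
    ∷ transform (58 ∷ 1 ∷ 2 ∷ 4 ∷ 8 ∷ 16 ∷ []) (2 ∷ 4 ∷ 8 ∷ 16 ∷ 32 ∷ 53 ∷ []) (1 ∷ [])
    ∷ transform (59 ∷ 1 ∷ 2 ∷ 4 ∷ 8 ∷ 16 ∷ []) (2 ∷ 4 ∷ 8 ∷ 16 ∷ 32 ∷ 55 ∷ []) (1 ∷ [])
    ∷ transform (60 ∷ 1 ∷ 2 ∷ 4 ∷ 8 ∷ 16 ∷ []) (2 ∷ 4 ∷ 8 ∷ 16 ∷ 32 ∷ 57 ∷ []) (1 ∷ [])
    ∷ transform (61 ∷ 1 ∷ 2 ∷ 4 ∷ 8 ∷ 16 ∷ []) (2 ∷ 4 ∷ 8 ∷ 16 ∷ 32 ∷ 59 ∷ []) (1 ∷ [])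
    ∷ transform (62 ∷ 1 ∷ 2 ∷ 4 ∷ 8 ∷ 16 ∷ []) (2 ∷ 4 ∷ 8 ∷ 16 ∷ 32 ∷ 61 ∷ []) (1 ∷ [])
    ∷ transform (63 ∷ 1 ∷ 2 ∷ 4 ∷ 8 ∷ 16 ∷ []) (2 ∷ 4 ∷ 8 ∷ 16 ∷ 32 ∷ 63 ∷ []) (1 ∷ [])
    ∷ []) ∷
  node (1 ∷ [])
    ( plane 1 2 4
    ∷ transform (1 ∷ 2 ∷ 4 ∷ 8 ∷ 16 ∷ 32 ∷ []) (1 ∷ 2 ∷ 4 ∷ 8 ∷ 16 ∷ 32 ∷ []) (1 ∷ 2 ∷ [])
    ∷ transform (1 ∷ 3 ∷ 4 ∷ 8 ∷ 16 ∷ 32 ∷ []) (1 ∷ 3 ∷ 4 ∷ 8 ∷ 16 ∷ 32 ∷ []) (1 ∷ 2 ∷ [])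
    ∷ transform (1 ∷ 4 ∷ 2 ∷ 8 ∷ 16 ∷ 32 ∷ []) (1 ∷ 4 ∷ 2 ∷ 8 ∷ 16 ∷ 32 ∷ []) (1 ∷ 2 ∷ [])
    ∷ transform (1 ∷ 5 ∷ 2 ∷ 8 ∷ 16 ∷ 32 ∷ []) (1 ∷ 4 ∷ 3 ∷ 8 ∷ 16 ∷ 32 ∷ []) (1 ∷ 2 ∷ [])
    ∷ transform (1 ∷ 6 ∷ 2 ∷ 8 ∷ 16 ∷ 32 ∷ []) (1 ∷ 4 ∷ 6 ∷ 8 ∷ 16 ∷ 32 ∷ []) (1 ∷ 2 ∷ [])
    ∷ transform (1 ∷ 7 ∷ 2 ∷ 8 ∷ 16 ∷ 32 ∷ []) (1 ∷ 4 ∷ 7 ∷ 8 ∷ 16 ∷ 32 ∷ []) (1 ∷ 2 ∷ [])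
    ∷ transform (8 ∷ 1 ∷ 2 ∷ 4 ∷ 16 ∷ 32 ∷ []) (2 ∷ 4 ∷ 8 ∷ 1 ∷ 16 ∷ 32 ∷ []) (1 ∷ 2 ∷ [])
    ∷ transform (1 ∷ 9 ∷ 2 ∷ 4 ∷ 16 ∷ 32 ∷ []) (1 ∷ 4 ∷ 8 ∷ 3 ∷ 16 ∷ 32 ∷ []) (1 ∷ 2 ∷ [])
    ∷ transform (1 ∷ 10 ∷ 2 ∷ 4 ∷ 16 ∷ 32 ∷ []) (1 ∷ 4 ∷ 8 ∷ 6 ∷ 16 ∷ 32 ∷ []) (1 ∷ 2 ∷ [])
    ∷ transform (1 ∷ 11 ∷ 2 ∷ 4 ∷ 16 ∷ 32 ∷ []) (1 ∷ 4 ∷ 8 ∷ 7 ∷ 16 ∷ 32 ∷ []) (1 ∷ 2 ∷ [])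
    ∷ transform (1 ∷ 12 ∷ 2 ∷ 4 ∷ 16 ∷ 32 ∷ []) (1 ∷ 4 ∷ 8 ∷ 10 ∷ 16 ∷ 32 ∷ []) (1 ∷ 2 ∷ [])
    ∷ transform (1 ∷ 13 ∷ 2 ∷ 4 ∷ 16 ∷ 32 ∷ []) (1 ∷ 4 ∷ 8 ∷ 11 ∷ 16 ∷ 32 ∷ []) (1 ∷ 2 ∷ [])
    ∷ transform (1 ∷ 14 ∷ 2 ∷ 4 ∷ 16 ∷ 32 ∷ []) (1 ∷ 4 ∷ 8 ∷ 14 ∷ 16 ∷ 32 ∷ []) (1 ∷ 2 ∷ [])
    ∷ transform (1 ∷ 15 ∷ 2 ∷ 4 ∷ 16 ∷ 32 ∷ []) (1 ∷ 4 ∷ 8 ∷ 15 ∷ 16 ∷ 32 ∷ []) (1 ∷ 2 ∷ [])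
    ∷ transform (16 ∷ 1 ∷ 2 ∷ 4 ∷ 8 ∷ 32 ∷ []) (2 ∷ 4 ∷ 8 ∷ 16 ∷ 1 ∷ 32 ∷ []) (1 ∷ 2 ∷ [])
    ∷ transform (1 ∷ 17 ∷ 2 ∷ 4 ∷ 8 ∷ 32 ∷ []) (1 ∷ 4 ∷ 8 ∷ 16 ∷ 3 ∷ 32 ∷ []) (1 ∷ 2 ∷ [])
    ∷ transform (1 ∷ 18 ∷ 2 ∷ 4 ∷ 8 ∷ 32 ∷ []) (1 ∷ 4 ∷ 8 ∷ 16 ∷ 6 ∷ 32 ∷ []) (1 ∷ 2 ∷ [])
    ∷ transform (1 ∷ 19 ∷ 2 ∷ 4 ∷ 8 ∷ 32 ∷ []) (1 ∷ 4 ∷ 8 ∷ 16 ∷ 7 ∷ 32 ∷ []) (1 ∷ 2 ∷ [])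
    ∷ transform (1 ∷ 20 ∷ 2 ∷ 4 ∷ 8 ∷ 32 ∷ []) (1 ∷ 4 ∷ 8 ∷ 16 ∷ 10 ∷ 32 ∷ []) (1 ∷ 2 ∷ [])
    ∷ transform (1 ∷ 21 ∷ 2 ∷ 4 ∷ 8 ∷ 32 ∷ []) (1 ∷ 4 ∷ 8 ∷ 16 ∷ 11 ∷ 32 ∷ []) (1 ∷ 2 ∷ [])
    ∷ transform (1 ∷ 22 ∷ 2 ∷ 4 ∷ 8 ∷ 32 ∷ []) (1 ∷ 4 ∷ 8 ∷ 16 ∷ 14 ∷ 32 ∷ []) (1 ∷ 2 ∷ [])
    ∷ transform (1 ∷ 23 ∷ 2 ∷ 4 ∷ 8 ∷ 32 ∷ []) (1 ∷ 4 ∷ 8 ∷ 16 ∷ 15 ∷ 32 ∷ []) (1 ∷ 2 ∷ [])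
    ∷ transform (24 ∷ 1 ∷ 2 ∷ 4 ∷ 8 ∷ 32 ∷ []) (2 ∷ 4 ∷ 8 ∷ 16 ∷ 17 ∷ 32 ∷ []) (1 ∷ 2 ∷ [])
    ∷ transform (1 ∷ 25 ∷ 2 ∷ 4 ∷ 8 ∷ 32 ∷ []) (1 ∷ 4 ∷ 8 ∷ 16 ∷ 19 ∷ 32 ∷ []) (1 ∷ 2 ∷ [])
    ∷ transform (1 ∷ 26 ∷ 2 ∷ 4 ∷ 8 ∷ 32 ∷ []) (1 ∷ 4 ∷ 8 ∷ 16 ∷ 22 ∷ 32 ∷ []) (1 ∷ 2 ∷ [])
    ∷ transform (1 ∷ 27 ∷ 2 ∷ 4 ∷ 8 ∷ 32 ∷ []) (1 ∷ 4 ∷ 8 ∷ 16 ∷ 23 ∷ 32 ∷ []) (1 ∷ 2 ∷ [])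
    ∷ transform (1 ∷ 28 ∷ 2 ∷ 4 ∷ 8 ∷ 32 ∷ []) (1 ∷ 4 ∷ 8 ∷ 16 ∷ 26 ∷ 32 ∷ []) (1 ∷ 2 ∷ [])
    ∷ transform (1 ∷ 29 ∷ 2 ∷ 4 ∷ 8 ∷ 32 ∷ []) (1 ∷ 4 ∷ 8 ∷ 16 ∷ 27 ∷ 32 ∷ []) (1 ∷ 2 ∷ [])
    ∷ transform (1 ∷ 30 ∷ 2 ∷ 4 ∷ 8 ∷ 32 ∷ []) (1 ∷ 4 ∷ 8 ∷ 16 ∷ 30 ∷ 32 ∷ []) (1 ∷ 2 ∷ [])
    ∷ transform (1 ∷ 31 ∷ 2 ∷ 4 ∷ 8 ∷ 32 ∷ []) (1 ∷ 4 ∷ 8 ∷ 16 ∷ 31 ∷ 32 ∷ []) (1 ∷ 2 ∷ [])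
    ∷ transform (32 ∷ 1 ∷ 2 ∷ 4 ∷ 8 ∷ 16 ∷ []) (2 ∷ 4 ∷ 8 ∷ 16 ∷ 32 ∷ 1 ∷ []) (1 ∷ 2 ∷ [])
    ∷ transform (1 ∷ 33 ∷ 2 ∷ 4 ∷ 8 ∷ 16 ∷ []) (1 ∷ 4 ∷ 8 ∷ 16 ∷ 32 ∷ 3 ∷ []) (1 ∷ 2 ∷ [])
    ∷ transform (1 ∷ 34 ∷ 2 ∷ 4 ∷ 8 ∷ 16 ∷ []) (1 ∷ 4 ∷ 8 ∷ 16 ∷ 32 ∷ 6 ∷ []) (1 ∷ 2 ∷ [])
    ∷ transform (1 ∷ 35 ∷ 2 ∷ 4 ∷ 8 ∷ 16 ∷ []) (1 ∷ 4 ∷ 8 ∷ 16 ∷ 32 ∷ 7 ∷ []) (1 ∷ 2 ∷ [])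
    ∷ transform (1 ∷ 36 ∷ 2 ∷ 4 ∷ 8 ∷ 16 ∷ []) (1 ∷ 4 ∷ 8 ∷ 16 ∷ 32 ∷ 10 ∷ []) (1 ∷ 2 ∷ [])
    ∷ transform (1 ∷ 37 ∷ 2 ∷ 4 ∷ 8 ∷ 16 ∷ []) (1 ∷ 4 ∷ 8 ∷ 16 ∷ 32 ∷ 11 ∷ []) (1 ∷ 2 ∷ [])
    ∷ transform (1 ∷ 38 ∷ 2 ∷ 4 ∷ 8 ∷ 16 ∷ []) (1 ∷ 4 ∷ 8 ∷ 16 ∷ 32 ∷ 14 ∷ []) (1 ∷ 2 ∷ [])
    ∷ transform (1 ∷ 39 ∷ 2 ∷ 4 ∷ 8 ∷ 16 ∷ []) (1 ∷ 4 ∷ 8 ∷ 16 ∷ 32 ∷ 15 ∷ []) (1 ∷ 2 ∷ [])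
    ∷ transform (40 ∷ 1 ∷ 2 ∷ 4 ∷ 8 ∷ 16 ∷ []) (2 ∷ 4 ∷ 8 ∷ 16 ∷ 32 ∷ 17 ∷ []) (1 ∷ 2 ∷ [])
    ∷ transform (1 ∷ 41 ∷ 2 ∷ 4 ∷ 8 ∷ 16 ∷ []) (1 ∷ 4 ∷ 8 ∷ 16 ∷ 32 ∷ 19 ∷ []) (1 ∷ 2 ∷ [])
    ∷ transform (1 ∷ 42 ∷ 2 ∷ 4 ∷ 8 ∷ 16 ∷ []) (1 ∷ 4 ∷ 8 ∷ 16 ∷ 32 ∷ 22 ∷ []) (1 ∷ 2 ∷ [])
    ∷ transform (1 ∷ 43 ∷ 2 ∷ 4 ∷ 8 ∷ 16 ∷ []) (1 ∷ 4 ∷ 8 ∷ 16 ∷ 32 ∷ 23 ∷ []) (1 ∷ 2 ∷ [])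
    ∷ transform (1 ∷ 44 ∷ 2 ∷ 4 ∷ 8 ∷ 16 ∷ []) (1 ∷ 4 ∷ 8 ∷ 16 ∷ 32 ∷ 26 ∷ []) (1 ∷ 2 ∷ [])
    ∷ transform (1 ∷ 45 ∷ 2 ∷ 4 ∷ 8 ∷ 16 ∷ []) (1 ∷ 4 ∷ 8 ∷ 16 ∷ 32 ∷ 27 ∷ []) (1 ∷ 2 ∷ [])
    ∷ transform (1 ∷ 46 ∷ 2 ∷ 4 ∷ 8 ∷ 16 ∷ []) (1 ∷ 4 ∷ 8 ∷ 16 ∷ 32 ∷ 30 ∷ []) (1 ∷ 2 ∷ [])
    ∷ transform (1 ∷ 47 ∷ 2 ∷ 4 ∷ 8 ∷ 16 ∷ []) (1 ∷ 4 ∷ 8 ∷ 16 ∷ 32 ∷ 31 ∷ []) (1 ∷ 2 ∷ [])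
    ∷ transform (48 ∷ 1 ∷ 2 ∷ 4 ∷ 8 ∷ 16 ∷ []) (2 ∷ 4 ∷ 8 ∷ 16 ∷ 32 ∷ 33 ∷ []) (1 ∷ 2 ∷ [])
    ∷ transform (1 ∷ 49 ∷ 2 ∷ 4 ∷ 8 ∷ 16 ∷ []) (1 ∷ 4 ∷ 8 ∷ 16 ∷ 32 ∷ 35 ∷ []) (1 ∷ 2 ∷ [])
    ∷ transform (1 ∷ 50 ∷ 2 ∷ 4 ∷ 8 ∷ 16 ∷ []) (1 ∷ 4 ∷ 8 ∷ 16 ∷ 32 ∷ 38 ∷ []) (1 ∷ 2 ∷ [])
    ∷ transform (1 ∷ 51 ∷ 2 ∷ 4 ∷ 8 ∷ 16 ∷ []) (1 ∷ 4 ∷ 8 ∷ 16 ∷ 32 ∷ 39 ∷ []) (1 ∷ 2 ∷ [])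
    ∷ transform (1 ∷ 52 ∷ 2 ∷ 4 ∷ 8 ∷ 16 ∷ []) (1 ∷ 4 ∷ 8 ∷ 16 ∷ 32 ∷ 42 ∷ []) (1 ∷ 2 ∷ [])
    ∷ transform (1 ∷ 53 ∷ 2 ∷ 4 ∷ 8 ∷ 16 ∷ []) (1 ∷ 4 ∷ 8 ∷ 16 ∷ 32 ∷ 43 ∷ []) (1 ∷ 2 ∷ [])
    ∷ transform (1 ∷ 54 ∷ 2 ∷ 4 ∷ 8 ∷ 16 ∷ []) (1 ∷ 4 ∷ 8 ∷ 16 ∷ 32 ∷ 46 ∷ []) (1 ∷ 2 ∷ [])
    ∷ transform (1 ∷ 55 ∷ 2 ∷ 4 ∷ 8 ∷ 16 ∷ []) (1 ∷ 4 ∷ 8 ∷ 16 ∷ 32 ∷ 47 ∷ []) (1 ∷ 2 ∷ [])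
    ∷ transform (56 ∷ 1 ∷ 2 ∷ 4 ∷ 8 ∷ 16 ∷ []) (2 ∷ 4 ∷ 8 ∷ 16 ∷ 32 ∷ 49 ∷ []) (1 ∷ 2 ∷ [])
    ∷ transform (1 ∷ 57 ∷ 2 ∷ 4 ∷ 8 ∷ 16 ∷ []) (1 ∷ 4 ∷ 8 ∷ 16 ∷ 32 ∷ 51 ∷ []) (1 ∷ 2 ∷ [])
    ∷ transform (1 ∷ 58 ∷ 2 ∷ 4 ∷ 8 ∷ 16 ∷ []) (1 ∷ 4 ∷ 8 ∷ 16 ∷ 32 ∷ 54 ∷ []) (1 ∷ 2 ∷ [])
    ∷ transform (1 ∷ 59 ∷ 2 ∷ 4 ∷ 8 ∷ 16 ∷ []) (1 ∷ 4 ∷ 8 ∷ 16 ∷ 32 ∷ 55 ∷ []) (1 ∷ 2 ∷ [])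
    ∷ transform (1 ∷ 60 ∷ 2 ∷ 4 ∷ 8 ∷ 16 ∷ []) (1 ∷ 4 ∷ 8 ∷ 16 ∷ 32 ∷ 58 ∷ []) (1 ∷ 2 ∷ [])
    ∷ transform (1 ∷ 61 ∷ 2 ∷ 4 ∷ 8 ∷ 16 ∷ []) (1 ∷ 4 ∷ 8 ∷ 16 ∷ 32 ∷ 59 ∷ []) (1 ∷ 2 ∷ [])
    ∷ transform (1 ∷ 62 ∷ 2 ∷ 4 ∷ 8 ∷ 16 ∷ []) (1 ∷ 4 ∷ 8 ∷ 16 ∷ 32 ∷ 62 ∷ []) (1 ∷ 2 ∷ [])
    ∷ transform (1 ∷ 63 ∷ 2 ∷ 4 ∷ 8 ∷ 16 ∷ []) (1 ∷ 4 ∷ 8 ∷ 16 ∷ 32 ∷ 63 ∷ []) (1 ∷ 2 ∷ [])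
    ∷ []) ∷
  node (1 ∷ 2 ∷ [])
    ( plane 1 2 4
    ∷ plane 2 1 4
    ∷ transform (1 ∷ 2 ∷ 4 ∷ 8 ∷ 16 ∷ 32 ∷ []) (1 ∷ 2 ∷ 4 ∷ 8 ∷ 16 ∷ 32 ∷ []) (1 ∷ 2 ∷ 3 ∷ [])
    ∷ transform (1 ∷ 2 ∷ 4 ∷ 8 ∷ 16 ∷ 32 ∷ []) (1 ∷ 2 ∷ 4 ∷ 8 ∷ 16 ∷ 32 ∷ []) (1 ∷ 2 ∷ 4 ∷ [])
    ∷ transform (1 ∷ 2 ∷ 5 ∷ 8 ∷ 16 ∷ 32 ∷ []) (1 ∷ 2 ∷ 5 ∷ 8 ∷ 16 ∷ 32 ∷ []) (1 ∷ 2 ∷ 4 ∷ [])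
    ∷ transform (1 ∷ 2 ∷ 6 ∷ 8 ∷ 16 ∷ 32 ∷ []) (1 ∷ 2 ∷ 6 ∷ 8 ∷ 16 ∷ 32 ∷ []) (1 ∷ 2 ∷ 4 ∷ [])
    ∷ transform (1 ∷ 2 ∷ 7 ∷ 8 ∷ 16 ∷ 32 ∷ []) (1 ∷ 2 ∷ 7 ∷ 8 ∷ 16 ∷ 32 ∷ []) (1 ∷ 2 ∷ 4 ∷ [])
    ∷ transform (8 ∷ 1 ∷ 2 ∷ 4 ∷ 16 ∷ 32 ∷ []) (2 ∷ 4 ∷ 8 ∷ 1 ∷ 16 ∷ 32 ∷ []) (1 ∷ 2 ∷ 4 ∷ [])
    ∷ transform (1 ∷ 2 ∷ 9 ∷ 4 ∷ 16 ∷ 32 ∷ []) (1 ∷ 2 ∷ 8 ∷ 5 ∷ 16 ∷ 32 ∷ []) (1 ∷ 2 ∷ 4 ∷ [])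
    ∷ transform (1 ∷ 2 ∷ 10 ∷ 4 ∷ 16 ∷ 32 ∷ []) (1 ∷ 2 ∷ 8 ∷ 6 ∷ 16 ∷ 32 ∷ []) (1 ∷ 2 ∷ 4 ∷ [])
    ∷ transform (1 ∷ 2 ∷ 11 ∷ 4 ∷ 16 ∷ 32 ∷ []) (1 ∷ 2 ∷ 8 ∷ 7 ∷ 16 ∷ 32 ∷ []) (1 ∷ 2 ∷ 4 ∷ [])
    ∷ transform (1 ∷ 2 ∷ 12 ∷ 4 ∷ 16 ∷ 32 ∷ []) (1 ∷ 2 ∷ 8 ∷ 12 ∷ 16 ∷ 32 ∷ []) (1 ∷ 2 ∷ 4 ∷ [])
    ∷ transform (1 ∷ 2 ∷ 13 ∷ 4 ∷ 16 ∷ 32 ∷ []) (1 ∷ 2 ∷ 8 ∷ 13 ∷ 16 ∷ 32 ∷ []) (1 ∷ 2 ∷ 4 ∷ [])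
    ∷ transform (1 ∷ 2 ∷ 14 ∷ 4 ∷ 16 ∷ 32 ∷ []) (1 ∷ 2 ∷ 8 ∷ 14 ∷ 16 ∷ 32 ∷ []) (1 ∷ 2 ∷ 4 ∷ [])
    ∷ transform (1 ∷ 2 ∷ 15 ∷ 4 ∷ 16 ∷ 32 ∷ []) (1 ∷ 2 ∷ 8 ∷ 15 ∷ 16 ∷ 32 ∷ []) (1 ∷ 2 ∷ 4 ∷ [])
    ∷ transform (16 ∷ 1 ∷ 2 ∷ 4 ∷ 8 ∷ 32 ∷ []) (2 ∷ 4 ∷ 8 ∷ 16 ∷ 1 ∷ 32 ∷ []) (1 ∷ 2 ∷ 4 ∷ [])
    ∷ transform (1 ∷ 2 ∷ 17 ∷ 4 ∷ 8 ∷ 32 ∷ []) (1 ∷ 2 ∷ 8 ∷ 16 ∷ 5 ∷ 32 ∷ []) (1 ∷ 2 ∷ 4 ∷ [])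
    ∷ transform (1 ∷ 2 ∷ 18 ∷ 4 ∷ 8 ∷ 32 ∷ []) (1 ∷ 2 ∷ 8 ∷ 16 ∷ 6 ∷ 32 ∷ []) (1 ∷ 2 ∷ 4 ∷ [])
    ∷ transform (1 ∷ 2 ∷ 19 ∷ 4 ∷ 8 ∷ 32 ∷ []) (1 ∷ 2 ∷ 8 ∷ 16 ∷ 7 ∷ 32 ∷ []) (1 ∷ 2 ∷ 4 ∷ [])
    ∷ transform (1 ∷ 2 ∷ 20 ∷ 4 ∷ 8 ∷ 32 ∷ []) (1 ∷ 2 ∷ 8 ∷ 16 ∷ 12 ∷ 32 ∷ []) (1 ∷ 2 ∷ 4 ∷ [])
    ∷ transform (1 ∷ 2 ∷ 21 ∷ 4 ∷ 8 ∷ 32 ∷ []) (1 ∷ 2 ∷ 8 ∷ 16 ∷ 13 ∷ 32 ∷ []) (1 ∷ 2 ∷ 4 ∷ [])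
    ∷ transform (1 ∷ 2 ∷ 22 ∷ 4 ∷ 8 ∷ 32 ∷ []) (1 ∷ 2 ∷ 8 ∷ 16 ∷ 14 ∷ 32 ∷ []) (1 ∷ 2 ∷ 4 ∷ [])
    ∷ transform (1 ∷ 2 ∷ 23 ∷ 4 ∷ 8 ∷ 32 ∷ []) (1 ∷ 2 ∷ 8 ∷ 16 ∷ 15 ∷ 32 ∷ []) (1 ∷ 2 ∷ 4 ∷ [])
    ∷ transform (24 ∷ 1 ∷ 2 ∷ 4 ∷ 8 ∷ 32 ∷ []) (2 ∷ 4 ∷ 8 ∷ 16 ∷ 17 ∷ 32 ∷ []) (1 ∷ 2 ∷ 4 ∷ [])
    ∷ transform (1 ∷ 2 ∷ 25 ∷ 4 ∷ 8 ∷ 32 ∷ []) (1 ∷ 2 ∷ 8 ∷ 16 ∷ 21 ∷ 32 ∷ []) (1 ∷ 2 ∷ 4 ∷ [])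
    ∷ transform (1 ∷ 2 ∷ 26 ∷ 4 ∷ 8 ∷ 32 ∷ []) (1 ∷ 2 ∷ 8 ∷ 16 ∷ 22 ∷ 32 ∷ []) (1 ∷ 2 ∷ 4 ∷ [])
    ∷ transform (1 ∷ 2 ∷ 27 ∷ 4 ∷ 8 ∷ 32 ∷ []) (1 ∷ 2 ∷ 8 ∷ 16 ∷ 23 ∷ 32 ∷ []) (1 ∷ 2 ∷ 4 ∷ [])
    ∷ transform (1 ∷ 2 ∷ 28 ∷ 4 ∷ 8 ∷ 32 ∷ []) (1 ∷ 2 ∷ 8 ∷ 16 ∷ 28 ∷ 32 ∷ []) (1 ∷ 2 ∷ 4 ∷ [])
    ∷ transform (1 ∷ 2 ∷ 29 ∷ 4 ∷ 8 ∷ 32 ∷ []) (1 ∷ 2 ∷ 8 ∷ 16 ∷ 29 ∷ 32 ∷ []) (1 ∷ 2 ∷ 4 ∷ [])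
    ∷ transform (1 ∷ 2 ∷ 30 ∷ 4 ∷ 8 ∷ 32 ∷ []) (1 ∷ 2 ∷ 8 ∷ 16 ∷ 30 ∷ 32 ∷ []) (1 ∷ 2 ∷ 4 ∷ [])
    ∷ transform (1 ∷ 2 ∷ 31 ∷ 4 ∷ 8 ∷ 32 ∷ []) (1 ∷ 2 ∷ 8 ∷ 16 ∷ 31 ∷ 32 ∷ []) (1 ∷ 2 ∷ 4 ∷ [])
    ∷ transform (32 ∷ 1 ∷ 2 ∷ 4 ∷ 8 ∷ 16 ∷ []) (2 ∷ 4 ∷ 8 ∷ 16 ∷ 32 ∷ 1 ∷ []) (1 ∷ 2 ∷ 4 ∷ [])
    ∷ transform (1 ∷ 2 ∷ 33 ∷ 4 ∷ 8 ∷ 16 ∷ []) (1 ∷ 2 ∷ 8 ∷ 16 ∷ 32 ∷ 5 ∷ []) (1 ∷ 2 ∷ 4 ∷ [])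
    ∷ transform (1 ∷ 2 ∷ 34 ∷ 4 ∷ 8 ∷ 16 ∷ []) (1 ∷ 2 ∷ 8 ∷ 16 ∷ 32 ∷ 6 ∷ []) (1 ∷ 2 ∷ 4 ∷ [])
    ∷ transform (1 ∷ 2 ∷ 35 ∷ 4 ∷ 8 ∷ 16 ∷ []) (1 ∷ 2 ∷ 8 ∷ 16 ∷ 32 ∷ 7 ∷ []) (1 ∷ 2 ∷ 4 ∷ [])
    ∷ transform (1 ∷ 2 ∷ 36 ∷ 4 ∷ 8 ∷ 16 ∷ []) (1 ∷ 2 ∷ 8 ∷ 16 ∷ 32 ∷ 12 ∷ []) (1 ∷ 2 ∷ 4 ∷ [])
    ∷ transform (1 ∷ 2 ∷ 37 ∷ 4 ∷ 8 ∷ 16 ∷ []) (1 ∷ 2 ∷ 8 ∷ 16 ∷ 32 ∷ 13 ∷ []) (1 ∷ 2 ∷ 4 ∷ [])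
    ∷ transform (1 ∷ 2 ∷ 38 ∷ 4 ∷ 8 ∷ 16 ∷ []) (1 ∷ 2 ∷ 8 ∷ 16 ∷ 32 ∷ 14 ∷ []) (1 ∷ 2 ∷ 4 ∷ [])
    ∷ transform (1 ∷ 2 ∷ 39 ∷ 4 ∷ 8 ∷ 16 ∷ []) (1 ∷ 2 ∷ 8 ∷ 16 ∷ 32 ∷ 15 ∷ []) (1 ∷ 2 ∷ 4 ∷ [])
    ∷ transform (40 ∷ 1 ∷ 2 ∷ 4 ∷ 8 ∷ 16 ∷ []) (2 ∷ 4 ∷ 8 ∷ 16 ∷ 32 ∷ 17 ∷ []) (1 ∷ 2 ∷ 4 ∷ [])
    ∷ transform (1 ∷ 2 ∷ 41 ∷ 4 ∷ 8 ∷ 16 ∷ []) (1 ∷ 2 ∷ 8 ∷ 16 ∷ 32 ∷ 21 ∷ []) (1 ∷ 2 ∷ 4 ∷ [])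
    ∷ transform (1 ∷ 2 ∷ 42 ∷ 4 ∷ 8 ∷ 16 ∷ []) (1 ∷ 2 ∷ 8 ∷ 16 ∷ 32 ∷ 22 ∷ []) (1 ∷ 2 ∷ 4 ∷ [])
    ∷ transform (1 ∷ 2 ∷ 43 ∷ 4 ∷ 8 ∷ 16 ∷ []) (1 ∷ 2 ∷ 8 ∷ 16 ∷ 32 ∷ 23 ∷ []) (1 ∷ 2 ∷ 4 ∷ [])
    ∷ transform (1 ∷ 2 ∷ 44 ∷ 4 ∷ 8 ∷ 16 ∷ []) (1 ∷ 2 ∷ 8 ∷ 16 ∷ 32 ∷ 28 ∷ []) (1 ∷ 2 ∷ 4 ∷ [])
    ∷ transform (1 ∷ 2 ∷ 45 ∷ 4 ∷ 8 ∷ 16 ∷ []) (1 ∷ 2 ∷ 8 ∷ 16 ∷ 32 ∷ 29 ∷ []) (1 ∷ 2 ∷ 4 ∷ [])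
    ∷ transform (1 ∷ 2 ∷ 46 ∷ 4 ∷ 8 ∷ 16 ∷ []) (1 ∷ 2 ∷ 8 ∷ 16 ∷ 32 ∷ 30 ∷ []) (1 ∷ 2 ∷ 4 ∷ [])
    ∷ transform (1 ∷ 2 ∷ 47 ∷ 4 ∷ 8 ∷ 16 ∷ []) (1 ∷ 2 ∷ 8 ∷ 16 ∷ 32 ∷ 31 ∷ []) (1 ∷ 2 ∷ 4 ∷ [])
    ∷ transform (48 ∷ 1 ∷ 2 ∷ 4 ∷ 8 ∷ 16 ∷ []) (2 ∷ 4 ∷ 8 ∷ 16 ∷ 32 ∷ 33 ∷ []) (1 ∷ 2 ∷ 4 ∷ [])
    ∷ transform (1 ∷ 2 ∷ 49 ∷ 4 ∷ 8 ∷ 16 ∷ []) (1 ∷ 2 ∷ 8 ∷ 16 ∷ 32 ∷ 37 ∷ []) (1 ∷ 2 ∷ 4 ∷ [])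
    ∷ transform (1 ∷ 2 ∷ 50 ∷ 4 ∷ 8 ∷ 16 ∷ []) (1 ∷ 2 ∷ 8 ∷ 16 ∷ 32 ∷ 38 ∷ []) (1 ∷ 2 ∷ 4 ∷ [])
    ∷ transform (1 ∷ 2 ∷ 51 ∷ 4 ∷ 8 ∷ 16 ∷ []) (1 ∷ 2 ∷ 8 ∷ 16 ∷ 32 ∷ 39 ∷ []) (1 ∷ 2 ∷ 4 ∷ [])
    ∷ transform (1 ∷ 2 ∷ 52 ∷ 4 ∷ 8 ∷ 16 ∷ []) (1 ∷ 2 ∷ 8 ∷ 16 ∷ 32 ∷ 44 ∷ []) (1 ∷ 2 ∷ 4 ∷ [])
    ∷ transform (1 ∷ 2 ∷ 53 ∷ 4 ∷ 8 ∷ 16 ∷ []) (1 ∷ 2 ∷ 8 ∷ 16 ∷ 32 ∷ 45 ∷ []) (1 ∷ 2 ∷ 4 ∷ [])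
    ∷ transform (1 ∷ 2 ∷ 54 ∷ 4 ∷ 8 ∷ 16 ∷ []) (1 ∷ 2 ∷ 8 ∷ 16 ∷ 32 ∷ 46 ∷ []) (1 ∷ 2 ∷ 4 ∷ [])
    ∷ transform (1 ∷ 2 ∷ 55 ∷ 4 ∷ 8 ∷ 16 ∷ []) (1 ∷ 2 ∷ 8 ∷ 16 ∷ 32 ∷ 47 ∷ []) (1 ∷ 2 ∷ 4 ∷ [])
    ∷ transform (56 ∷ 1 ∷ 2 ∷ 4 ∷ 8 ∷ 16 ∷ []) (2 ∷ 4 ∷ 8 ∷ 16 ∷ 32 ∷ 49 ∷ []) (1 ∷ 2 ∷ 4 ∷ [])
    ∷ transform (1 ∷ 2 ∷ 57 ∷ 4 ∷ 8 ∷ 16 ∷ []) (1 ∷ 2 ∷ 8 ∷ 16 ∷ 32 ∷ 53 ∷ []) (1 ∷ 2 ∷ 4 ∷ [])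
    ∷ transform (1 ∷ 2 ∷ 58 ∷ 4 ∷ 8 ∷ 16 ∷ []) (1 ∷ 2 ∷ 8 ∷ 16 ∷ 32 ∷ 54 ∷ []) (1 ∷ 2 ∷ 4 ∷ [])
    ∷ transform (1 ∷ 2 ∷ 59 ∷ 4 ∷ 8 ∷ 16 ∷ []) (1 ∷ 2 ∷ 8 ∷ 16 ∷ 32 ∷ 55 ∷ []) (1 ∷ 2 ∷ 4 ∷ [])
    ∷ transform (1 ∷ 2 ∷ 60 ∷ 4 ∷ 8 ∷ 16 ∷ []) (1 ∷ 2 ∷ 8 ∷ 16 ∷ 32 ∷ 60 ∷ []) (1 ∷ 2 ∷ 4 ∷ [])
    ∷ transform (1 ∷ 2 ∷ 61 ∷ 4 ∷ 8 ∷ 16 ∷ []) (1 ∷ 2 ∷ 8 ∷ 16 ∷ 32 ∷ 61 ∷ []) (1 ∷ 2 ∷ 4 ∷ [])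
    ∷ transform (1 ∷ 2 ∷ 62 ∷ 4 ∷ 8 ∷ 16 ∷ []) (1 ∷ 2 ∷ 8 ∷ 16 ∷ 32 ∷ 62 ∷ []) (1 ∷ 2 ∷ 4 ∷ [])
    ∷ transform (1 ∷ 2 ∷ 63 ∷ 4 ∷ 8 ∷ 16 ∷ []) (1 ∷ 2 ∷ 8 ∷ 16 ∷ 32 ∷ 63 ∷ []) (1 ∷ 2 ∷ 4 ∷ [])
    ∷ []) ∷
  node (1 ∷ 2 ∷ 3 ∷ [])
    ( plane 1 2 4
    ∷ plane 2 1 4
    ∷ plane 3 1 4
    ∷ plane 4 1 2
    ∷ plane 5 1 2
    ∷ plane 6 1 2
    ∷ plane 7 1 2
    ∷ plane 8 1 2
    ∷ plane 9 1 2
    ∷ plane 10 1 2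
    ∷ plane 11 1 2
    ∷ plane 12 1 2
    ∷ plane 13 1 2
    ∷ plane 14 1 2
    ∷ plane 15 1 2
    ∷ plane 16 1 2
    ∷ plane 17 1 2
    ∷ plane 18 1 2
    ∷ plane 19 1 2
    ∷ plane 20 1 2
    ∷ plane 21 1 2
    ∷ plane 22 1 2
    ∷ plane 23 1 2
    ∷ plane 24 1 2
    ∷ plane 25 1 2
    ∷ plane 26 1 2
    ∷ plane 27 1 2
    ∷ plane 28 1 2
    ∷ plane 29 1 2
    ∷ plane 30 1 2
    ∷ plane 31 1 2
    ∷ plane 32 1 2
    ∷ plane 33 1 2
    ∷ plane 34 1 2
    ∷ plane 35 1 2
    ∷ plane 36 1 2
    ∷ plane 37 1 2
    ∷ plane 38 1 2
    ∷ plane 39 1 2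
    ∷ plane 40 1 2
    ∷ plane 41 1 2
    ∷ plane 42 1 2
    ∷ plane 43 1 2
    ∷ plane 44 1 2
    ∷ plane 45 1 2
    ∷ plane 46 1 2
    ∷ plane 47 1 2
    ∷ plane 48 1 2
    ∷ plane 49 1 2
    ∷ plane 50 1 2
    ∷ plane 51 1 2
    ∷ plane 52 1 2
    ∷ plane 53 1 2
    ∷ plane 54 1 2
    ∷ plane 55 1 2
    ∷ plane 56 1 2
    ∷ plane 57 1 2
    ∷ plane 58 1 2
    ∷ plane 59 1 2
    ∷ plane 60 1 2
    ∷ plane 61 1 2
    ∷ plane 62 1 2
    ∷ plane 63 1 2
    ∷ []) ∷
  node (1 ∷ 2 ∷ 4 ∷ [])
    ( plane 1 2 4
    ∷ plane 2 1 4
    ∷ plane 3 1 4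
    ∷ plane 4 1 2
    ∷ plane 5 1 2
    ∷ plane 6 1 2
    ∷ plane 7 1 2
    ∷ transform (8 ∷ 1 ∷ 2 ∷ 4 ∷ 16 ∷ 32 ∷ []) (2 ∷ 4 ∷ 8 ∷ 1 ∷ 16 ∷ 32 ∷ []) (1 ∷ 2 ∷ 4 ∷ 8 ∷ [])
    ∷ transform (1 ∷ 2 ∷ 4 ∷ 9 ∷ 16 ∷ 32 ∷ []) (1 ∷ 2 ∷ 4 ∷ 9 ∷ 16 ∷ 32 ∷ []) (1 ∷ 2 ∷ 4 ∷ 8 ∷ [])
    ∷ transform (1 ∷ 2 ∷ 10 ∷ 4 ∷ 16 ∷ 32 ∷ []) (1 ∷ 2 ∷ 8 ∷ 6 ∷ 16 ∷ 32 ∷ []) (1 ∷ 2 ∷ 4 ∷ 8 ∷ [])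
    ∷ transform (1 ∷ 2 ∷ 11 ∷ 4 ∷ 16 ∷ 32 ∷ []) (1 ∷ 2 ∷ 8 ∷ 7 ∷ 16 ∷ 32 ∷ []) (1 ∷ 2 ∷ 4 ∷ 8 ∷ [])
    ∷ transform (1 ∷ 2 ∷ 4 ∷ 12 ∷ 16 ∷ 32 ∷ []) (1 ∷ 2 ∷ 4 ∷ 12 ∷ 16 ∷ 32 ∷ []) (1 ∷ 2 ∷ 4 ∷ 8 ∷ [])
    ∷ transform (1 ∷ 2 ∷ 4 ∷ 13 ∷ 16 ∷ 32 ∷ []) (1 ∷ 2 ∷ 4 ∷ 13 ∷ 16 ∷ 32 ∷ []) (1 ∷ 2 ∷ 4 ∷ 8 ∷ [])
    ∷ transform (1 ∷ 2 ∷ 4 ∷ 14 ∷ 16 ∷ 32 ∷ []) (1 ∷ 2 ∷ 4 ∷ 14 ∷ 16 ∷ 32 ∷ []) (1 ∷ 2 ∷ 4 ∷ 8 ∷ [])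
    ∷ transform (1 ∷ 2 ∷ 4 ∷ 15 ∷ 16 ∷ 32 ∷ []) (1 ∷ 2 ∷ 4 ∷ 15 ∷ 16 ∷ 32 ∷ []) (1 ∷ 2 ∷ 4 ∷ 8 ∷ [])
    ∷ transform (16 ∷ 1 ∷ 2 ∷ 4 ∷ 8 ∷ 32 ∷ []) (2 ∷ 4 ∷ 8 ∷ 16 ∷ 1 ∷ 32 ∷ []) (1 ∷ 2 ∷ 4 ∷ 8 ∷ [])
    ∷ transform (1 ∷ 2 ∷ 4 ∷ 17 ∷ 8 ∷ 32 ∷ []) (1 ∷ 2 ∷ 4 ∷ 16 ∷ 9 ∷ 32 ∷ []) (1 ∷ 2 ∷ 4 ∷ 8 ∷ [])
    ∷ transform (1 ∷ 2 ∷ 18 ∷ 4 ∷ 8 ∷ 32 ∷ []) (1 ∷ 2 ∷ 8 ∷ 16 ∷ 6 ∷ 32 ∷ []) (1 ∷ 2 ∷ 4 ∷ 8 ∷ [])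
    ∷ transform (1 ∷ 2 ∷ 19 ∷ 4 ∷ 8 ∷ 32 ∷ []) (1 ∷ 2 ∷ 8 ∷ 16 ∷ 7 ∷ 32 ∷ []) (1 ∷ 2 ∷ 4 ∷ 8 ∷ [])
    ∷ transform (1 ∷ 2 ∷ 4 ∷ 20 ∷ 8 ∷ 32 ∷ []) (1 ∷ 2 ∷ 4 ∷ 16 ∷ 12 ∷ 32 ∷ []) (1 ∷ 2 ∷ 4 ∷ 8 ∷ [])
    ∷ transform (1 ∷ 2 ∷ 4 ∷ 21 ∷ 8 ∷ 32 ∷ []) (1 ∷ 2 ∷ 4 ∷ 16 ∷ 13 ∷ 32 ∷ []) (1 ∷ 2 ∷ 4 ∷ 8 ∷ [])
    ∷ transform (1 ∷ 2 ∷ 4 ∷ 22 ∷ 8 ∷ 32 ∷ []) (1 ∷ 2 ∷ 4 ∷ 16 ∷ 14 ∷ 32 ∷ []) (1 ∷ 2 ∷ 4 ∷ 8 ∷ [])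
    ∷ transform (1 ∷ 2 ∷ 4 ∷ 23 ∷ 8 ∷ 32 ∷ []) (1 ∷ 2 ∷ 4 ∷ 16 ∷ 15 ∷ 32 ∷ []) (1 ∷ 2 ∷ 4 ∷ 8 ∷ [])
    ∷ transform (24 ∷ 1 ∷ 2 ∷ 4 ∷ 8 ∷ 32 ∷ []) (2 ∷ 4 ∷ 8 ∷ 16 ∷ 17 ∷ 32 ∷ []) (1 ∷ 2 ∷ 4 ∷ 8 ∷ [])
    ∷ transform (1 ∷ 2 ∷ 4 ∷ 25 ∷ 8 ∷ 32 ∷ []) (1 ∷ 2 ∷ 4 ∷ 16 ∷ 25 ∷ 32 ∷ []) (1 ∷ 2 ∷ 4 ∷ 8 ∷ [])
    ∷ transform (1 ∷ 2 ∷ 26 ∷ 4 ∷ 8 ∷ 32 ∷ []) (1 ∷ 2 ∷ 8 ∷ 16 ∷ 22 ∷ 32 ∷ []) (1 ∷ 2 ∷ 4 ∷ 8 ∷ [])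
    ∷ transform (1 ∷ 2 ∷ 27 ∷ 4 ∷ 8 ∷ 32 ∷ []) (1 ∷ 2 ∷ 8 ∷ 16 ∷ 23 ∷ 32 ∷ []) (1 ∷ 2 ∷ 4 ∷ 8 ∷ [])
    ∷ transform (1 ∷ 2 ∷ 4 ∷ 28 ∷ 8 ∷ 32 ∷ []) (1 ∷ 2 ∷ 4 ∷ 16 ∷ 28 ∷ 32 ∷ []) (1 ∷ 2 ∷ 4 ∷ 8 ∷ [])
    ∷ transform (1 ∷ 2 ∷ 4 ∷ 29 ∷ 8 ∷ 32 ∷ []) (1 ∷ 2 ∷ 4 ∷ 16 ∷ 29 ∷ 32 ∷ []) (1 ∷ 2 ∷ 4 ∷ 8 ∷ [])
    ∷ transform (1 ∷ 2 ∷ 4 ∷ 30 ∷ 8 ∷ 32 ∷ []) (1 ∷ 2 ∷ 4 ∷ 16 ∷ 30 ∷ 32 ∷ []) (1 ∷ 2 ∷ 4 ∷ 8 ∷ [])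
    ∷ transform (1 ∷ 2 ∷ 4 ∷ 31 ∷ 8 ∷ 32 ∷ []) (1 ∷ 2 ∷ 4 ∷ 16 ∷ 31 ∷ 32 ∷ []) (1 ∷ 2 ∷ 4 ∷ 8 ∷ [])
    ∷ transform (32 ∷ 1 ∷ 2 ∷ 4 ∷ 8 ∷ 16 ∷ []) (2 ∷ 4 ∷ 8 ∷ 16 ∷ 32 ∷ 1 ∷ []) (1 ∷ 2 ∷ 4 ∷ 8 ∷ [])
    ∷ transform (1 ∷ 2 ∷ 4 ∷ 33 ∷ 8 ∷ 16 ∷ []) (1 ∷ 2 ∷ 4 ∷ 16 ∷ 32 ∷ 9 ∷ []) (1 ∷ 2 ∷ 4 ∷ 8 ∷ [])
    ∷ transform (1 ∷ 2 ∷ 4 ∷ 34 ∷ 8 ∷ 16 ∷ []) (1 ∷ 2 ∷ 4 ∷ 16 ∷ 32 ∷ 10 ∷ []) (1 ∷ 2 ∷ 4 ∷ 8 ∷ [])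
    ∷ transform (1 ∷ 2 ∷ 35 ∷ 4 ∷ 8 ∷ 16 ∷ []) (1 ∷ 2 ∷ 8 ∷ 16 ∷ 32 ∷ 7 ∷ []) (1 ∷ 2 ∷ 4 ∷ 8 ∷ [])
    ∷ transform (1 ∷ 2 ∷ 4 ∷ 36 ∷ 8 ∷ 16 ∷ []) (1 ∷ 2 ∷ 4 ∷ 16 ∷ 32 ∷ 12 ∷ []) (1 ∷ 2 ∷ 4 ∷ 8 ∷ [])
    ∷ transform (1 ∷ 2 ∷ 4 ∷ 37 ∷ 8 ∷ 16 ∷ []) (1 ∷ 2 ∷ 4 ∷ 16 ∷ 32 ∷ 13 ∷ []) (1 ∷ 2 ∷ 4 ∷ 8 ∷ [])
    ∷ transform (1 ∷ 2 ∷ 4 ∷ 38 ∷ 8 ∷ 16 ∷ []) (1 ∷ 2 ∷ 4 ∷ 16 ∷ 32 ∷ 14 ∷ []) (1 ∷ 2 ∷ 4 ∷ 8 ∷ [])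
    ∷ transform (1 ∷ 2 ∷ 4 ∷ 39 ∷ 8 ∷ 16 ∷ []) (1 ∷ 2 ∷ 4 ∷ 16 ∷ 32 ∷ 15 ∷ []) (1 ∷ 2 ∷ 4 ∷ 8 ∷ [])
    ∷ transform (40 ∷ 1 ∷ 2 ∷ 4 ∷ 8 ∷ 16 ∷ []) (2 ∷ 4 ∷ 8 ∷ 16 ∷ 32 ∷ 17 ∷ []) (1 ∷ 2 ∷ 4 ∷ 8 ∷ [])
    ∷ transform (1 ∷ 2 ∷ 4 ∷ 41 ∷ 8 ∷ 16 ∷ []) (1 ∷ 2 ∷ 4 ∷ 16 ∷ 32 ∷ 25 ∷ []) (1 ∷ 2 ∷ 4 ∷ 8 ∷ [])
    ∷ transform (1 ∷ 2 ∷ 4 ∷ 42 ∷ 8 ∷ 16 ∷ []) (1 ∷ 2 ∷ 4 ∷ 16 ∷ 32 ∷ 26 ∷ []) (1 ∷ 2 ∷ 4 ∷ 8 ∷ [])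
    ∷ transform (1 ∷ 2 ∷ 43 ∷ 4 ∷ 8 ∷ 16 ∷ []) (1 ∷ 2 ∷ 8 ∷ 16 ∷ 32 ∷ 23 ∷ []) (1 ∷ 2 ∷ 4 ∷ 8 ∷ [])
    ∷ transform (1 ∷ 2 ∷ 4 ∷ 44 ∷ 8 ∷ 16 ∷ []) (1 ∷ 2 ∷ 4 ∷ 16 ∷ 32 ∷ 28 ∷ []) (1 ∷ 2 ∷ 4 ∷ 8 ∷ [])
    ∷ transform (1 ∷ 2 ∷ 4 ∷ 45 ∷ 8 ∷ 16 ∷ []) (1 ∷ 2 ∷ 4 ∷ 16 ∷ 32 ∷ 29 ∷ []) (1 ∷ 2 ∷ 4 ∷ 8 ∷ [])
    ∷ transform (1 ∷ 2 ∷ 4 ∷ 46 ∷ 8 ∷ 16 ∷ []) (1 ∷ 2 ∷ 4 ∷ 16 ∷ 32 ∷ 30 ∷ []) (1 ∷ 2 ∷ 4 ∷ 8 ∷ [])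
    ∷ transform (1 ∷ 2 ∷ 4 ∷ 47 ∷ 8 ∷ 16 ∷ []) (1 ∷ 2 ∷ 4 ∷ 16 ∷ 32 ∷ 31 ∷ []) (1 ∷ 2 ∷ 4 ∷ 8 ∷ [])
    ∷ transform (48 ∷ 1 ∷ 2 ∷ 4 ∷ 8 ∷ 16 ∷ []) (2 ∷ 4 ∷ 8 ∷ 16 ∷ 32 ∷ 33 ∷ []) (1 ∷ 2 ∷ 4 ∷ 8 ∷ [])
    ∷ transform (1 ∷ 2 ∷ 4 ∷ 49 ∷ 8 ∷ 16 ∷ []) (1 ∷ 2 ∷ 4 ∷ 16 ∷ 32 ∷ 41 ∷ []) (1 ∷ 2 ∷ 4 ∷ 8 ∷ [])
    ∷ transform (1 ∷ 2 ∷ 4 ∷ 50 ∷ 8 ∷ 16 ∷ []) (1 ∷ 2 ∷ 4 ∷ 16 ∷ 32 ∷ 42 ∷ []) (1 ∷ 2 ∷ 4 ∷ 8 ∷ [])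
    ∷ transform (1 ∷ 2 ∷ 51 ∷ 4 ∷ 8 ∷ 16 ∷ []) (1 ∷ 2 ∷ 8 ∷ 16 ∷ 32 ∷ 39 ∷ []) (1 ∷ 2 ∷ 4 ∷ 8 ∷ [])
    ∷ transform (1 ∷ 2 ∷ 4 ∷ 52 ∷ 8 ∷ 16 ∷ []) (1 ∷ 2 ∷ 4 ∷ 16 ∷ 32 ∷ 44 ∷ []) (1 ∷ 2 ∷ 4 ∷ 8 ∷ [])
    ∷ transform (1 ∷ 2 ∷ 4 ∷ 53 ∷ 8 ∷ 16 ∷ []) (1 ∷ 2 ∷ 4 ∷ 16 ∷ 32 ∷ 45 ∷ []) (1 ∷ 2 ∷ 4 ∷ 8 ∷ [])
    ∷ transform (1 ∷ 2 ∷ 4 ∷ 54 ∷ 8 ∷ 16 ∷ []) (1 ∷ 2 ∷ 4 ∷ 16 ∷ 32 ∷ 46 ∷ []) (1 ∷ 2 ∷ 4 ∷ 8 ∷ [])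
    ∷ transform (1 ∷ 2 ∷ 4 ∷ 55 ∷ 8 ∷ 16 ∷ []) (1 ∷ 2 ∷ 4 ∷ 16 ∷ 32 ∷ 47 ∷ []) (1 ∷ 2 ∷ 4 ∷ 8 ∷ [])
    ∷ transform (56 ∷ 1 ∷ 2 ∷ 4 ∷ 8 ∷ 16 ∷ []) (2 ∷ 4 ∷ 8 ∷ 16 ∷ 32 ∷ 49 ∷ []) (1 ∷ 2 ∷ 4 ∷ 8 ∷ [])
    ∷ transform (1 ∷ 2 ∷ 4 ∷ 57 ∷ 8 ∷ 16 ∷ []) (1 ∷ 2 ∷ 4 ∷ 16 ∷ 32 ∷ 57 ∷ []) (1 ∷ 2 ∷ 4 ∷ 8 ∷ [])
    ∷ transform (1 ∷ 2 ∷ 4 ∷ 58 ∷ 8 ∷ 16 ∷ []) (1 ∷ 2 ∷ 4 ∷ 16 ∷ 32 ∷ 58 ∷ []) (1 ∷ 2 ∷ 4 ∷ 8 ∷ [])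
    ∷ transform (1 ∷ 2 ∷ 59 ∷ 4 ∷ 8 ∷ 16 ∷ []) (1 ∷ 2 ∷ 8 ∷ 16 ∷ 32 ∷ 55 ∷ []) (1 ∷ 2 ∷ 4 ∷ 8 ∷ [])
    ∷ transform (1 ∷ 2 ∷ 4 ∷ 60 ∷ 8 ∷ 16 ∷ []) (1 ∷ 2 ∷ 4 ∷ 16 ∷ 32 ∷ 60 ∷ []) (1 ∷ 2 ∷ 4 ∷ 8 ∷ [])
    ∷ transform (1 ∷ 2 ∷ 4 ∷ 61 ∷ 8 ∷ 16 ∷ []) (1 ∷ 2 ∷ 4 ∷ 16 ∷ 32 ∷ 61 ∷ []) (1 ∷ 2 ∷ 4 ∷ 8 ∷ [])
    ∷ transform (1 ∷ 2 ∷ 4 ∷ 62 ∷ 8 ∷ 16 ∷ []) (1 ∷ 2 ∷ 4 ∷ 16 ∷ 32 ∷ 62 ∷ []) (1 ∷ 2 ∷ 4 ∷ 8 ∷ [])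
    ∷ transform (1 ∷ 2 ∷ 4 ∷ 63 ∷ 8 ∷ 16 ∷ []) (1 ∷ 2 ∷ 4 ∷ 16 ∷ 32 ∷ 63 ∷ []) (1 ∷ 2 ∷ 4 ∷ 8 ∷ [])
    ∷ []) ∷
  node (1 ∷ 2 ∷ 4 ∷ 8 ∷ [])
    ( plane 1 2 4
    ∷ plane 2 1 4
    ∷ plane 3 1 4
    ∷ plane 4 1 2
    ∷ plane 5 1 2
    ∷ plane 6 1 2
    ∷ plane 7 1 2
    ∷ plane 8 1 4
    ∷ plane 9 1 4
    ∷ plane 10 2 4
    ∷ plane 11 1 2
    ∷ plane 12 1 4
    ∷ plane 13 1 4
    ∷ plane 14 2 4
    ∷ transform (1 ∷ 2 ∷ 4 ∷ 8 ∷ 16 ∷ 32 ∷ []) (1 ∷ 2 ∷ 4 ∷ 8 ∷ 16 ∷ 32 ∷ []) (1 ∷ 2 ∷ 4 ∷ 8 ∷ 15 ∷ [])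
    ∷ transform (16 ∷ 1 ∷ 2 ∷ 4 ∷ 8 ∷ 32 ∷ []) (2 ∷ 4 ∷ 8 ∷ 16 ∷ 1 ∷ 32 ∷ []) (1 ∷ 2 ∷ 4 ∷ 8 ∷ 16 ∷ [])
    ∷ transform (1 ∷ 2 ∷ 17 ∷ 4 ∷ 8 ∷ 32 ∷ []) (1 ∷ 2 ∷ 8 ∷ 16 ∷ 5 ∷ 32 ∷ []) (1 ∷ 2 ∷ 4 ∷ 8 ∷ 16 ∷ [])
    ∷ transform (1 ∷ 2 ∷ 18 ∷ 4 ∷ 8 ∷ 32 ∷ []) (1 ∷ 2 ∷ 8 ∷ 16 ∷ 6 ∷ 32 ∷ []) (1 ∷ 2 ∷ 4 ∷ 8 ∷ 16 ∷ [])
    ∷ transform (1 ∷ 2 ∷ 19 ∷ 4 ∷ 8 ∷ 32 ∷ []) (1 ∷ 2 ∷ 8 ∷ 16 ∷ 7 ∷ 32 ∷ []) (1 ∷ 2 ∷ 4 ∷ 8 ∷ 16 ∷ [])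
    ∷ transform (1 ∷ 2 ∷ 4 ∷ 20 ∷ 8 ∷ 32 ∷ []) (1 ∷ 2 ∷ 4 ∷ 16 ∷ 12 ∷ 32 ∷ []) (1 ∷ 2 ∷ 4 ∷ 8 ∷ 16 ∷ [])
    ∷ transform (1 ∷ 2 ∷ 4 ∷ 21 ∷ 8 ∷ 32 ∷ []) (1 ∷ 2 ∷ 4 ∷ 16 ∷ 13 ∷ 32 ∷ []) (1 ∷ 2 ∷ 4 ∷ 8 ∷ 16 ∷ [])
    ∷ transform (1 ∷ 2 ∷ 4 ∷ 22 ∷ 8 ∷ 32 ∷ []) (1 ∷ 2 ∷ 4 ∷ 16 ∷ 14 ∷ 32 ∷ []) (1 ∷ 2 ∷ 4 ∷ 8 ∷ 16 ∷ [])
    ∷ transform (1 ∷ 2 ∷ 4 ∷ 23 ∷ 8 ∷ 32 ∷ []) (1 ∷ 2 ∷ 4 ∷ 16 ∷ 15 ∷ 32 ∷ []) (1 ∷ 2 ∷ 4 ∷ 8 ∷ 16 ∷ [])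
    ∷ transform (1 ∷ 2 ∷ 4 ∷ 8 ∷ 24 ∷ 32 ∷ []) (1 ∷ 2 ∷ 4 ∷ 8 ∷ 24 ∷ 32 ∷ []) (1 ∷ 2 ∷ 4 ∷ 8 ∷ 16 ∷ [])
    ∷ transform (1 ∷ 2 ∷ 4 ∷ 8 ∷ 25 ∷ 32 ∷ []) (1 ∷ 2 ∷ 4 ∷ 8 ∷ 25 ∷ 32 ∷ []) (1 ∷ 2 ∷ 4 ∷ 8 ∷ 16 ∷ [])
    ∷ transform (1 ∷ 2 ∷ 4 ∷ 8 ∷ 26 ∷ 32 ∷ []) (1 ∷ 2 ∷ 4 ∷ 8 ∷ 26 ∷ 32 ∷ []) (1 ∷ 2 ∷ 4 ∷ 8 ∷ 16 ∷ [])
    ∷ transform (1 ∷ 2 ∷ 4 ∷ 8 ∷ 27 ∷ 32 ∷ []) (1 ∷ 2 ∷ 4 ∷ 8 ∷ 27 ∷ 32 ∷ []) (1 ∷ 2 ∷ 4 ∷ 8 ∷ 16 ∷ [])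
    ∷ transform (1 ∷ 2 ∷ 4 ∷ 8 ∷ 28 ∷ 32 ∷ []) (1 ∷ 2 ∷ 4 ∷ 8 ∷ 28 ∷ 32 ∷ []) (1 ∷ 2 ∷ 4 ∷ 8 ∷ 16 ∷ [])
    ∷ transform (1 ∷ 2 ∷ 4 ∷ 8 ∷ 29 ∷ 32 ∷ []) (1 ∷ 2 ∷ 4 ∷ 8 ∷ 29 ∷ 32 ∷ []) (1 ∷ 2 ∷ 4 ∷ 8 ∷ 16 ∷ [])
    ∷ transform (1 ∷ 2 ∷ 4 ∷ 8 ∷ 30 ∷ 32 ∷ []) (1 ∷ 2 ∷ 4 ∷ 8 ∷ 30 ∷ 32 ∷ []) (1 ∷ 2 ∷ 4 ∷ 8 ∷ 16 ∷ [])
    ∷ transform (1 ∷ 2 ∷ 4 ∷ 8 ∷ 31 ∷ 32 ∷ []) (1 ∷ 2 ∷ 4 ∷ 8 ∷ 31 ∷ 32 ∷ []) (1 ∷ 2 ∷ 4 ∷ 8 ∷ 16 ∷ [])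
    ∷ transform (32 ∷ 1 ∷ 2 ∷ 4 ∷ 8 ∷ 16 ∷ []) (2 ∷ 4 ∷ 8 ∷ 16 ∷ 32 ∷ 1 ∷ []) (1 ∷ 2 ∷ 4 ∷ 8 ∷ 16 ∷ [])
    ∷ transform (1 ∷ 2 ∷ 33 ∷ 4 ∷ 8 ∷ 16 ∷ []) (1 ∷ 2 ∷ 8 ∷ 16 ∷ 32 ∷ 5 ∷ []) (1 ∷ 2 ∷ 4 ∷ 8 ∷ 16 ∷ [])
    ∷ transform (1 ∷ 2 ∷ 34 ∷ 4 ∷ 8 ∷ 16 ∷ []) (1 ∷ 2 ∷ 8 ∷ 16 ∷ 32 ∷ 6 ∷ []) (1 ∷ 2 ∷ 4 ∷ 8 ∷ 16 ∷ [])
    ∷ transform (1 ∷ 2 ∷ 35 ∷ 4 ∷ 8 ∷ 16 ∷ []) (1 ∷ 2 ∷ 8 ∷ 16 ∷ 32 ∷ 7 ∷ []) (1 ∷ 2 ∷ 4 ∷ 8 ∷ 16 ∷ [])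
    ∷ transform (1 ∷ 2 ∷ 4 ∷ 36 ∷ 8 ∷ 16 ∷ []) (1 ∷ 2 ∷ 4 ∷ 16 ∷ 32 ∷ 12 ∷ []) (1 ∷ 2 ∷ 4 ∷ 8 ∷ 16 ∷ [])
    ∷ transform (1 ∷ 2 ∷ 4 ∷ 37 ∷ 8 ∷ 16 ∷ []) (1 ∷ 2 ∷ 4 ∷ 16 ∷ 32 ∷ 13 ∷ []) (1 ∷ 2 ∷ 4 ∷ 8 ∷ 16 ∷ [])
    ∷ transform (1 ∷ 2 ∷ 4 ∷ 38 ∷ 8 ∷ 16 ∷ []) (1 ∷ 2 ∷ 4 ∷ 16 ∷ 32 ∷ 14 ∷ []) (1 ∷ 2 ∷ 4 ∷ 8 ∷ 16 ∷ [])
    ∷ transform (1 ∷ 2 ∷ 4 ∷ 39 ∷ 8 ∷ 16 ∷ []) (1 ∷ 2 ∷ 4 ∷ 16 ∷ 32 ∷ 15 ∷ []) (1 ∷ 2 ∷ 4 ∷ 8 ∷ 16 ∷ [])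
    ∷ transform (1 ∷ 2 ∷ 4 ∷ 8 ∷ 40 ∷ 16 ∷ []) (1 ∷ 2 ∷ 4 ∷ 8 ∷ 32 ∷ 24 ∷ []) (1 ∷ 2 ∷ 4 ∷ 8 ∷ 16 ∷ [])
    ∷ transform (1 ∷ 2 ∷ 4 ∷ 8 ∷ 41 ∷ 16 ∷ []) (1 ∷ 2 ∷ 4 ∷ 8 ∷ 32 ∷ 25 ∷ []) (1 ∷ 2 ∷ 4 ∷ 8 ∷ 16 ∷ [])
    ∷ transform (1 ∷ 2 ∷ 4 ∷ 8 ∷ 42 ∷ 16 ∷ []) (1 ∷ 2 ∷ 4 ∷ 8 ∷ 32 ∷ 26 ∷ []) (1 ∷ 2 ∷ 4 ∷ 8 ∷ 16 ∷ [])
    ∷ transform (1 ∷ 2 ∷ 4 ∷ 8 ∷ 43 ∷ 16 ∷ []) (1 ∷ 2 ∷ 4 ∷ 8 ∷ 32 ∷ 27 ∷ []) (1 ∷ 2 ∷ 4 ∷ 8 ∷ 16 ∷ [])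
    ∷ transform (1 ∷ 2 ∷ 4 ∷ 8 ∷ 44 ∷ 16 ∷ []) (1 ∷ 2 ∷ 4 ∷ 8 ∷ 32 ∷ 28 ∷ []) (1 ∷ 2 ∷ 4 ∷ 8 ∷ 16 ∷ [])
    ∷ transform (1 ∷ 2 ∷ 4 ∷ 8 ∷ 45 ∷ 16 ∷ []) (1 ∷ 2 ∷ 4 ∷ 8 ∷ 32 ∷ 29 ∷ []) (1 ∷ 2 ∷ 4 ∷ 8 ∷ 16 ∷ [])
    ∷ transform (1 ∷ 2 ∷ 4 ∷ 8 ∷ 46 ∷ 16 ∷ []) (1 ∷ 2 ∷ 4 ∷ 8 ∷ 32 ∷ 30 ∷ []) (1 ∷ 2 ∷ 4 ∷ 8 ∷ 16 ∷ [])
    ∷ transform (1 ∷ 2 ∷ 4 ∷ 8 ∷ 47 ∷ 16 ∷ []) (1 ∷ 2 ∷ 4 ∷ 8 ∷ 32 ∷ 31 ∷ []) (1 ∷ 2 ∷ 4 ∷ 8 ∷ 16 ∷ [])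
    ∷ transform (48 ∷ 1 ∷ 2 ∷ 4 ∷ 8 ∷ 16 ∷ []) (2 ∷ 4 ∷ 8 ∷ 16 ∷ 32 ∷ 33 ∷ []) (1 ∷ 2 ∷ 4 ∷ 8 ∷ 16 ∷ [])
    ∷ transform (1 ∷ 2 ∷ 49 ∷ 4 ∷ 8 ∷ 16 ∷ []) (1 ∷ 2 ∷ 8 ∷ 16 ∷ 32 ∷ 37 ∷ []) (1 ∷ 2 ∷ 4 ∷ 8 ∷ 16 ∷ [])
    ∷ transform (1 ∷ 2 ∷ 50 ∷ 4 ∷ 8 ∷ 16 ∷ []) (1 ∷ 2 ∷ 8 ∷ 16 ∷ 32 ∷ 38 ∷ []) (1 ∷ 2 ∷ 4 ∷ 8 ∷ 16 ∷ [])
    ∷ transform (1 ∷ 2 ∷ 51 ∷ 4 ∷ 8 ∷ 16 ∷ []) (1 ∷ 2 ∷ 8 ∷ 16 ∷ 32 ∷ 39 ∷ []) (1 ∷ 2 ∷ 4 ∷ 8 ∷ 16 ∷ [])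
    ∷ transform (1 ∷ 2 ∷ 4 ∷ 52 ∷ 8 ∷ 16 ∷ []) (1 ∷ 2 ∷ 4 ∷ 16 ∷ 32 ∷ 44 ∷ []) (1 ∷ 2 ∷ 4 ∷ 8 ∷ 16 ∷ [])
    ∷ transform (1 ∷ 2 ∷ 4 ∷ 53 ∷ 8 ∷ 16 ∷ []) (1 ∷ 2 ∷ 4 ∷ 16 ∷ 32 ∷ 45 ∷ []) (1 ∷ 2 ∷ 4 ∷ 8 ∷ 16 ∷ [])
    ∷ transform (1 ∷ 2 ∷ 4 ∷ 54 ∷ 8 ∷ 16 ∷ []) (1 ∷ 2 ∷ 4 ∷ 16 ∷ 32 ∷ 46 ∷ []) (1 ∷ 2 ∷ 4 ∷ 8 ∷ 16 ∷ [])
    ∷ transform (1 ∷ 2 ∷ 4 ∷ 55 ∷ 8 ∷ 16 ∷ []) (1 ∷ 2 ∷ 4 ∷ 16 ∷ 32 ∷ 47 ∷ []) (1 ∷ 2 ∷ 4 ∷ 8 ∷ 16 ∷ [])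
    ∷ transform (1 ∷ 2 ∷ 4 ∷ 8 ∷ 56 ∷ 16 ∷ []) (1 ∷ 2 ∷ 4 ∷ 8 ∷ 32 ∷ 56 ∷ []) (1 ∷ 2 ∷ 4 ∷ 8 ∷ 16 ∷ [])
    ∷ transform (1 ∷ 2 ∷ 4 ∷ 8 ∷ 57 ∷ 16 ∷ []) (1 ∷ 2 ∷ 4 ∷ 8 ∷ 32 ∷ 57 ∷ []) (1 ∷ 2 ∷ 4 ∷ 8 ∷ 16 ∷ [])
    ∷ transform (1 ∷ 2 ∷ 4 ∷ 8 ∷ 58 ∷ 16 ∷ []) (1 ∷ 2 ∷ 4 ∷ 8 ∷ 32 ∷ 58 ∷ []) (1 ∷ 2 ∷ 4 ∷ 8 ∷ 16 ∷ [])
    ∷ transform (1 ∷ 2 ∷ 4 ∷ 8 ∷ 59 ∷ 16 ∷ []) (1 ∷ 2 ∷ 4 ∷ 8 ∷ 32 ∷ 59 ∷ []) (1 ∷ 2 ∷ 4 ∷ 8 ∷ 16 ∷ [])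
    ∷ transform (1 ∷ 2 ∷ 4 ∷ 8 ∷ 60 ∷ 16 ∷ []) (1 ∷ 2 ∷ 4 ∷ 8 ∷ 32 ∷ 60 ∷ []) (1 ∷ 2 ∷ 4 ∷ 8 ∷ 16 ∷ [])
    ∷ transform (1 ∷ 2 ∷ 4 ∷ 8 ∷ 61 ∷ 16 ∷ []) (1 ∷ 2 ∷ 4 ∷ 8 ∷ 32 ∷ 61 ∷ []) (1 ∷ 2 ∷ 4 ∷ 8 ∷ 16 ∷ [])
    ∷ transform (1 ∷ 2 ∷ 4 ∷ 8 ∷ 62 ∷ 16 ∷ []) (1 ∷ 2 ∷ 4 ∷ 8 ∷ 32 ∷ 62 ∷ []) (1 ∷ 2 ∷ 4 ∷ 8 ∷ 16 ∷ [])
    ∷ transform (1 ∷ 2 ∷ 4 ∷ 8 ∷ 63 ∷ 16 ∷ []) (1 ∷ 2 ∷ 4 ∷ 8 ∷ 32 ∷ 63 ∷ []) (1 ∷ 2 ∷ 4 ∷ 8 ∷ 16 ∷ [])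
    ∷ []) ∷
  node (1 ∷ 2 ∷ 4 ∷ 8 ∷ 15 ∷ [])
    ( plane 1 2 4
    ∷ plane 2 1 4
    ∷ plane 3 1 4
    ∷ plane 4 1 2
    ∷ plane 5 1 2
    ∷ plane 6 1 2
    ∷ plane 7 1 2
    ∷ plane 8 1 4
    ∷ plane 9 1 4
    ∷ plane 10 2 5
    ∷ plane 11 3 4
    ∷ plane 12 1 2
    ∷ plane 13 1 2
    ∷ plane 14 1 2
    ∷ plane 15 1 2
    ∷ transform (1 ∷ 2 ∷ 4 ∷ 8 ∷ 16 ∷ 32 ∷ []) (1 ∷ 2 ∷ 4 ∷ 8 ∷ 16 ∷ 32 ∷ []) (1 ∷ 2 ∷ 4 ∷ 8 ∷ 15 ∷ 16 ∷ [])
    ∷ transform (1 ∷ 2 ∷ 4 ∷ 8 ∷ 17 ∷ 32 ∷ []) (1 ∷ 2 ∷ 4 ∷ 8 ∷ 17 ∷ 32 ∷ []) (1 ∷ 2 ∷ 4 ∷ 8 ∷ 15 ∷ 16 ∷ [])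
    ∷ transform (1 ∷ 2 ∷ 4 ∷ 8 ∷ 18 ∷ 32 ∷ []) (1 ∷ 2 ∷ 4 ∷ 8 ∷ 18 ∷ 32 ∷ []) (1 ∷ 2 ∷ 4 ∷ 8 ∷ 15 ∷ 16 ∷ [])
    ∷ transform (1 ∷ 2 ∷ 4 ∷ 8 ∷ 19 ∷ 32 ∷ []) (1 ∷ 2 ∷ 4 ∷ 8 ∷ 19 ∷ 32 ∷ []) (1 ∷ 2 ∷ 4 ∷ 8 ∷ 15 ∷ 16 ∷ [])
    ∷ transform (1 ∷ 2 ∷ 4 ∷ 8 ∷ 20 ∷ 32 ∷ []) (1 ∷ 2 ∷ 4 ∷ 8 ∷ 20 ∷ 32 ∷ []) (1 ∷ 2 ∷ 4 ∷ 8 ∷ 15 ∷ 16 ∷ [])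
    ∷ transform (1 ∷ 2 ∷ 4 ∷ 8 ∷ 21 ∷ 32 ∷ []) (1 ∷ 2 ∷ 4 ∷ 8 ∷ 21 ∷ 32 ∷ []) (1 ∷ 2 ∷ 4 ∷ 8 ∷ 15 ∷ 16 ∷ [])
    ∷ transform (1 ∷ 2 ∷ 4 ∷ 8 ∷ 22 ∷ 32 ∷ []) (1 ∷ 2 ∷ 4 ∷ 8 ∷ 22 ∷ 32 ∷ []) (1 ∷ 2 ∷ 4 ∷ 8 ∷ 15 ∷ 16 ∷ [])
    ∷ transform (1 ∷ 2 ∷ 4 ∷ 8 ∷ 23 ∷ 32 ∷ []) (1 ∷ 2 ∷ 4 ∷ 8 ∷ 23 ∷ 32 ∷ []) (1 ∷ 2 ∷ 4 ∷ 8 ∷ 15 ∷ 16 ∷ [])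
    ∷ transform (1 ∷ 2 ∷ 4 ∷ 8 ∷ 24 ∷ 32 ∷ []) (1 ∷ 2 ∷ 4 ∷ 8 ∷ 24 ∷ 32 ∷ []) (1 ∷ 2 ∷ 4 ∷ 8 ∷ 15 ∷ 16 ∷ [])
    ∷ transform (1 ∷ 2 ∷ 4 ∷ 8 ∷ 25 ∷ 32 ∷ []) (1 ∷ 2 ∷ 4 ∷ 8 ∷ 25 ∷ 32 ∷ []) (1 ∷ 2 ∷ 4 ∷ 8 ∷ 15 ∷ 16 ∷ [])
    ∷ transform (1 ∷ 2 ∷ 4 ∷ 8 ∷ 26 ∷ 32 ∷ []) (1 ∷ 2 ∷ 4 ∷ 8 ∷ 26 ∷ 32 ∷ []) (1 ∷ 2 ∷ 4 ∷ 8 ∷ 15 ∷ 16 ∷ [])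
    ∷ transform (1 ∷ 2 ∷ 4 ∷ 8 ∷ 27 ∷ 32 ∷ []) (1 ∷ 2 ∷ 4 ∷ 8 ∷ 27 ∷ 32 ∷ []) (1 ∷ 2 ∷ 4 ∷ 8 ∷ 15 ∷ 16 ∷ [])
    ∷ transform (1 ∷ 2 ∷ 4 ∷ 8 ∷ 28 ∷ 32 ∷ []) (1 ∷ 2 ∷ 4 ∷ 8 ∷ 28 ∷ 32 ∷ []) (1 ∷ 2 ∷ 4 ∷ 8 ∷ 15 ∷ 16 ∷ [])
    ∷ transform (1 ∷ 2 ∷ 4 ∷ 8 ∷ 29 ∷ 32 ∷ []) (1 ∷ 2 ∷ 4 ∷ 8 ∷ 29 ∷ 32 ∷ []) (1 ∷ 2 ∷ 4 ∷ 8 ∷ 15 ∷ 16 ∷ [])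
    ∷ transform (1 ∷ 2 ∷ 4 ∷ 8 ∷ 30 ∷ 32 ∷ []) (1 ∷ 2 ∷ 4 ∷ 8 ∷ 30 ∷ 32 ∷ []) (1 ∷ 2 ∷ 4 ∷ 8 ∷ 15 ∷ 16 ∷ [])
    ∷ transform (1 ∷ 2 ∷ 4 ∷ 8 ∷ 31 ∷ 32 ∷ []) (1 ∷ 2 ∷ 4 ∷ 8 ∷ 31 ∷ 32 ∷ []) (1 ∷ 2 ∷ 4 ∷ 8 ∷ 15 ∷ 16 ∷ [])
    ∷ transform (1 ∷ 2 ∷ 4 ∷ 8 ∷ 32 ∷ 16 ∷ []) (1 ∷ 2 ∷ 4 ∷ 8 ∷ 32 ∷ 16 ∷ []) (1 ∷ 2 ∷ 4 ∷ 8 ∷ 15 ∷ 16 ∷ [])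
    ∷ transform (1 ∷ 2 ∷ 4 ∷ 8 ∷ 33 ∷ 16 ∷ []) (1 ∷ 2 ∷ 4 ∷ 8 ∷ 32 ∷ 17 ∷ []) (1 ∷ 2 ∷ 4 ∷ 8 ∷ 15 ∷ 16 ∷ [])
    ∷ transform (1 ∷ 2 ∷ 4 ∷ 8 ∷ 34 ∷ 16 ∷ []) (1 ∷ 2 ∷ 4 ∷ 8 ∷ 32 ∷ 18 ∷ []) (1 ∷ 2 ∷ 4 ∷ 8 ∷ 15 ∷ 16 ∷ [])
    ∷ transform (1 ∷ 2 ∷ 4 ∷ 8 ∷ 35 ∷ 16 ∷ []) (1 ∷ 2 ∷ 4 ∷ 8 ∷ 32 ∷ 19 ∷ []) (1 ∷ 2 ∷ 4 ∷ 8 ∷ 15 ∷ 16 ∷ [])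
    ∷ transform (1 ∷ 2 ∷ 4 ∷ 8 ∷ 36 ∷ 16 ∷ []) (1 ∷ 2 ∷ 4 ∷ 8 ∷ 32 ∷ 20 ∷ []) (1 ∷ 2 ∷ 4 ∷ 8 ∷ 15 ∷ 16 ∷ [])
    ∷ transform (1 ∷ 2 ∷ 4 ∷ 8 ∷ 37 ∷ 16 ∷ []) (1 ∷ 2 ∷ 4 ∷ 8 ∷ 32 ∷ 21 ∷ []) (1 ∷ 2 ∷ 4 ∷ 8 ∷ 15 ∷ 16 ∷ [])
    ∷ transform (1 ∷ 2 ∷ 4 ∷ 8 ∷ 38 ∷ 16 ∷ []) (1 ∷ 2 ∷ 4 ∷ 8 ∷ 32 ∷ 22 ∷ []) (1 ∷ 2 ∷ 4 ∷ 8 ∷ 15 ∷ 16 ∷ [])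
    ∷ transform (1 ∷ 2 ∷ 4 ∷ 8 ∷ 39 ∷ 16 ∷ []) (1 ∷ 2 ∷ 4 ∷ 8 ∷ 32 ∷ 23 ∷ []) (1 ∷ 2 ∷ 4 ∷ 8 ∷ 15 ∷ 16 ∷ [])
    ∷ transform (1 ∷ 2 ∷ 4 ∷ 8 ∷ 40 ∷ 16 ∷ []) (1 ∷ 2 ∷ 4 ∷ 8 ∷ 32 ∷ 24 ∷ []) (1 ∷ 2 ∷ 4 ∷ 8 ∷ 15 ∷ 16 ∷ [])
    ∷ transform (1 ∷ 2 ∷ 4 ∷ 8 ∷ 41 ∷ 16 ∷ []) (1 ∷ 2 ∷ 4 ∷ 8 ∷ 32 ∷ 25 ∷ []) (1 ∷ 2 ∷ 4 ∷ 8 ∷ 15 ∷ 16 ∷ [])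
    ∷ transform (1 ∷ 2 ∷ 4 ∷ 8 ∷ 42 ∷ 16 ∷ []) (1 ∷ 2 ∷ 4 ∷ 8 ∷ 32 ∷ 26 ∷ []) (1 ∷ 2 ∷ 4 ∷ 8 ∷ 15 ∷ 16 ∷ [])
    ∷ transform (1 ∷ 2 ∷ 4 ∷ 8 ∷ 43 ∷ 16 ∷ []) (1 ∷ 2 ∷ 4 ∷ 8 ∷ 32 ∷ 27 ∷ []) (1 ∷ 2 ∷ 4 ∷ 8 ∷ 15 ∷ 16 ∷ [])
    ∷ transform (1 ∷ 2 ∷ 4 ∷ 8 ∷ 44 ∷ 16 ∷ []) (1 ∷ 2 ∷ 4 ∷ 8 ∷ 32 ∷ 28 ∷ []) (1 ∷ 2 ∷ 4 ∷ 8 ∷ 15 ∷ 16 ∷ [])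
    ∷ transform (1 ∷ 2 ∷ 4 ∷ 8 ∷ 45 ∷ 16 ∷ []) (1 ∷ 2 ∷ 4 ∷ 8 ∷ 32 ∷ 29 ∷ []) (1 ∷ 2 ∷ 4 ∷ 8 ∷ 15 ∷ 16 ∷ [])
    ∷ transform (1 ∷ 2 ∷ 4 ∷ 8 ∷ 46 ∷ 16 ∷ []) (1 ∷ 2 ∷ 4 ∷ 8 ∷ 32 ∷ 30 ∷ []) (1 ∷ 2 ∷ 4 ∷ 8 ∷ 15 ∷ 16 ∷ [])
    ∷ transform (1 ∷ 2 ∷ 4 ∷ 8 ∷ 47 ∷ 16 ∷ []) (1 ∷ 2 ∷ 4 ∷ 8 ∷ 32 ∷ 31 ∷ []) (1 ∷ 2 ∷ 4 ∷ 8 ∷ 15 ∷ 16 ∷ [])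
    ∷ transform (1 ∷ 2 ∷ 4 ∷ 8 ∷ 48 ∷ 16 ∷ []) (1 ∷ 2 ∷ 4 ∷ 8 ∷ 32 ∷ 48 ∷ []) (1 ∷ 2 ∷ 4 ∷ 8 ∷ 15 ∷ 16 ∷ [])
    ∷ transform (1 ∷ 2 ∷ 4 ∷ 8 ∷ 49 ∷ 16 ∷ []) (1 ∷ 2 ∷ 4 ∷ 8 ∷ 32 ∷ 49 ∷ []) (1 ∷ 2 ∷ 4 ∷ 8 ∷ 15 ∷ 16 ∷ [])
    ∷ transform (1 ∷ 2 ∷ 4 ∷ 8 ∷ 50 ∷ 16 ∷ []) (1 ∷ 2 ∷ 4 ∷ 8 ∷ 32 ∷ 50 ∷ []) (1 ∷ 2 ∷ 4 ∷ 8 ∷ 15 ∷ 16 ∷ [])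
    ∷ transform (1 ∷ 2 ∷ 4 ∷ 8 ∷ 51 ∷ 16 ∷ []) (1 ∷ 2 ∷ 4 ∷ 8 ∷ 32 ∷ 51 ∷ []) (1 ∷ 2 ∷ 4 ∷ 8 ∷ 15 ∷ 16 ∷ [])
    ∷ transform (1 ∷ 2 ∷ 4 ∷ 8 ∷ 52 ∷ 16 ∷ []) (1 ∷ 2 ∷ 4 ∷ 8 ∷ 32 ∷ 52 ∷ []) (1 ∷ 2 ∷ 4 ∷ 8 ∷ 15 ∷ 16 ∷ [])
    ∷ transform (1 ∷ 2 ∷ 4 ∷ 8 ∷ 53 ∷ 16 ∷ []) (1 ∷ 2 ∷ 4 ∷ 8 ∷ 32 ∷ 53 ∷ []) (1 ∷ 2 ∷ 4 ∷ 8 ∷ 15 ∷ 16 ∷ [])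
    ∷ transform (1 ∷ 2 ∷ 4 ∷ 8 ∷ 54 ∷ 16 ∷ []) (1 ∷ 2 ∷ 4 ∷ 8 ∷ 32 ∷ 54 ∷ []) (1 ∷ 2 ∷ 4 ∷ 8 ∷ 15 ∷ 16 ∷ [])
    ∷ transform (1 ∷ 2 ∷ 4 ∷ 8 ∷ 55 ∷ 16 ∷ []) (1 ∷ 2 ∷ 4 ∷ 8 ∷ 32 ∷ 55 ∷ []) (1 ∷ 2 ∷ 4 ∷ 8 ∷ 15 ∷ 16 ∷ [])
    ∷ transform (1 ∷ 2 ∷ 4 ∷ 8 ∷ 56 ∷ 16 ∷ []) (1 ∷ 2 ∷ 4 ∷ 8 ∷ 32 ∷ 56 ∷ []) (1 ∷ 2 ∷ 4 ∷ 8 ∷ 15 ∷ 16 ∷ [])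
    ∷ transform (1 ∷ 2 ∷ 4 ∷ 8 ∷ 57 ∷ 16 ∷ []) (1 ∷ 2 ∷ 4 ∷ 8 ∷ 32 ∷ 57 ∷ []) (1 ∷ 2 ∷ 4 ∷ 8 ∷ 15 ∷ 16 ∷ [])
    ∷ transform (1 ∷ 2 ∷ 4 ∷ 8 ∷ 58 ∷ 16 ∷ []) (1 ∷ 2 ∷ 4 ∷ 8 ∷ 32 ∷ 58 ∷ []) (1 ∷ 2 ∷ 4 ∷ 8 ∷ 15 ∷ 16 ∷ [])
    ∷ transform (1 ∷ 2 ∷ 4 ∷ 8 ∷ 59 ∷ 16 ∷ []) (1 ∷ 2 ∷ 4 ∷ 8 ∷ 32 ∷ 59 ∷ []) (1 ∷ 2 ∷ 4 ∷ 8 ∷ 15 ∷ 16 ∷ [])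
    ∷ transform (1 ∷ 2 ∷ 4 ∷ 8 ∷ 60 ∷ 16 ∷ []) (1 ∷ 2 ∷ 4 ∷ 8 ∷ 32 ∷ 60 ∷ []) (1 ∷ 2 ∷ 4 ∷ 8 ∷ 15 ∷ 16 ∷ [])
    ∷ transform (1 ∷ 2 ∷ 4 ∷ 8 ∷ 61 ∷ 16 ∷ []) (1 ∷ 2 ∷ 4 ∷ 8 ∷ 32 ∷ 61 ∷ []) (1 ∷ 2 ∷ 4 ∷ 8 ∷ 15 ∷ 16 ∷ [])
    ∷ transform (1 ∷ 2 ∷ 4 ∷ 8 ∷ 62 ∷ 16 ∷ []) (1 ∷ 2 ∷ 4 ∷ 8 ∷ 32 ∷ 62 ∷ []) (1 ∷ 2 ∷ 4 ∷ 8 ∷ 15 ∷ 16 ∷ [])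
    ∷ transform (1 ∷ 2 ∷ 4 ∷ 8 ∷ 63 ∷ 16 ∷ []) (1 ∷ 2 ∷ 4 ∷ 8 ∷ 32 ∷ 63 ∷ []) (1 ∷ 2 ∷ 4 ∷ 8 ∷ 15 ∷ 16 ∷ [])
    ∷ []) ∷
  node (1 ∷ 2 ∷ 4 ∷ 8 ∷ 16 ∷ [])
    ( plane 1 2 4
    ∷ plane 2 1 4
    ∷ plane 3 1 4
    ∷ plane 4 1 2
    ∷ plane 5 1 2
    ∷ plane 6 1 2
    ∷ plane 7 1 2
    ∷ plane 8 2 16
    ∷ plane 9 1 4
    ∷ plane 10 2 16
    ∷ plane 11 1 2
    ∷ plane 12 1 4
    ∷ plane 13 1 4
    ∷ plane 14 2 4
    ∷ transform (1 ∷ 2 ∷ 4 ∷ 8 ∷ 16 ∷ 32 ∷ []) (1 ∷ 2 ∷ 4 ∷ 8 ∷ 16 ∷ 32 ∷ []) (1 ∷ 2 ∷ 4 ∷ 8 ∷ 15 ∷ 16 ∷ [])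
    ∷ plane 16 1 2
    ∷ plane 17 1 2
    ∷ plane 18 1 2
    ∷ plane 19 1 2
    ∷ plane 20 4 8
    ∷ plane 21 1 4
    ∷ plane 22 2 4
    ∷ transform (16 ∷ 1 ∷ 2 ∷ 4 ∷ 8 ∷ 32 ∷ []) (2 ∷ 4 ∷ 8 ∷ 16 ∷ 1 ∷ 32 ∷ []) (1 ∷ 2 ∷ 4 ∷ 8 ∷ 15 ∷ 16 ∷ [])
    ∷ plane 24 2 8
    ∷ plane 25 1 8
    ∷ plane 26 2 8
    ∷ transform (16 ∷ 1 ∷ 2 ∷ 8 ∷ 4 ∷ 32 ∷ []) (2 ∷ 4 ∷ 16 ∷ 8 ∷ 1 ∷ 32 ∷ []) (1 ∷ 2 ∷ 4 ∷ 8 ∷ 15 ∷ 16 ∷ [])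
    ∷ plane 28 4 8
    ∷ transform (16 ∷ 1 ∷ 4 ∷ 8 ∷ 2 ∷ 32 ∷ []) (2 ∷ 16 ∷ 4 ∷ 8 ∷ 1 ∷ 32 ∷ []) (1 ∷ 2 ∷ 4 ∷ 8 ∷ 15 ∷ 16 ∷ [])
    ∷ transform (16 ∷ 2 ∷ 4 ∷ 8 ∷ 1 ∷ 32 ∷ []) (16 ∷ 2 ∷ 4 ∷ 8 ∷ 1 ∷ 32 ∷ []) (1 ∷ 2 ∷ 4 ∷ 8 ∷ 15 ∷ 16 ∷ [])
    ∷ transform (16 ∷ 1 ∷ 2 ∷ 4 ∷ 8 ∷ 32 ∷ []) (2 ∷ 4 ∷ 8 ∷ 16 ∷ 1 ∷ 32 ∷ []) (1 ∷ 2 ∷ 4 ∷ 8 ∷ 16 ∷ 31 ∷ [])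
    ∷ transform (16 ∷ 1 ∷ 2 ∷ 32 ∷ 4 ∷ 8 ∷ []) (2 ∷ 4 ∷ 16 ∷ 32 ∷ 1 ∷ 8 ∷ []) (1 ∷ 2 ∷ 4 ∷ 8 ∷ 16 ∷ 32 ∷ [])
    ∷ transform (16 ∷ 1 ∷ 2 ∷ 33 ∷ 4 ∷ 8 ∷ []) (2 ∷ 4 ∷ 16 ∷ 32 ∷ 1 ∷ 10 ∷ []) (1 ∷ 2 ∷ 4 ∷ 8 ∷ 16 ∷ 32 ∷ [])
    ∷ transform (16 ∷ 1 ∷ 2 ∷ 34 ∷ 4 ∷ 8 ∷ []) (2 ∷ 4 ∷ 16 ∷ 32 ∷ 1 ∷ 12 ∷ []) (1 ∷ 2 ∷ 4 ∷ 8 ∷ 16 ∷ 32 ∷ [])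
    ∷ transform (16 ∷ 1 ∷ 2 ∷ 35 ∷ 4 ∷ 8 ∷ []) (2 ∷ 4 ∷ 16 ∷ 32 ∷ 1 ∷ 14 ∷ []) (1 ∷ 2 ∷ 4 ∷ 8 ∷ 16 ∷ 32 ∷ [])
    ∷ transform (16 ∷ 1 ∷ 2 ∷ 4 ∷ 36 ∷ 8 ∷ []) (2 ∷ 4 ∷ 8 ∷ 32 ∷ 1 ∷ 24 ∷ []) (1 ∷ 2 ∷ 4 ∷ 8 ∷ 16 ∷ 32 ∷ [])
    ∷ transform (16 ∷ 1 ∷ 2 ∷ 4 ∷ 37 ∷ 8 ∷ []) (2 ∷ 4 ∷ 8 ∷ 32 ∷ 1 ∷ 26 ∷ []) (1 ∷ 2 ∷ 4 ∷ 8 ∷ 16 ∷ 32 ∷ [])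
    ∷ transform (16 ∷ 1 ∷ 2 ∷ 4 ∷ 38 ∷ 8 ∷ []) (2 ∷ 4 ∷ 8 ∷ 32 ∷ 1 ∷ 28 ∷ []) (1 ∷ 2 ∷ 4 ∷ 8 ∷ 16 ∷ 32 ∷ [])
    ∷ transform (16 ∷ 1 ∷ 2 ∷ 4 ∷ 39 ∷ 8 ∷ []) (2 ∷ 4 ∷ 8 ∷ 32 ∷ 1 ∷ 30 ∷ []) (1 ∷ 2 ∷ 4 ∷ 8 ∷ 16 ∷ 32 ∷ [])
    ∷ transform (16 ∷ 1 ∷ 2 ∷ 4 ∷ 8 ∷ 40 ∷ []) (2 ∷ 4 ∷ 8 ∷ 16 ∷ 1 ∷ 48 ∷ []) (1 ∷ 2 ∷ 4 ∷ 8 ∷ 16 ∷ 32 ∷ [])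
    ∷ transform (16 ∷ 1 ∷ 2 ∷ 4 ∷ 8 ∷ 41 ∷ []) (2 ∷ 4 ∷ 8 ∷ 16 ∷ 1 ∷ 50 ∷ []) (1 ∷ 2 ∷ 4 ∷ 8 ∷ 16 ∷ 32 ∷ [])
    ∷ transform (16 ∷ 1 ∷ 2 ∷ 4 ∷ 8 ∷ 42 ∷ []) (2 ∷ 4 ∷ 8 ∷ 16 ∷ 1 ∷ 52 ∷ []) (1 ∷ 2 ∷ 4 ∷ 8 ∷ 16 ∷ 32 ∷ [])
    ∷ transform (16 ∷ 1 ∷ 2 ∷ 4 ∷ 8 ∷ 43 ∷ []) (2 ∷ 4 ∷ 8 ∷ 16 ∷ 1 ∷ 54 ∷ []) (1 ∷ 2 ∷ 4 ∷ 8 ∷ 16 ∷ 32 ∷ [])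
    ∷ transform (16 ∷ 1 ∷ 2 ∷ 4 ∷ 8 ∷ 44 ∷ []) (2 ∷ 4 ∷ 8 ∷ 16 ∷ 1 ∷ 56 ∷ []) (1 ∷ 2 ∷ 4 ∷ 8 ∷ 16 ∷ 32 ∷ [])
    ∷ transform (16 ∷ 1 ∷ 2 ∷ 4 ∷ 8 ∷ 45 ∷ []) (2 ∷ 4 ∷ 8 ∷ 16 ∷ 1 ∷ 58 ∷ []) (1 ∷ 2 ∷ 4 ∷ 8 ∷ 16 ∷ 32 ∷ [])
    ∷ transform (16 ∷ 1 ∷ 2 ∷ 4 ∷ 8 ∷ 46 ∷ []) (2 ∷ 4 ∷ 8 ∷ 16 ∷ 1 ∷ 60 ∷ []) (1 ∷ 2 ∷ 4 ∷ 8 ∷ 16 ∷ 32 ∷ [])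
    ∷ transform (16 ∷ 1 ∷ 2 ∷ 4 ∷ 8 ∷ 47 ∷ []) (2 ∷ 4 ∷ 8 ∷ 16 ∷ 1 ∷ 62 ∷ []) (1 ∷ 2 ∷ 4 ∷ 8 ∷ 16 ∷ 32 ∷ [])
    ∷ transform (16 ∷ 1 ∷ 2 ∷ 48 ∷ 4 ∷ 8 ∷ []) (2 ∷ 4 ∷ 16 ∷ 32 ∷ 1 ∷ 9 ∷ []) (1 ∷ 2 ∷ 4 ∷ 8 ∷ 16 ∷ 32 ∷ [])
    ∷ transform (16 ∷ 1 ∷ 2 ∷ 49 ∷ 4 ∷ 8 ∷ []) (2 ∷ 4 ∷ 16 ∷ 32 ∷ 1 ∷ 11 ∷ []) (1 ∷ 2 ∷ 4 ∷ 8 ∷ 16 ∷ 32 ∷ [])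
    ∷ transform (16 ∷ 1 ∷ 2 ∷ 50 ∷ 4 ∷ 8 ∷ []) (2 ∷ 4 ∷ 16 ∷ 32 ∷ 1 ∷ 13 ∷ []) (1 ∷ 2 ∷ 4 ∷ 8 ∷ 16 ∷ 32 ∷ [])
    ∷ transform (16 ∷ 1 ∷ 2 ∷ 51 ∷ 4 ∷ 8 ∷ []) (2 ∷ 4 ∷ 16 ∷ 32 ∷ 1 ∷ 15 ∷ []) (1 ∷ 2 ∷ 4 ∷ 8 ∷ 16 ∷ 32 ∷ [])
    ∷ transform (16 ∷ 1 ∷ 2 ∷ 4 ∷ 52 ∷ 8 ∷ []) (2 ∷ 4 ∷ 8 ∷ 32 ∷ 1 ∷ 25 ∷ []) (1 ∷ 2 ∷ 4 ∷ 8 ∷ 16 ∷ 32 ∷ [])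
    ∷ transform (16 ∷ 1 ∷ 2 ∷ 4 ∷ 53 ∷ 8 ∷ []) (2 ∷ 4 ∷ 8 ∷ 32 ∷ 1 ∷ 27 ∷ []) (1 ∷ 2 ∷ 4 ∷ 8 ∷ 16 ∷ 32 ∷ [])
    ∷ transform (16 ∷ 1 ∷ 2 ∷ 4 ∷ 54 ∷ 8 ∷ []) (2 ∷ 4 ∷ 8 ∷ 32 ∷ 1 ∷ 29 ∷ []) (1 ∷ 2 ∷ 4 ∷ 8 ∷ 16 ∷ 32 ∷ [])
    ∷ transform (16 ∷ 1 ∷ 2 ∷ 4 ∷ 55 ∷ 8 ∷ []) (2 ∷ 4 ∷ 8 ∷ 32 ∷ 1 ∷ 31 ∷ []) (1 ∷ 2 ∷ 4 ∷ 8 ∷ 16 ∷ 32 ∷ [])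
    ∷ transform (16 ∷ 1 ∷ 2 ∷ 4 ∷ 8 ∷ 56 ∷ []) (2 ∷ 4 ∷ 8 ∷ 16 ∷ 1 ∷ 49 ∷ []) (1 ∷ 2 ∷ 4 ∷ 8 ∷ 16 ∷ 32 ∷ [])
    ∷ transform (16 ∷ 1 ∷ 2 ∷ 4 ∷ 8 ∷ 57 ∷ []) (2 ∷ 4 ∷ 8 ∷ 16 ∷ 1 ∷ 51 ∷ []) (1 ∷ 2 ∷ 4 ∷ 8 ∷ 16 ∷ 32 ∷ [])
    ∷ transform (16 ∷ 1 ∷ 2 ∷ 4 ∷ 8 ∷ 58 ∷ []) (2 ∷ 4 ∷ 8 ∷ 16 ∷ 1 ∷ 53 ∷ []) (1 ∷ 2 ∷ 4 ∷ 8 ∷ 16 ∷ 32 ∷ [])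
    ∷ transform (16 ∷ 1 ∷ 2 ∷ 4 ∷ 8 ∷ 59 ∷ []) (2 ∷ 4 ∷ 8 ∷ 16 ∷ 1 ∷ 55 ∷ []) (1 ∷ 2 ∷ 4 ∷ 8 ∷ 16 ∷ 32 ∷ [])
    ∷ transform (16 ∷ 1 ∷ 2 ∷ 4 ∷ 8 ∷ 60 ∷ []) (2 ∷ 4 ∷ 8 ∷ 16 ∷ 1 ∷ 57 ∷ []) (1 ∷ 2 ∷ 4 ∷ 8 ∷ 16 ∷ 32 ∷ [])
    ∷ transform (16 ∷ 1 ∷ 2 ∷ 4 ∷ 8 ∷ 61 ∷ []) (2 ∷ 4 ∷ 8 ∷ 16 ∷ 1 ∷ 59 ∷ []) (1 ∷ 2 ∷ 4 ∷ 8 ∷ 16 ∷ 32 ∷ [])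
    ∷ transform (16 ∷ 1 ∷ 2 ∷ 4 ∷ 8 ∷ 62 ∷ []) (2 ∷ 4 ∷ 8 ∷ 16 ∷ 1 ∷ 61 ∷ []) (1 ∷ 2 ∷ 4 ∷ 8 ∷ 16 ∷ 32 ∷ [])
    ∷ transform (16 ∷ 1 ∷ 2 ∷ 4 ∷ 8 ∷ 63 ∷ []) (2 ∷ 4 ∷ 8 ∷ 16 ∷ 1 ∷ 63 ∷ []) (1 ∷ 2 ∷ 4 ∷ 8 ∷ 16 ∷ 32 ∷ [])
    ∷ []) ∷
  node (1 ∷ 2 ∷ 4 ∷ 8 ∷ 15 ∷ 16 ∷ [])
    ( plane 1 2 4
    ∷ plane 2 1 4
    ∷ plane 3 1 4
    ∷ plane 4 1 2
    ∷ plane 5 1 2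
    ∷ plane 6 1 2
    ∷ plane 7 1 2
    ∷ plane 8 2 16
    ∷ plane 9 1 4
    ∷ plane 10 2 16
    ∷ plane 11 3 4
    ∷ plane 12 1 2
    ∷ plane 13 1 2
    ∷ plane 14 1 2
    ∷ plane 15 1 2
    ∷ plane 16 1 2
    ∷ plane 17 1 2
    ∷ plane 18 1 2
    ∷ plane 19 1 2
    ∷ plane 20 4 8
    ∷ plane 21 1 4
    ∷ plane 22 2 4
    ∷ plane 23 7 8
    ∷ plane 24 2 8
    ∷ plane 25 1 8
    ∷ plane 26 2 8
    ∷ plane 27 4 11
    ∷ plane 28 4 8
    ∷ plane 29 2 13
    ∷ plane 30 1 14
    ∷ plane 31 4 11
    ∷ transform (1 ∷ 2 ∷ 4 ∷ 8 ∷ 16 ∷ 32 ∷ []) (1 ∷ 2 ∷ 4 ∷ 8 ∷ 16 ∷ 32 ∷ []) (1 ∷ 2 ∷ 4 ∷ 8 ∷ 15 ∷ 16 ∷ 32 ∷ [])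
    ∷ transform (1 ∷ 2 ∷ 4 ∷ 8 ∷ 16 ∷ 33 ∷ []) (1 ∷ 2 ∷ 4 ∷ 8 ∷ 16 ∷ 33 ∷ []) (1 ∷ 2 ∷ 4 ∷ 8 ∷ 15 ∷ 16 ∷ 32 ∷ [])
    ∷ transform (1 ∷ 2 ∷ 4 ∷ 8 ∷ 16 ∷ 34 ∷ []) (1 ∷ 2 ∷ 4 ∷ 8 ∷ 16 ∷ 34 ∷ []) (1 ∷ 2 ∷ 4 ∷ 8 ∷ 15 ∷ 16 ∷ 32 ∷ [])
    ∷ transform (1 ∷ 2 ∷ 4 ∷ 8 ∷ 16 ∷ 35 ∷ []) (1 ∷ 2 ∷ 4 ∷ 8 ∷ 16 ∷ 35 ∷ []) (1 ∷ 2 ∷ 4 ∷ 8 ∷ 15 ∷ 16 ∷ 32 ∷ [])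
    ∷ transform (1 ∷ 2 ∷ 4 ∷ 8 ∷ 16 ∷ 36 ∷ []) (1 ∷ 2 ∷ 4 ∷ 8 ∷ 16 ∷ 36 ∷ []) (1 ∷ 2 ∷ 4 ∷ 8 ∷ 15 ∷ 16 ∷ 32 ∷ [])
    ∷ transform (1 ∷ 2 ∷ 4 ∷ 8 ∷ 16 ∷ 37 ∷ []) (1 ∷ 2 ∷ 4 ∷ 8 ∷ 16 ∷ 37 ∷ []) (1 ∷ 2 ∷ 4 ∷ 8 ∷ 15 ∷ 16 ∷ 32 ∷ [])
    ∷ transform (1 ∷ 2 ∷ 4 ∷ 8 ∷ 16 ∷ 38 ∷ []) (1 ∷ 2 ∷ 4 ∷ 8 ∷ 16 ∷ 38 ∷ []) (1 ∷ 2 ∷ 4 ∷ 8 ∷ 15 ∷ 16 ∷ 32 ∷ [])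
    ∷ transform (1 ∷ 2 ∷ 4 ∷ 8 ∷ 16 ∷ 39 ∷ []) (1 ∷ 2 ∷ 4 ∷ 8 ∷ 16 ∷ 39 ∷ []) (1 ∷ 2 ∷ 4 ∷ 8 ∷ 15 ∷ 16 ∷ 32 ∷ [])
    ∷ transform (1 ∷ 2 ∷ 4 ∷ 8 ∷ 16 ∷ 40 ∷ []) (1 ∷ 2 ∷ 4 ∷ 8 ∷ 16 ∷ 40 ∷ []) (1 ∷ 2 ∷ 4 ∷ 8 ∷ 15 ∷ 16 ∷ 32 ∷ [])
    ∷ transform (1 ∷ 2 ∷ 4 ∷ 8 ∷ 16 ∷ 41 ∷ []) (1 ∷ 2 ∷ 4 ∷ 8 ∷ 16 ∷ 41 ∷ []) (1 ∷ 2 ∷ 4 ∷ 8 ∷ 15 ∷ 16 ∷ 32 ∷ [])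
    ∷ transform (1 ∷ 2 ∷ 4 ∷ 8 ∷ 16 ∷ 42 ∷ []) (1 ∷ 2 ∷ 4 ∷ 8 ∷ 16 ∷ 42 ∷ []) (1 ∷ 2 ∷ 4 ∷ 8 ∷ 15 ∷ 16 ∷ 32 ∷ [])
    ∷ transform (1 ∷ 2 ∷ 4 ∷ 8 ∷ 16 ∷ 43 ∷ []) (1 ∷ 2 ∷ 4 ∷ 8 ∷ 16 ∷ 43 ∷ []) (1 ∷ 2 ∷ 4 ∷ 8 ∷ 15 ∷ 16 ∷ 32 ∷ [])
    ∷ transform (1 ∷ 2 ∷ 4 ∷ 8 ∷ 16 ∷ 44 ∷ []) (1 ∷ 2 ∷ 4 ∷ 8 ∷ 16 ∷ 44 ∷ []) (1 ∷ 2 ∷ 4 ∷ 8 ∷ 15 ∷ 16 ∷ 32 ∷ [])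
    ∷ transform (1 ∷ 2 ∷ 4 ∷ 8 ∷ 16 ∷ 45 ∷ []) (1 ∷ 2 ∷ 4 ∷ 8 ∷ 16 ∷ 45 ∷ []) (1 ∷ 2 ∷ 4 ∷ 8 ∷ 15 ∷ 16 ∷ 32 ∷ [])
    ∷ transform (1 ∷ 2 ∷ 4 ∷ 8 ∷ 16 ∷ 46 ∷ []) (1 ∷ 2 ∷ 4 ∷ 8 ∷ 16 ∷ 46 ∷ []) (1 ∷ 2 ∷ 4 ∷ 8 ∷ 15 ∷ 16 ∷ 32 ∷ [])
    ∷ transform (1 ∷ 2 ∷ 4 ∷ 8 ∷ 16 ∷ 47 ∷ []) (1 ∷ 2 ∷ 4 ∷ 8 ∷ 16 ∷ 47 ∷ []) (1 ∷ 2 ∷ 4 ∷ 8 ∷ 15 ∷ 16 ∷ 32 ∷ [])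
    ∷ transform (1 ∷ 2 ∷ 4 ∷ 8 ∷ 16 ∷ 48 ∷ []) (1 ∷ 2 ∷ 4 ∷ 8 ∷ 16 ∷ 48 ∷ []) (1 ∷ 2 ∷ 4 ∷ 8 ∷ 15 ∷ 16 ∷ 32 ∷ [])
    ∷ transform (1 ∷ 2 ∷ 4 ∷ 8 ∷ 16 ∷ 49 ∷ []) (1 ∷ 2 ∷ 4 ∷ 8 ∷ 16 ∷ 49 ∷ []) (1 ∷ 2 ∷ 4 ∷ 8 ∷ 15 ∷ 16 ∷ 32 ∷ [])
    ∷ transform (1 ∷ 2 ∷ 4 ∷ 8 ∷ 16 ∷ 50 ∷ []) (1 ∷ 2 ∷ 4 ∷ 8 ∷ 16 ∷ 50 ∷ []) (1 ∷ 2 ∷ 4 ∷ 8 ∷ 15 ∷ 16 ∷ 32 ∷ [])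
    ∷ transform (1 ∷ 2 ∷ 4 ∷ 8 ∷ 16 ∷ 51 ∷ []) (1 ∷ 2 ∷ 4 ∷ 8 ∷ 16 ∷ 51 ∷ []) (1 ∷ 2 ∷ 4 ∷ 8 ∷ 15 ∷ 16 ∷ 32 ∷ [])
    ∷ transform (1 ∷ 2 ∷ 4 ∷ 8 ∷ 16 ∷ 52 ∷ []) (1 ∷ 2 ∷ 4 ∷ 8 ∷ 16 ∷ 52 ∷ []) (1 ∷ 2 ∷ 4 ∷ 8 ∷ 15 ∷ 16 ∷ 32 ∷ [])
    ∷ transform (1 ∷ 2 ∷ 4 ∷ 8 ∷ 16 ∷ 53 ∷ []) (1 ∷ 2 ∷ 4 ∷ 8 ∷ 16 ∷ 53 ∷ []) (1 ∷ 2 ∷ 4 ∷ 8 ∷ 15 ∷ 16 ∷ 32 ∷ [])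
    ∷ transform (1 ∷ 2 ∷ 4 ∷ 8 ∷ 16 ∷ 54 ∷ []) (1 ∷ 2 ∷ 4 ∷ 8 ∷ 16 ∷ 54 ∷ []) (1 ∷ 2 ∷ 4 ∷ 8 ∷ 15 ∷ 16 ∷ 32 ∷ [])
    ∷ transform (1 ∷ 2 ∷ 4 ∷ 8 ∷ 16 ∷ 55 ∷ []) (1 ∷ 2 ∷ 4 ∷ 8 ∷ 16 ∷ 55 ∷ []) (1 ∷ 2 ∷ 4 ∷ 8 ∷ 15 ∷ 16 ∷ 32 ∷ [])
    ∷ transform (1 ∷ 2 ∷ 4 ∷ 8 ∷ 16 ∷ 56 ∷ []) (1 ∷ 2 ∷ 4 ∷ 8 ∷ 16 ∷ 56 ∷ []) (1 ∷ 2 ∷ 4 ∷ 8 ∷ 15 ∷ 16 ∷ 32 ∷ [])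
    ∷ transform (1 ∷ 2 ∷ 4 ∷ 8 ∷ 16 ∷ 57 ∷ []) (1 ∷ 2 ∷ 4 ∷ 8 ∷ 16 ∷ 57 ∷ []) (1 ∷ 2 ∷ 4 ∷ 8 ∷ 15 ∷ 16 ∷ 32 ∷ [])
    ∷ transform (1 ∷ 2 ∷ 4 ∷ 8 ∷ 16 ∷ 58 ∷ []) (1 ∷ 2 ∷ 4 ∷ 8 ∷ 16 ∷ 58 ∷ []) (1 ∷ 2 ∷ 4 ∷ 8 ∷ 15 ∷ 16 ∷ 32 ∷ [])
    ∷ transform (1 ∷ 2 ∷ 4 ∷ 8 ∷ 16 ∷ 59 ∷ []) (1 ∷ 2 ∷ 4 ∷ 8 ∷ 16 ∷ 59 ∷ []) (1 ∷ 2 ∷ 4 ∷ 8 ∷ 15 ∷ 16 ∷ 32 ∷ [])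
    ∷ transform (1 ∷ 2 ∷ 4 ∷ 8 ∷ 16 ∷ 60 ∷ []) (1 ∷ 2 ∷ 4 ∷ 8 ∷ 16 ∷ 60 ∷ []) (1 ∷ 2 ∷ 4 ∷ 8 ∷ 15 ∷ 16 ∷ 32 ∷ [])
    ∷ transform (1 ∷ 2 ∷ 4 ∷ 8 ∷ 16 ∷ 61 ∷ []) (1 ∷ 2 ∷ 4 ∷ 8 ∷ 16 ∷ 61 ∷ []) (1 ∷ 2 ∷ 4 ∷ 8 ∷ 15 ∷ 16 ∷ 32 ∷ [])
    ∷ transform (1 ∷ 2 ∷ 4 ∷ 8 ∷ 16 ∷ 62 ∷ []) (1 ∷ 2 ∷ 4 ∷ 8 ∷ 16 ∷ 62 ∷ []) (1 ∷ 2 ∷ 4 ∷ 8 ∷ 15 ∷ 16 ∷ 32 ∷ [])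
    ∷ transform (1 ∷ 2 ∷ 4 ∷ 8 ∷ 16 ∷ 63 ∷ []) (1 ∷ 2 ∷ 4 ∷ 8 ∷ 16 ∷ 63 ∷ []) (1 ∷ 2 ∷ 4 ∷ 8 ∷ 15 ∷ 16 ∷ 32 ∷ [])
    ∷ []) ∷
  node (1 ∷ 2 ∷ 4 ∷ 8 ∷ 16 ∷ 31 ∷ [])
    ( plane 1 2 4
    ∷ plane 2 1 4
    ∷ plane 3 1 4
    ∷ plane 4 1 2
    ∷ plane 5 1 2
    ∷ plane 6 1 2
    ∷ plane 7 1 2
    ∷ plane 8 1 31
    ∷ plane 9 1 22
    ∷ plane 10 2 21
    ∷ plane 11 4 16
    ∷ plane 12 1 4
    ∷ plane 13 1 4
    ∷ plane 14 1 16
    ∷ plane 15 4 16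
    ∷ plane 16 1 2
    ∷ plane 17 1 2
    ∷ plane 18 1 2
    ∷ plane 19 1 2
    ∷ plane 20 4 8
    ∷ plane 21 2 8
    ∷ plane 22 1 8
    ∷ plane 23 1 8
    ∷ plane 24 2 8
    ∷ plane 25 2 4
    ∷ plane 26 2 8
    ∷ plane 27 1 4
    ∷ plane 28 1 2
    ∷ plane 29 2 8
    ∷ plane 30 1 8
    ∷ plane 31 1 8
    ∷ transform (16 ∷ 1 ∷ 2 ∷ 4 ∷ 8 ∷ 32 ∷ []) (2 ∷ 4 ∷ 8 ∷ 16 ∷ 1 ∷ 32 ∷ []) (1 ∷ 2 ∷ 4 ∷ 8 ∷ 16 ∷ 31 ∷ 32 ∷ [])
    ∷ transform (16 ∷ 1 ∷ 2 ∷ 4 ∷ 8 ∷ 33 ∷ []) (2 ∷ 4 ∷ 8 ∷ 16 ∷ 1 ∷ 34 ∷ []) (1 ∷ 2 ∷ 4 ∷ 8 ∷ 16 ∷ 31 ∷ 32 ∷ [])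
    ∷ transform (16 ∷ 1 ∷ 2 ∷ 4 ∷ 8 ∷ 34 ∷ []) (2 ∷ 4 ∷ 8 ∷ 16 ∷ 1 ∷ 36 ∷ []) (1 ∷ 2 ∷ 4 ∷ 8 ∷ 16 ∷ 31 ∷ 32 ∷ [])
    ∷ transform (16 ∷ 1 ∷ 2 ∷ 4 ∷ 8 ∷ 35 ∷ []) (2 ∷ 4 ∷ 8 ∷ 16 ∷ 1 ∷ 38 ∷ []) (1 ∷ 2 ∷ 4 ∷ 8 ∷ 16 ∷ 31 ∷ 32 ∷ [])
    ∷ transform (16 ∷ 1 ∷ 2 ∷ 4 ∷ 8 ∷ 36 ∷ []) (2 ∷ 4 ∷ 8 ∷ 16 ∷ 1 ∷ 40 ∷ []) (1 ∷ 2 ∷ 4 ∷ 8 ∷ 16 ∷ 31 ∷ 32 ∷ [])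
    ∷ transform (16 ∷ 1 ∷ 2 ∷ 4 ∷ 8 ∷ 37 ∷ []) (2 ∷ 4 ∷ 8 ∷ 16 ∷ 1 ∷ 42 ∷ []) (1 ∷ 2 ∷ 4 ∷ 8 ∷ 16 ∷ 31 ∷ 32 ∷ [])
    ∷ transform (16 ∷ 1 ∷ 2 ∷ 4 ∷ 8 ∷ 38 ∷ []) (2 ∷ 4 ∷ 8 ∷ 16 ∷ 1 ∷ 44 ∷ []) (1 ∷ 2 ∷ 4 ∷ 8 ∷ 16 ∷ 31 ∷ 32 ∷ [])
    ∷ transform (16 ∷ 1 ∷ 2 ∷ 4 ∷ 8 ∷ 39 ∷ []) (2 ∷ 4 ∷ 8 ∷ 16 ∷ 1 ∷ 46 ∷ []) (1 ∷ 2 ∷ 4 ∷ 8 ∷ 16 ∷ 31 ∷ 32 ∷ [])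
    ∷ transform (16 ∷ 1 ∷ 2 ∷ 4 ∷ 8 ∷ 40 ∷ []) (2 ∷ 4 ∷ 8 ∷ 16 ∷ 1 ∷ 48 ∷ []) (1 ∷ 2 ∷ 4 ∷ 8 ∷ 16 ∷ 31 ∷ 32 ∷ [])
    ∷ transform (16 ∷ 1 ∷ 2 ∷ 4 ∷ 8 ∷ 41 ∷ []) (2 ∷ 4 ∷ 8 ∷ 16 ∷ 1 ∷ 50 ∷ []) (1 ∷ 2 ∷ 4 ∷ 8 ∷ 16 ∷ 31 ∷ 32 ∷ [])
    ∷ transform (16 ∷ 1 ∷ 2 ∷ 4 ∷ 8 ∷ 42 ∷ []) (2 ∷ 4 ∷ 8 ∷ 16 ∷ 1 ∷ 52 ∷ []) (1 ∷ 2 ∷ 4 ∷ 8 ∷ 16 ∷ 31 ∷ 32 ∷ [])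
    ∷ transform (16 ∷ 1 ∷ 2 ∷ 4 ∷ 8 ∷ 43 ∷ []) (2 ∷ 4 ∷ 8 ∷ 16 ∷ 1 ∷ 54 ∷ []) (1 ∷ 2 ∷ 4 ∷ 8 ∷ 16 ∷ 31 ∷ 32 ∷ [])
    ∷ transform (16 ∷ 1 ∷ 2 ∷ 4 ∷ 8 ∷ 44 ∷ []) (2 ∷ 4 ∷ 8 ∷ 16 ∷ 1 ∷ 56 ∷ []) (1 ∷ 2 ∷ 4 ∷ 8 ∷ 16 ∷ 31 ∷ 32 ∷ [])
    ∷ transform (16 ∷ 1 ∷ 2 ∷ 4 ∷ 8 ∷ 45 ∷ []) (2 ∷ 4 ∷ 8 ∷ 16 ∷ 1 ∷ 58 ∷ []) (1 ∷ 2 ∷ 4 ∷ 8 ∷ 16 ∷ 31 ∷ 32 ∷ [])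
    ∷ transform (16 ∷ 1 ∷ 2 ∷ 4 ∷ 8 ∷ 46 ∷ []) (2 ∷ 4 ∷ 8 ∷ 16 ∷ 1 ∷ 60 ∷ []) (1 ∷ 2 ∷ 4 ∷ 8 ∷ 16 ∷ 31 ∷ 32 ∷ [])
    ∷ transform (16 ∷ 1 ∷ 2 ∷ 4 ∷ 8 ∷ 47 ∷ []) (2 ∷ 4 ∷ 8 ∷ 16 ∷ 1 ∷ 62 ∷ []) (1 ∷ 2 ∷ 4 ∷ 8 ∷ 16 ∷ 31 ∷ 32 ∷ [])
    ∷ transform (16 ∷ 1 ∷ 2 ∷ 4 ∷ 8 ∷ 48 ∷ []) (2 ∷ 4 ∷ 8 ∷ 16 ∷ 1 ∷ 33 ∷ []) (1 ∷ 2 ∷ 4 ∷ 8 ∷ 16 ∷ 31 ∷ 32 ∷ [])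
    ∷ transform (16 ∷ 1 ∷ 2 ∷ 4 ∷ 8 ∷ 49 ∷ []) (2 ∷ 4 ∷ 8 ∷ 16 ∷ 1 ∷ 35 ∷ []) (1 ∷ 2 ∷ 4 ∷ 8 ∷ 16 ∷ 31 ∷ 32 ∷ [])
    ∷ transform (16 ∷ 1 ∷ 2 ∷ 4 ∷ 8 ∷ 50 ∷ []) (2 ∷ 4 ∷ 8 ∷ 16 ∷ 1 ∷ 37 ∷ []) (1 ∷ 2 ∷ 4 ∷ 8 ∷ 16 ∷ 31 ∷ 32 ∷ [])
    ∷ transform (16 ∷ 1 ∷ 2 ∷ 4 ∷ 8 ∷ 51 ∷ []) (2 ∷ 4 ∷ 8 ∷ 16 ∷ 1 ∷ 39 ∷ []) (1 ∷ 2 ∷ 4 ∷ 8 ∷ 16 ∷ 31 ∷ 32 ∷ [])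
    ∷ transform (16 ∷ 1 ∷ 2 ∷ 4 ∷ 8 ∷ 52 ∷ []) (2 ∷ 4 ∷ 8 ∷ 16 ∷ 1 ∷ 41 ∷ []) (1 ∷ 2 ∷ 4 ∷ 8 ∷ 16 ∷ 31 ∷ 32 ∷ [])
    ∷ transform (16 ∷ 1 ∷ 2 ∷ 4 ∷ 8 ∷ 53 ∷ []) (2 ∷ 4 ∷ 8 ∷ 16 ∷ 1 ∷ 43 ∷ []) (1 ∷ 2 ∷ 4 ∷ 8 ∷ 16 ∷ 31 ∷ 32 ∷ [])
    ∷ transform (16 ∷ 1 ∷ 2 ∷ 4 ∷ 8 ∷ 54 ∷ []) (2 ∷ 4 ∷ 8 ∷ 16 ∷ 1 ∷ 45 ∷ []) (1 ∷ 2 ∷ 4 ∷ 8 ∷ 16 ∷ 31 ∷ 32 ∷ [])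
    ∷ transform (16 ∷ 1 ∷ 2 ∷ 4 ∷ 8 ∷ 55 ∷ []) (2 ∷ 4 ∷ 8 ∷ 16 ∷ 1 ∷ 47 ∷ []) (1 ∷ 2 ∷ 4 ∷ 8 ∷ 16 ∷ 31 ∷ 32 ∷ [])
    ∷ transform (16 ∷ 1 ∷ 2 ∷ 4 ∷ 8 ∷ 56 ∷ []) (2 ∷ 4 ∷ 8 ∷ 16 ∷ 1 ∷ 49 ∷ []) (1 ∷ 2 ∷ 4 ∷ 8 ∷ 16 ∷ 31 ∷ 32 ∷ [])
    ∷ transform (16 ∷ 1 ∷ 2 ∷ 4 ∷ 8 ∷ 57 ∷ []) (2 ∷ 4 ∷ 8 ∷ 16 ∷ 1 ∷ 51 ∷ []) (1 ∷ 2 ∷ 4 ∷ 8 ∷ 16 ∷ 31 ∷ 32 ∷ [])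
    ∷ transform (16 ∷ 1 ∷ 2 ∷ 4 ∷ 8 ∷ 58 ∷ []) (2 ∷ 4 ∷ 8 ∷ 16 ∷ 1 ∷ 53 ∷ []) (1 ∷ 2 ∷ 4 ∷ 8 ∷ 16 ∷ 31 ∷ 32 ∷ [])
    ∷ transform (16 ∷ 1 ∷ 2 ∷ 4 ∷ 8 ∷ 59 ∷ []) (2 ∷ 4 ∷ 8 ∷ 16 ∷ 1 ∷ 55 ∷ []) (1 ∷ 2 ∷ 4 ∷ 8 ∷ 16 ∷ 31 ∷ 32 ∷ [])
    ∷ transform (16 ∷ 1 ∷ 2 ∷ 4 ∷ 8 ∷ 60 ∷ []) (2 ∷ 4 ∷ 8 ∷ 16 ∷ 1 ∷ 57 ∷ []) (1 ∷ 2 ∷ 4 ∷ 8 ∷ 16 ∷ 31 ∷ 32 ∷ [])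
    ∷ transform (16 ∷ 1 ∷ 2 ∷ 4 ∷ 8 ∷ 61 ∷ []) (2 ∷ 4 ∷ 8 ∷ 16 ∷ 1 ∷ 59 ∷ []) (1 ∷ 2 ∷ 4 ∷ 8 ∷ 16 ∷ 31 ∷ 32 ∷ [])
    ∷ transform (16 ∷ 1 ∷ 2 ∷ 4 ∷ 8 ∷ 62 ∷ []) (2 ∷ 4 ∷ 8 ∷ 16 ∷ 1 ∷ 61 ∷ []) (1 ∷ 2 ∷ 4 ∷ 8 ∷ 16 ∷ 31 ∷ 32 ∷ [])
    ∷ transform (16 ∷ 1 ∷ 2 ∷ 4 ∷ 8 ∷ 63 ∷ []) (2 ∷ 4 ∷ 8 ∷ 16 ∷ 1 ∷ 63 ∷ []) (1 ∷ 2 ∷ 4 ∷ 8 ∷ 16 ∷ 31 ∷ 32 ∷ [])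
    ∷ []) ∷
  node (1 ∷ 2 ∷ 4 ∷ 8 ∷ 16 ∷ 32 ∷ [])
    ( plane 1 2 4
    ∷ plane 2 1 4
    ∷ plane 3 1 4
    ∷ plane 4 1 2
    ∷ plane 5 1 2
    ∷ plane 6 1 2
    ∷ plane 7 1 2
    ∷ plane 8 16 32
    ∷ plane 9 1 32
    ∷ plane 10 2 16
    ∷ plane 11 1 2
    ∷ plane 12 4 32
    ∷ plane 13 1 4
    ∷ plane 14 2 4
    ∷ transform (1 ∷ 2 ∷ 4 ∷ 8 ∷ 32 ∷ 16 ∷ []) (1 ∷ 2 ∷ 4 ∷ 8 ∷ 32 ∷ 16 ∷ []) (1 ∷ 2 ∷ 4 ∷ 8 ∷ 15 ∷ 16 ∷ 32 ∷ [])
    ∷ plane 16 1 32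
    ∷ plane 17 1 32
    ∷ plane 18 1 2
    ∷ plane 19 1 2
    ∷ plane 20 4 8
    ∷ plane 21 1 4
    ∷ plane 22 2 4
    ∷ transform (1 ∷ 2 ∷ 16 ∷ 4 ∷ 32 ∷ 8 ∷ []) (1 ∷ 2 ∷ 8 ∷ 32 ∷ 4 ∷ 16 ∷ []) (1 ∷ 2 ∷ 4 ∷ 8 ∷ 15 ∷ 16 ∷ 32 ∷ [])
    ∷ plane 24 8 32
    ∷ plane 25 1 8
    ∷ plane 26 2 8
    ∷ transform (1 ∷ 2 ∷ 16 ∷ 8 ∷ 32 ∷ 4 ∷ []) (1 ∷ 2 ∷ 32 ∷ 8 ∷ 4 ∷ 16 ∷ []) (1 ∷ 2 ∷ 4 ∷ 8 ∷ 15 ∷ 16 ∷ 32 ∷ [])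
    ∷ plane 28 4 8
    ∷ transform (1 ∷ 16 ∷ 4 ∷ 8 ∷ 32 ∷ 2 ∷ []) (1 ∷ 32 ∷ 4 ∷ 8 ∷ 2 ∷ 16 ∷ []) (1 ∷ 2 ∷ 4 ∷ 8 ∷ 15 ∷ 16 ∷ 32 ∷ [])
    ∷ transform (2 ∷ 16 ∷ 4 ∷ 8 ∷ 32 ∷ 1 ∷ []) (32 ∷ 1 ∷ 4 ∷ 8 ∷ 2 ∷ 16 ∷ []) (1 ∷ 2 ∷ 4 ∷ 8 ∷ 15 ∷ 16 ∷ 32 ∷ [])
    ∷ transform (1 ∷ 2 ∷ 16 ∷ 4 ∷ 8 ∷ 32 ∷ []) (1 ∷ 2 ∷ 8 ∷ 16 ∷ 4 ∷ 32 ∷ []) (1 ∷ 2 ∷ 4 ∷ 8 ∷ 16 ∷ 31 ∷ 32 ∷ [])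
    ∷ plane 32 1 16
    ∷ plane 33 1 16
    ∷ plane 34 2 8
    ∷ plane 35 1 2
    ∷ plane 36 4 8
    ∷ plane 37 1 4
    ∷ plane 38 2 4
    ∷ transform (32 ∷ 1 ∷ 2 ∷ 4 ∷ 16 ∷ 8 ∷ []) (2 ∷ 4 ∷ 8 ∷ 32 ∷ 16 ∷ 1 ∷ []) (1 ∷ 2 ∷ 4 ∷ 8 ∷ 15 ∷ 16 ∷ 32 ∷ [])
    ∷ plane 40 8 16
    ∷ plane 41 1 8
    ∷ plane 42 2 8
    ∷ transform (32 ∷ 1 ∷ 2 ∷ 8 ∷ 16 ∷ 4 ∷ []) (2 ∷ 4 ∷ 32 ∷ 8 ∷ 16 ∷ 1 ∷ []) (1 ∷ 2 ∷ 4 ∷ 8 ∷ 15 ∷ 16 ∷ 32 ∷ [])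
    ∷ plane 44 4 8
    ∷ transform (32 ∷ 1 ∷ 4 ∷ 8 ∷ 2 ∷ 16 ∷ []) (2 ∷ 16 ∷ 4 ∷ 8 ∷ 32 ∷ 1 ∷ []) (1 ∷ 2 ∷ 4 ∷ 8 ∷ 15 ∷ 16 ∷ 32 ∷ [])
    ∷ transform (32 ∷ 2 ∷ 4 ∷ 8 ∷ 1 ∷ 16 ∷ []) (16 ∷ 2 ∷ 4 ∷ 8 ∷ 32 ∷ 1 ∷ []) (1 ∷ 2 ∷ 4 ∷ 8 ∷ 15 ∷ 16 ∷ 32 ∷ [])
    ∷ transform (32 ∷ 1 ∷ 2 ∷ 4 ∷ 8 ∷ 16 ∷ []) (2 ∷ 4 ∷ 8 ∷ 16 ∷ 32 ∷ 1 ∷ []) (1 ∷ 2 ∷ 4 ∷ 8 ∷ 16 ∷ 31 ∷ 32 ∷ [])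
    ∷ plane 48 1 16
    ∷ plane 49 1 16
    ∷ plane 50 2 16
    ∷ transform (32 ∷ 1 ∷ 2 ∷ 16 ∷ 4 ∷ 8 ∷ []) (2 ∷ 4 ∷ 16 ∷ 32 ∷ 8 ∷ 1 ∷ []) (1 ∷ 2 ∷ 4 ∷ 8 ∷ 15 ∷ 16 ∷ 32 ∷ [])
    ∷ plane 52 4 16
    ∷ transform (32 ∷ 1 ∷ 16 ∷ 4 ∷ 2 ∷ 8 ∷ []) (2 ∷ 16 ∷ 8 ∷ 32 ∷ 4 ∷ 1 ∷ []) (1 ∷ 2 ∷ 4 ∷ 8 ∷ 15 ∷ 16 ∷ 32 ∷ [])
    ∷ transform (32 ∷ 2 ∷ 16 ∷ 4 ∷ 1 ∷ 8 ∷ []) (16 ∷ 2 ∷ 8 ∷ 32 ∷ 4 ∷ 1 ∷ []) (1 ∷ 2 ∷ 4 ∷ 8 ∷ 15 ∷ 16 ∷ 32 ∷ [])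
    ∷ transform (32 ∷ 1 ∷ 2 ∷ 16 ∷ 4 ∷ 8 ∷ []) (2 ∷ 4 ∷ 16 ∷ 32 ∷ 8 ∷ 1 ∷ []) (1 ∷ 2 ∷ 4 ∷ 8 ∷ 16 ∷ 31 ∷ 32 ∷ [])
    ∷ plane 56 8 16
    ∷ transform (32 ∷ 1 ∷ 16 ∷ 8 ∷ 2 ∷ 4 ∷ []) (2 ∷ 16 ∷ 32 ∷ 8 ∷ 4 ∷ 1 ∷ []) (1 ∷ 2 ∷ 4 ∷ 8 ∷ 15 ∷ 16 ∷ 32 ∷ [])
    ∷ transform (32 ∷ 2 ∷ 16 ∷ 8 ∷ 1 ∷ 4 ∷ []) (16 ∷ 2 ∷ 32 ∷ 8 ∷ 4 ∷ 1 ∷ []) (1 ∷ 2 ∷ 4 ∷ 8 ∷ 15 ∷ 16 ∷ 32 ∷ [])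
    ∷ transform (32 ∷ 1 ∷ 2 ∷ 16 ∷ 8 ∷ 4 ∷ []) (2 ∷ 4 ∷ 32 ∷ 16 ∷ 8 ∷ 1 ∷ []) (1 ∷ 2 ∷ 4 ∷ 8 ∷ 16 ∷ 31 ∷ 32 ∷ [])
    ∷ transform (32 ∷ 16 ∷ 4 ∷ 8 ∷ 1 ∷ 2 ∷ []) (16 ∷ 32 ∷ 4 ∷ 8 ∷ 2 ∷ 1 ∷ []) (1 ∷ 2 ∷ 4 ∷ 8 ∷ 15 ∷ 16 ∷ 32 ∷ [])
    ∷ transform (32 ∷ 1 ∷ 16 ∷ 4 ∷ 8 ∷ 2 ∷ []) (2 ∷ 32 ∷ 8 ∷ 16 ∷ 4 ∷ 1 ∷ []) (1 ∷ 2 ∷ 4 ∷ 8 ∷ 16 ∷ 31 ∷ 32 ∷ [])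
    ∷ transform (32 ∷ 2 ∷ 16 ∷ 4 ∷ 8 ∷ 1 ∷ []) (32 ∷ 2 ∷ 8 ∷ 16 ∷ 4 ∷ 1 ∷ []) (1 ∷ 2 ∷ 4 ∷ 8 ∷ 16 ∷ 31 ∷ 32 ∷ [])
    ∷ transform (32 ∷ 1 ∷ 2 ∷ 16 ∷ 4 ∷ 8 ∷ []) (2 ∷ 4 ∷ 16 ∷ 32 ∷ 8 ∷ 1 ∷ []) (1 ∷ 2 ∷ 4 ∷ 8 ∷ 16 ∷ 32 ∷ 63 ∷ [])
    ∷ []) ∷
  node (1 ∷ 2 ∷ 4 ∷ 8 ∷ 15 ∷ 16 ∷ 32 ∷ [])
    ( plane 1 2 4
    ∷ plane 2 1 4
    ∷ plane 3 1 4
    ∷ plane 4 1 2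
    ∷ plane 5 1 2
    ∷ plane 6 1 2
    ∷ plane 7 1 2
    ∷ plane 8 16 32
    ∷ plane 9 1 32
    ∷ plane 10 2 16
    ∷ plane 11 4 32
    ∷ plane 12 4 32
    ∷ plane 13 2 32
    ∷ plane 14 1 32
    ∷ plane 15 1 32
    ∷ plane 16 1 32
    ∷ plane 17 1 32
    ∷ plane 18 1 2
    ∷ plane 19 1 2
    ∷ plane 20 4 8
    ∷ plane 21 1 4
    ∷ plane 22 2 4
    ∷ plane 23 7 8
    ∷ plane 24 8 32
    ∷ plane 25 1 8
    ∷ plane 26 2 8
    ∷ plane 27 4 11
    ∷ plane 28 4 8
    ∷ plane 29 2 13
    ∷ plane 30 1 14
    ∷ plane 31 15 32
    ∷ plane 32 1 16
    ∷ plane 33 1 16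
    ∷ plane 34 2 13
    ∷ plane 35 1 2
    ∷ plane 36 4 8
    ∷ plane 37 1 4
    ∷ plane 38 2 4
    ∷ plane 39 7 8
    ∷ plane 40 8 16
    ∷ plane 41 1 8
    ∷ plane 42 2 8
    ∷ plane 43 4 11
    ∷ plane 44 4 8
    ∷ plane 45 2 13
    ∷ plane 46 1 14
    ∷ plane 47 1 14
    ∷ plane 48 1 16
    ∷ plane 49 1 16
    ∷ plane 50 2 16
    ∷ transform (1 ∷ 2 ∷ 32 ∷ 16 ∷ 4 ∷ 8 ∷ []) (1 ∷ 2 ∷ 16 ∷ 32 ∷ 8 ∷ 4 ∷ []) (1 ∷ 2 ∷ 4 ∷ 8 ∷ 15 ∷ 16 ∷ 32 ∷ 51 ∷ [])
    ∷ plane 52 4 16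
    ∷ transform (1 ∷ 4 ∷ 32 ∷ 16 ∷ 2 ∷ 8 ∷ []) (1 ∷ 16 ∷ 2 ∷ 32 ∷ 8 ∷ 4 ∷ []) (1 ∷ 2 ∷ 4 ∷ 8 ∷ 15 ∷ 16 ∷ 32 ∷ 51 ∷ [])
    ∷ transform (2 ∷ 4 ∷ 32 ∷ 16 ∷ 1 ∷ 8 ∷ []) (16 ∷ 1 ∷ 2 ∷ 32 ∷ 8 ∷ 4 ∷ []) (1 ∷ 2 ∷ 4 ∷ 8 ∷ 15 ∷ 16 ∷ 32 ∷ 51 ∷ [])
    ∷ transform (8 ∷ 15 ∷ 32 ∷ 16 ∷ 1 ∷ 2 ∷ []) (16 ∷ 32 ∷ 51 ∷ 1 ∷ 8 ∷ 4 ∷ []) (1 ∷ 2 ∷ 4 ∷ 8 ∷ 15 ∷ 16 ∷ 32 ∷ 51 ∷ [])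
    ∷ plane 56 8 16
    ∷ transform (1 ∷ 8 ∷ 32 ∷ 16 ∷ 2 ∷ 4 ∷ []) (1 ∷ 16 ∷ 32 ∷ 2 ∷ 8 ∷ 4 ∷ []) (1 ∷ 2 ∷ 4 ∷ 8 ∷ 15 ∷ 16 ∷ 32 ∷ 51 ∷ [])
    ∷ transform (2 ∷ 8 ∷ 32 ∷ 16 ∷ 1 ∷ 4 ∷ []) (16 ∷ 1 ∷ 32 ∷ 2 ∷ 8 ∷ 4 ∷ []) (1 ∷ 2 ∷ 4 ∷ 8 ∷ 15 ∷ 16 ∷ 32 ∷ 51 ∷ [])
    ∷ transform (4 ∷ 15 ∷ 32 ∷ 16 ∷ 1 ∷ 2 ∷ []) (16 ∷ 32 ∷ 1 ∷ 51 ∷ 8 ∷ 4 ∷ []) (1 ∷ 2 ∷ 4 ∷ 8 ∷ 15 ∷ 16 ∷ 32 ∷ 51 ∷ [])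
    ∷ transform (4 ∷ 8 ∷ 32 ∷ 16 ∷ 1 ∷ 2 ∷ []) (16 ∷ 32 ∷ 1 ∷ 2 ∷ 8 ∷ 4 ∷ []) (1 ∷ 2 ∷ 4 ∷ 8 ∷ 15 ∷ 16 ∷ 32 ∷ 51 ∷ [])
    ∷ transform (2 ∷ 15 ∷ 32 ∷ 16 ∷ 1 ∷ 4 ∷ []) (16 ∷ 1 ∷ 32 ∷ 51 ∷ 8 ∷ 4 ∷ []) (1 ∷ 2 ∷ 4 ∷ 8 ∷ 15 ∷ 16 ∷ 32 ∷ 51 ∷ [])
    ∷ transform (1 ∷ 15 ∷ 32 ∷ 16 ∷ 2 ∷ 4 ∷ []) (1 ∷ 16 ∷ 32 ∷ 51 ∷ 8 ∷ 4 ∷ []) (1 ∷ 2 ∷ 4 ∷ 8 ∷ 15 ∷ 16 ∷ 32 ∷ 51 ∷ [])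
    ∷ plane 63 15 16
    ∷ []) ∷
  node (1 ∷ 2 ∷ 4 ∷ 8 ∷ 16 ∷ 31 ∷ 32 ∷ [])
    ( plane 1 2 4
    ∷ plane 2 1 4
    ∷ plane 3 1 4
    ∷ plane 4 1 2
    ∷ plane 5 1 2
    ∷ plane 6 1 2
    ∷ plane 7 1 2
    ∷ plane 8 1 31
    ∷ plane 9 1 22
    ∷ plane 10 2 21
    ∷ plane 11 4 16
    ∷ plane 12 4 32
    ∷ plane 13 1 4
    ∷ plane 14 1 16
    ∷ plane 15 16 32
    ∷ plane 16 1 32
    ∷ plane 17 1 32
    ∷ plane 18 1 2
    ∷ plane 19 1 2
    ∷ plane 20 4 8
    ∷ plane 21 2 8
    ∷ plane 22 1 8
    ∷ plane 23 1 8
    ∷ plane 24 8 32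
    ∷ plane 25 2 4
    ∷ plane 26 2 8
    ∷ plane 27 1 4
    ∷ plane 28 1 2
    ∷ plane 29 2 8
    ∷ plane 30 1 8
    ∷ plane 31 1 8
    ∷ plane 32 1 16
    ∷ plane 33 1 16
    ∷ plane 34 2 8
    ∷ plane 35 1 2
    ∷ plane 36 4 8
    ∷ plane 37 1 4
    ∷ plane 38 2 4
    ∷ transform (32 ∷ 39 ∷ 1 ∷ 2 ∷ 16 ∷ 8 ∷ []) (4 ∷ 8 ∷ 15 ∷ 32 ∷ 16 ∷ 1 ∷ []) (1 ∷ 2 ∷ 4 ∷ 8 ∷ 15 ∷ 16 ∷ 32 ∷ 51 ∷ [])
    ∷ plane 40 8 16
    ∷ plane 41 1 8
    ∷ plane 42 2 8
    ∷ transform (32 ∷ 43 ∷ 1 ∷ 2 ∷ 16 ∷ 4 ∷ []) (4 ∷ 8 ∷ 32 ∷ 15 ∷ 16 ∷ 1 ∷ []) (1 ∷ 2 ∷ 4 ∷ 8 ∷ 15 ∷ 16 ∷ 32 ∷ 51 ∷ [])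
    ∷ plane 44 4 8
    ∷ transform (32 ∷ 45 ∷ 1 ∷ 4 ∷ 2 ∷ 16 ∷ []) (4 ∷ 16 ∷ 8 ∷ 15 ∷ 32 ∷ 1 ∷ []) (1 ∷ 2 ∷ 4 ∷ 8 ∷ 15 ∷ 16 ∷ 32 ∷ 51 ∷ [])
    ∷ transform (32 ∷ 46 ∷ 1 ∷ 16 ∷ 2 ∷ 4 ∷ []) (4 ∷ 16 ∷ 32 ∷ 51 ∷ 8 ∷ 1 ∷ []) (1 ∷ 2 ∷ 4 ∷ 8 ∷ 15 ∷ 16 ∷ 32 ∷ 51 ∷ [])
    ∷ plane 47 15 16
    ∷ plane 48 1 16
    ∷ plane 49 1 16
    ∷ plane 50 2 16
    ∷ transform (32 ∷ 51 ∷ 1 ∷ 2 ∷ 4 ∷ 8 ∷ []) (4 ∷ 8 ∷ 16 ∷ 32 ∷ 15 ∷ 1 ∷ []) (1 ∷ 2 ∷ 4 ∷ 8 ∷ 15 ∷ 16 ∷ 32 ∷ 51 ∷ [])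
    ∷ plane 52 4 16
    ∷ transform (32 ∷ 53 ∷ 1 ∷ 16 ∷ 2 ∷ 8 ∷ []) (4 ∷ 16 ∷ 15 ∷ 32 ∷ 8 ∷ 1 ∷ []) (1 ∷ 2 ∷ 4 ∷ 8 ∷ 15 ∷ 16 ∷ 32 ∷ 51 ∷ [])
    ∷ transform (32 ∷ 54 ∷ 1 ∷ 8 ∷ 2 ∷ 16 ∷ []) (4 ∷ 16 ∷ 51 ∷ 8 ∷ 32 ∷ 1 ∷ []) (1 ∷ 2 ∷ 4 ∷ 8 ∷ 15 ∷ 16 ∷ 32 ∷ 51 ∷ [])
    ∷ plane 55 8 23
    ∷ plane 56 8 16
    ∷ transform (32 ∷ 57 ∷ 1 ∷ 16 ∷ 2 ∷ 4 ∷ []) (4 ∷ 16 ∷ 32 ∷ 15 ∷ 8 ∷ 1 ∷ []) (1 ∷ 2 ∷ 4 ∷ 8 ∷ 15 ∷ 16 ∷ 32 ∷ 51 ∷ [])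
    ∷ transform (32 ∷ 58 ∷ 1 ∷ 4 ∷ 2 ∷ 16 ∷ []) (4 ∷ 16 ∷ 8 ∷ 51 ∷ 32 ∷ 1 ∷ []) (1 ∷ 2 ∷ 4 ∷ 8 ∷ 15 ∷ 16 ∷ 32 ∷ 51 ∷ [])
    ∷ plane 59 4 27
    ∷ transform (32 ∷ 60 ∷ 1 ∷ 2 ∷ 16 ∷ 4 ∷ []) (4 ∷ 8 ∷ 32 ∷ 51 ∷ 16 ∷ 1 ∷ []) (1 ∷ 2 ∷ 4 ∷ 8 ∷ 15 ∷ 16 ∷ 32 ∷ 51 ∷ [])
    ∷ plane 61 2 29
    ∷ plane 62 1 30
    ∷ plane 63 1 30
    ∷ []) ∷
  node (1 ∷ 2 ∷ 4 ∷ 8 ∷ 16 ∷ 32 ∷ 63 ∷ [])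
    ( plane 1 2 4
    ∷ plane 2 1 4
    ∷ plane 3 1 4
    ∷ plane 4 1 2
    ∷ plane 5 1 2
    ∷ plane 6 1 2
    ∷ plane 7 1 2
    ∷ plane 8 16 32
    ∷ plane 9 1 32
    ∷ plane 10 2 16
    ∷ plane 11 1 2
    ∷ plane 12 4 32
    ∷ plane 13 1 4
    ∷ plane 14 2 4
    ∷ plane 15 16 32
    ∷ plane 16 1 32
    ∷ plane 17 1 32
    ∷ plane 18 1 2
    ∷ plane 19 1 2
    ∷ plane 20 4 43
    ∷ plane 21 1 4
    ∷ plane 22 2 4
    ∷ plane 23 8 32
    ∷ plane 24 8 32
    ∷ plane 25 1 8
    ∷ plane 26 2 8
    ∷ plane 27 4 32
    ∷ plane 28 4 8
    ∷ plane 29 2 32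
    ∷ plane 30 1 32
    ∷ plane 31 1 32
    ∷ plane 32 1 16
    ∷ plane 33 1 16
    ∷ plane 34 2 8
    ∷ plane 35 1 2
    ∷ plane 36 4 8
    ∷ plane 37 1 4
    ∷ plane 38 2 4
    ∷ plane 39 8 16
    ∷ plane 40 8 16
    ∷ plane 41 1 8
    ∷ plane 42 2 8
    ∷ plane 43 4 16
    ∷ plane 44 4 8
    ∷ plane 45 2 16
    ∷ plane 46 1 16
    ∷ plane 47 4 16
    ∷ plane 48 1 16
    ∷ plane 49 1 16
    ∷ plane 50 2 16
    ∷ plane 51 4 8
    ∷ plane 52 4 16
    ∷ plane 53 2 8
    ∷ plane 54 1 8
    ∷ plane 55 2 8
    ∷ plane 56 8 16
    ∷ plane 57 2 4
    ∷ plane 58 1 4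
    ∷ plane 59 2 4
    ∷ plane 60 1 2
    ∷ plane 61 1 2
    ∷ plane 62 1 2
    ∷ plane 63 1 2
    ∷ []) ∷
  node (1 ∷ 2 ∷ 4 ∷ 8 ∷ 15 ∷ 16 ∷ 32 ∷ 51 ∷ [])
    ( plane 1 2 4
    ∷ plane 2 1 4
    ∷ plane 3 1 4
    ∷ plane 4 1 2
    ∷ plane 5 1 2
    ∷ plane 6 1 2
    ∷ plane 7 1 2
    ∷ plane 8 32 51
    ∷ plane 9 1 32
    ∷ plane 10 2 49
    ∷ plane 11 4 32
    ∷ plane 12 4 32
    ∷ plane 13 2 49
    ∷ plane 14 1 32
    ∷ plane 15 1 32
    ∷ plane 16 1 32
    ∷ plane 17 1 32
    ∷ plane 18 1 2
    ∷ plane 19 8 32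
    ∷ plane 20 4 35
    ∷ plane 21 1 4
    ∷ plane 22 2 4
    ∷ plane 23 4 32
    ∷ plane 24 8 32
    ∷ plane 25 1 8
    ∷ plane 26 2 8
    ∷ plane 27 8 32
    ∷ plane 28 15 32
    ∷ plane 29 2 13
    ∷ plane 30 1 14
    ∷ plane 31 15 32
    ∷ plane 32 1 16
    ∷ plane 33 1 16
    ∷ plane 34 2 17
    ∷ plane 35 4 16
    ∷ plane 36 4 8
    ∷ plane 37 1 4
    ∷ plane 38 2 4
    ∷ plane 39 4 16
    ∷ plane 40 8 19
    ∷ plane 41 1 8
    ∷ plane 42 2 8
    ∷ plane 43 4 11
    ∷ plane 44 4 8
    ∷ plane 45 2 13
    ∷ plane 46 1 14
    ∷ plane 47 1 14
    ∷ plane 48 1 16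
    ∷ plane 49 1 16
    ∷ plane 50 1 2
    ∷ plane 51 8 32
    ∷ plane 52 7 8
    ∷ plane 53 2 4
    ∷ plane 54 1 4
    ∷ plane 55 2 4
    ∷ plane 56 8 16
    ∷ plane 57 2 8
    ∷ plane 58 1 8
    ∷ plane 59 8 19
    ∷ plane 60 2 13
    ∷ plane 61 1 14
    ∷ plane 62 2 13
    ∷ plane 63 15 16
    ∷ []) ∷
  []

lowerBound : Admissible 5 2 3 (indicator S₈) × totalMult (indicator S₈) ≡ 8
lowerBound = indicator-admissible S₈ S₈-lineFree S₈-quadrangleFree , refl

upperBound : (M : Multiset 5) → Admissible 5 2 3 M → totalMult M ≤ 8
upperBound = certified⇒bounded (toWitness {a? = certified? searchTree} tt)

mainTheorem14 : IsM2 2 5 3 8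
mainTheorem14 = (indicator S₈ , lowerBound) , upperBound
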